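{- Let $l,m,n\ge 0$ be integers and let $\Sigma=\big((+K_l)\vee_{ - }(+K_m)\big)\vee_{+}(-K_n)$. Then \[ \mathsf E(\Sigma,x)=H_4(l,m,n,x), \] \[ \mathsf O(\Sigma,x)=\mathsf E(\Sigma,x-1)+l\,H_4(l-1,m,n,x-1)+m\,H_4(l,m-1,n,x-1)+n\,H_4(l,m,n-1,x-1). \]
   Context: A signed graph $\Sigma=(\Gamma,\sigma)$ is a finite simple graph $\Gamma$ with a signature $\sigma:E(\Gamma)\to\{\pm1\}$. $+K_n$ (resp. $-K_n$) is the complete graph on $n$ vertices with all edges positive (resp. negative); $K_0$ is empty. For signed graphs $\Sigma_1,\Sigma_2$ on disjoint vertex sets, the all-positive join $\Sigma_1\vee_{+}\Sigma_2$ (resp. all-negative join $\Sigma_1\vee_{ - }\Sigma_2$) is obtained from their disjoint union by joining every vertex of $\Sigma_1$ to every vertex of $\Sigma_2$ by a positive (resp. negative) edge. For an integer $\lambda\ge 0$, let $C_\lambda$ be the set of nonzero integers in $[-\lambda/2,\lambda/2]$ if $\lambda$ is even, and the set of integers in $[-(\lambda-1)/2,(\lambda-1)/2]$ if $\lambda$ is odd. A proper $C_\lambda$-colouring of $\Sigma$ is a map $\kappa:V(\Gamma)\to C_\lambda$ with $\kappa(v)\ne\sigma(\{v,w\})\kappa(w)$ for every edge $\{v,w\}$; $f(\Sigma,\lambda)$ denotes their number. $\mathsf E(\Sigma,x),\mathsf O(\Sigma,x)\in\mathbb Z[x]$ are the unique polynomials with $f(\Sigma,\lambda)=\mathsf E(\Sigma,\lambda)$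 for all even $\lambda\ge0$ and $f(\Sigma,\lambda)=\mathsf O(\Sigma,\lambda)$ for all odd $\lambda\ge0$. Notation: $(x)_n=\prod_{j=0}^{n-1}(x-j)$, ${}_2(x)_n=\prod_{j=0}^{n-1}(x-2j)$ (both $1$ for $n=0$); $S(n,k)$ is the Stirling number of the second kind ($S(0,0)=1$); for $n\ge2k\ge0$, $T(n,k)=\frac{(n)_{2k}}{2^k k!}$. For integers with $l+m+s-i-j-k\ge t\ge0$ put $U_x(i,j,k,l,m,s,t)={}_2(x)_{l+m+s-i-j-k-t}\,(l+m-i-2j-2k)_t$. For integers $l,m,n\ge0$, \[ H_4(l,m,n,x)=\sum_{i=0}^{\min(l,m)}\sum_{j=0}^{\lfloor (l-i)/2\rfloor}\sum_{k=0}^{\lfloor (m-i)/2\rfloor}\sum_{s=0}^{n}\sum_{t=0}^{s} i!\binom{l}{i}\binom{m}{i}\binom{s}{t}S(n,s)\,T(l-i,j)\,T(m-i,k)\,U_x(i,j,k,l,m,s,t), \] and $H_4(l,m,n,x)=0$ if any of $l,m,n$ is negative. -}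

module Defs where

open import Data.Nat as ℕ using (ℕ; zero; suc; _∸_; _!; _%_; _/_)
open import Data.Nat.Properties using (m^n≢0; m*n≢0; _!≢0)
open import Data.Nat.Combinatorics using (_C_)
open import Data.Integer as ℤ using (ℤ; +_; -[1+_]; _+_; _-_; _*_; ∣_∣)
import Data.Integer.Properties as ℤP
open import Data.Fin using (Fin; splitAt)
open import Data.Fin.Properties using (all?)
import Data.Fin as Fin
open import Data.Vec using (Vec; []; _∷_; lookup)
open import Data.List using (List; []; _∷_; [_]; map; concatMap; filter; length; upTo; foldr)
open import Data.Maybe using (Maybe; just; nothing)
open import Data.Sum using (_⊎_; inj₁; inj₂)
open import Data.Product using (_×_)
open import Data.Unit using (⊤)
open import Relation.Nullary using (Dec; yes; no; ¬_)
open import Relation.Nullary.Decidable using (_×-dec_; _⊎-dec_; ¬?)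
open import Relation.Binary.PropositionalEquality using (_≡_; _≢_)

data Sign : Set where
  pos neg : Sign

⟦_⟧ : Sign → ℤ
⟦ pos ⟧ = + 1
⟦ neg ⟧ = -[1+ 0 ]

-- A signed graph on the vertex set Fin N: `E i j = nothing` means no
-- edge between i and j, `E i j = just s` means an edge of sign s.
-- It is a simple graph when E is symmetric and loopless.
SGraph : ℕ → Set
SGraph N = Fin N → Fin N → Maybe Sign

IsSimple : ∀ {N} → SGraph N → Set
IsSimple {N} E = (∀ (i j : Fin N) → E i j ≡ E j i) × (∀ (i : Fin N) → E i i ≡ nothing)

-- complete graph with all edges of sign s:  +K_n = K pos n, -K_n = K neg n
K : Sign → (n : ℕ) → SGraph n
K s n i j with i Fin.≟ j
... | yes _ = nothing
... | no _  = just s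

-- join with all connecting edges of sign s (vertices of Σ₁ first)
join : ∀ {a b} → Sign → SGraph a → SGraph b → SGraph (a ℕ.+ b)
join {a} s E₁ E₂ i j with splitAt a i | splitAt a j
... | inj₁ x | inj₁ y = E₁ x y
... | inj₂ x | inj₂ y = E₂ x y
... | inj₁ _ | inj₂ _ = just s
... | inj₂ _ | inj₁ _ = just s

Σgraph : (l m n : ℕ) → SGraph ((l ℕ.+ m) ℕ.+ n)
Σgraph l m n = join pos (join neg (K pos l) (K pos m)) (K neg n)

InC : ℕ → ℤ → Set
InC λ′ z = (λ′ % 2 ≡ 0 × z ≢ + 0 × 2 ℕ.* ∣ z ∣ ℕ.≤ λ′)
         ⊎ (λ′ % 2 ≡ 1 × 2 ℕ.* ∣ z ∣ ℕ.≤ λ′ ∸ 1)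

InC? : ∀ λ′ z → Dec (InC λ′ z)
InC? λ′ z = ((λ′ % 2 ℕ.≟ 0) ×-dec (¬? (z ℤ.≟ + 0)) ×-dec (2 ℕ.* ∣ z ∣ ℕ.≤? λ′))
          ⊎-dec ((λ′ % 2 ℕ.≟ 1) ×-dec (2 ℕ.* ∣ z ∣ ℕ.≤? λ′ ∸ 1))

range : ℕ → List ℤ
range λ′ = map (λ i → + i - + λ′) (upTo (suc (2 ℕ.* λ′)))

-- C_λ as a (duplicate-free) list: the integers of [-λ,λ] lying in C_λ
Cλ : ℕ → List ℤ
Cλ λ′ = filter (InC? λ′) (range λ′)

allVecs : ∀ {A : Set} → List A → (N : ℕ) → List (Vec A N)
allVecs xs zero = [ [] ]
allVecs xs (suc N) = concatMap (λ x → map (x ∷_) (allVecs xs N)) xs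

EdgeOK : Maybe Sign → ℤ → ℤ → Set
EdgeOK nothing  a b = ⊤
EdgeOK (just s) a b = a ≢ ⟦ s ⟧ * b

EdgeOK? : ∀ e a b → Dec (EdgeOK e a b)
EdgeOK? nothing  a b = yes _
EdgeOK? (just s) a b = ¬? (a ℤ.≟ ⟦ s ⟧ * b)

Proper : ∀ {N} → SGraph N → Vec ℤ N → Set
Proper E κ = ∀ i j → EdgeOK (E i j) (lookup κ i) (lookup κ j)

Proper? : ∀ {N} (E : SGraph N) (κ : Vec ℤ N) → Dec (Proper E κ)
Proper? E κ = all? (λ i → all? (λ j → EdgeOK? (E i j) (lookup κ i) (lookup κ j)))

f : ∀ {N} → SGraph N → ℕ → ℕ
f {N} E λ′ = length (filter (Proper? E) (allVecs (Cλ λ′) N))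

sumTo : ℕ → (ℕ → ℤ) → ℤ
sumTo n g = foldr (λ i acc → g i + acc) (+ 0) (upTo (suc n))

falling : ℤ → ℕ → ℤ
falling x zero = + 1
falling x (suc n) = falling x n * (x - + n)

falling2 : ℤ → ℕ → ℤ
falling2 x zero = + 1
falling2 x (suc n) = falling2 x n * (x - + (2 ℕ.* n))

S : ℕ → ℕ → ℕ
S zero zero = 1
S zero (suc k) = 0
S (suc n) zero = 0
S (suc n) (suc k) = suc k ℕ.* S n (suc k) ℕ.+ S n k

fallingℕ : ℕ → ℕ → ℕ
fallingℕ n zero = 1
fallingℕ n (suc m) = fallingℕ n m ℕ.* (n ∸ m)

-- T(n,k) = (n)_{2k} / (2^k k!)   (used only for n ≥ 2k, where it is exact)
T : ℕ → ℕ → ℕ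
T n k = (fallingℕ n (2 ℕ.* k) / (2 ℕ.^ k ℕ.* k !))
          {{m*n≢0 (2 ℕ.^ k) (k !) {{m^n≢0 2 k}} {{k !≢0}}}}

-- U_x(i,j,k,l,m,s,t) = ₂(x)_{l+m+s-i-j-k-t} (l+m-i-2j-2k)_t
-- (the index conditions of the paper guarantee both subtractions are exact
--  in the range where U is used; the second factor is computed in ℤ)
U : ℤ → (i j k l m s t : ℕ) → ℤ
U x i j k l m s t =
  falling2 x ((l ℕ.+ m ℕ.+ s) ∸ (i ℕ.+ j ℕ.+ k ℕ.+ t))
  * falling (+ (l ℕ.+ m) - + i - + (2 ℕ.* j) - + (2 ℕ.* k)) t

H4ℕ : ℕ → ℕ → ℕ → ℤ → ℤ
H4ℕ l m n x =
  sumTo (l ℕ.⊓ m) λ i →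
  sumTo ((l ∸ i) / 2) λ j →
  sumTo ((m ∸ i) / 2) λ k →
  sumTo n λ s →
  sumTo s λ t →
    + (i ! ℕ.* (l C i) ℕ.* (m C i) ℕ.* (s C t) ℕ.* S n s
         ℕ.* T (l ∸ i) j ℕ.* T (m ∸ i) k)
    * U x i j k l m s t

-- H4 with integer arguments; 0 if any of l, m, n is negative
H4 : ℤ → ℤ → ℤ → ℤ → ℤ
H4 (+ l) (+ m) (+ n) x = H4ℕ l m n x
H4 _ _ _ x = + 0

{-# OPTIONS --safe #-}
-- Colour the vertices one at a time: the l vertices of +K_l (part A), then the m of +K_m (B), then
-- the n of -K_n (N). As Σ is complete, whether a colour x is still allowed for the next vertex only
-- depends on which parts already use x and which use -x. For a colour set closed under negation and
-- without 0 (λ even) the number of completions is therefore a polynomial in a few counts of colours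
-- (untouched pairs {c, -c}, colours of A-vertices still allowed to B, colours opposite to a B-colour,
-- colours allowed to N whose opposite is not), given by the recurrences polyA, polyB and polyN.
-- Solving them brings in matchings (pairs c, -c inside a positive clique), falling factorials
-- (colours shared by A and B) and Stirling numbers (classes of equal colour in -K_n); expanding
-- gives H4. For odd λ the extra colour 0 clashes with itself, so at most one vertex takes it, and
-- removing that vertex leaves a graph of the same shape with one part smaller.

module Submission where

module RangeSum where

  open import Data.Nat as ℕ using (ℕ; zero; suc; z≤n; s≤s)
  import Data.Nat.Properties as ℕP
  open import Data.Integer using (ℤ; +_; _+_; _*_)
  import Data.Integer.Properties as ℤP
  open import Data.Integer.Tactic.RingSolver using (solve-∀)
  open import Data.List using (foldr; applyUpTo)
  open import Function using (id; _∘_)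
  open import Relation.Binary.PropositionalEquality
  open import Defs using (sumTo)

  ∑< : ℕ → (ℕ → ℤ) → ℤ
  ∑< zero    g = + 0
  ∑< (suc n) g = g 0 + ∑< n (g ∘ suc)

  ∑≤ : ℕ → (ℕ → ℤ) → ℤ
  ∑≤ n = ∑< (suc n)

  infixl 10 ∑< ∑≤
  syntax ∑< n (λ i → e) = ∑[ i < n ] e
  syntax ∑≤ n (λ i → e) = ∑[ i ≤ n ] e

  ∑-cong< : ∀ n {g h : ℕ → ℤ} → (∀ i → i ℕ.< n → g i ≡ h i) → ∑< n g ≡ ∑< n h
  ∑-cong< zero    eq = refl
  ∑-cong< (suc n) eq = cong₂ _+_ (eq 0 (s≤s z≤n)) (∑-cong< n (λ i i<n → eq (suc i) (s≤s i<n)))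

  ∑-cong : ∀ n {g h : ℕ → ℤ} → (∀ i → g i ≡ h i) → ∑< n g ≡ ∑< n h
  ∑-cong n eq = ∑-cong< n (λ i _ → eq i)

  ∑-zero : ∀ n {g : ℕ → ℤ} → (∀ i → i ℕ.< n → g i ≡ + 0) → ∑< n g ≡ + 0
  ∑-zero zero    eq = refl
  ∑-zero (suc n) eq = cong₂ _+_ (eq 0 (s≤s z≤n)) (∑-zero n (λ i i<n → eq (suc i) (s≤s i<n)))

  ∑-distrib-+ : ∀ n (g h : ℕ → ℤ) → ∑[ i < n ] (g i + h i) ≡ ∑< n g + ∑< n h
  ∑-distrib-+ zero    g h = refl
  ∑-distrib-+ (suc n) g h =
    trans (cong (_+_ (g 0 + h 0)) (∑-distrib-+ n (g ∘ suc) (h ∘ suc))) (interchange (g 0) (h 0) _ _)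
    where
    interchange : ∀ a b c d → a + b + (c + d) ≡ a + c + (b + d)
    interchange = solve-∀

  record Additive (f : ℤ → ℤ) : Set where
    field
      preserves-+ : ∀ u v → f (u + v) ≡ f u + f v
      preserves-0 : f (+ 0) ≡ + 0

  ∑-additive : ∀ {f} → Additive f → ∀ n (g : ℕ → ℤ) → f (∑< n g) ≡ ∑[ i < n ] f (g i)
  ∑-additive f-add zero    g = Additive.preserves-0 f-add
  ∑-additive {f} f-add (suc n) g =
    trans (Additive.preserves-+ f-add (g 0) _) (cong (_+_ (f (g 0))) (∑-additive f-add n (g ∘ suc)))

  *-additive : ∀ c → Additive (c *_)
  *-additive c = record { preserves-+ = ℤP.*-distribˡ-+ c ; preserves-0 = ℤP.*-zeroʳ c }

  ∘-additive : ∀ {f g} → Additive f → Additive g → Additive (f ∘ g)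
  ∘-additive {f} {g} f-add g-add = record
    { preserves-+ = λ u v → trans (cong f (Additive.preserves-+ g-add u v)) (Additive.preserves-+ f-add (g u) (g v))
    ; preserves-0 = trans (cong f (Additive.preserves-0 g-add)) (Additive.preserves-0 f-add)
    }

  *-distribˡ-∑ : ∀ n c (g : ℕ → ℤ) → c * ∑< n g ≡ ∑[ i < n ] (c * g i)
  *-distribˡ-∑ n c = ∑-additive (*-additive c) n

  ∑-init-last : ∀ n (g : ℕ → ℤ) → ∑< (suc n) g ≡ ∑< n g + g n
  ∑-init-last zero    g = ℤP.+-comm (g 0) (+ 0)
  ∑-init-last (suc n) g =
    trans (cong (_+_ (g 0)) (∑-init-last n (g ∘ suc))) (sym (ℤP.+-assoc (g 0) _ _))

  ∑-dropHead : ∀ n (g : ℕ → ℤ) → g 0 ≡ + 0 → ∑< (suc n) g ≡ ∑[ i < n ] g (suc i)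
  ∑-dropHead n g g0≡0 = trans (cong (_+ ∑< n (g ∘ suc)) g0≡0) (ℤP.+-identityˡ _)

  ∑-dropLast : ∀ n (g : ℕ → ℤ) → g n ≡ + 0 → ∑< (suc n) g ≡ ∑< n g
  ∑-dropLast n g gn≡0 =
    trans (∑-init-last n g) (trans (cong (_+_ (∑< n g)) gn≡0) (ℤP.+-identityʳ _))

  ∑-comm : ∀ a b (g : ℕ → ℕ → ℤ) → ∑[ i < a ] ∑[ j < b ] g i j ≡ ∑[ j < b ] ∑[ i < a ] g i j
  ∑-comm zero    b g = sym (∑-zero b (λ _ _ → refl))
  ∑-comm (suc a) b g =
    trans (cong (_+_ (∑< b (g 0))) (∑-comm a b (g ∘ suc)))
          (sym (∑-distrib-+ b (g 0) (λ j → ∑[ i < a ] g (suc i) j)))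

  ∑-pad : ∀ n d (g : ℕ → ℤ) → (∀ i → n ℕ.≤ i → g i ≡ + 0) → ∑< (n ℕ.+ d) g ≡ ∑< n g
  ∑-pad zero    d g out = ∑-zero d (λ i _ → out i z≤n)
  ∑-pad (suc n) d g out = cong (_+_ (g 0)) (∑-pad n d (g ∘ suc) (λ i n≤i → out (suc i) (s≤s n≤i)))

  ∑-extend : ∀ {n N} (g : ℕ → ℤ) → n ℕ.≤ N → (∀ i → n ℕ.≤ i → g i ≡ + 0) → ∑< N g ≡ ∑< n g
  ∑-extend {n} {N} g n≤N out =
    trans (cong (λ N′ → ∑< N′ g) (sym (ℕP.m+[n∸m]≡n n≤N))) (∑-pad n (N ℕ.∸ n) g out)

  ∑-box : ∀ N (Z : ℕ → ℕ → ℕ → ℤ) a (b : ℕ → ℕ) (c : ℕ → ℕ → ℕ) →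
    a ℕ.< N → (∀ i → b i ℕ.< N) → (∀ i j → c i j ℕ.< N) →
    (∀ i j k → a ℕ.< i → Z i j k ≡ + 0) → (∀ i j k → b i ℕ.< j → Z i j k ≡ + 0) →
    (∀ i j k → c i j ℕ.< k → Z i j k ≡ + 0) →
    ∑[ i ≤ a ] ∑[ j ≤ b i ] ∑[ k ≤ c i j ] Z i j k ≡ ∑[ i < N ] ∑[ j < N ] ∑[ k < N ] Z i j k
  ∑-box N Z a b c a<N b<N c<N outᵢ outⱼ outₖ = sym (begin
    ∑[ i < N ] ∑[ j < N ] ∑[ k < N ] Z i j k
      ≡⟨ ∑-extend _ a<N (λ i a<i → ∑-zero N (λ j _ → ∑-zero N (λ k _ → outᵢ i j k a<i))) ⟩
    ∑[ i ≤ a ] ∑[ j < N ] ∑[ k < N ] Z i j k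
      ≡⟨ ∑-cong (suc a) (λ i → ∑-extend _ (b<N i) (λ j b<j → ∑-zero N (λ k _ → outⱼ i j k b<j))) ⟩
    ∑[ i ≤ a ] ∑[ j ≤ b i ] ∑[ k < N ] Z i j k
      ≡⟨ ∑-cong (suc a) (λ i → ∑-cong (suc (b i)) (λ j → ∑-extend _ (c<N i j) (outₖ i j))) ⟩
    ∑[ i ≤ a ] ∑[ j ≤ b i ] ∑[ k ≤ c i j ] Z i j k ∎)
    where open ≡-Reasoning

  sumTo≡∑≤ : ∀ n g → sumTo n g ≡ ∑≤ n g
  sumTo≡∑≤ n g = foldr-applyUpTo (suc n) id
    where
    foldr-applyUpTo : ∀ k (f : ℕ → ℕ) →
      foldr (λ i acc → g i + acc) (+ 0) (applyUpTo f k) ≡ ∑[ i < k ] g (f i)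
    foldr-applyUpTo zero    f = refl
    foldr-applyUpTo (suc k) f = cong (_+_ (g (f 0))) (foldr-applyUpTo k (f ∘ suc))


module Factorials where

  open import Data.Nat as ℕ
    using (ℕ; zero; suc; z≤n; s≤s; _∸_; _^_; _!; NonZero)
  open import Data.Nat.Properties as ℕP using (_!≢0; m^n≢0; m*n≢0)
  open import Data.Nat.Combinatorics using (_C_; nCk+nC[k+1]≡[n+1]C[k+1]; k>n⇒nCk≡0)
  open import Data.Nat.DivMod using (_/_; m*n/n≡m)
  open import Data.Integer using (+_; _+_; _-_; _*_)
  import Data.Integer.Properties as ℤP
  import Data.Nat.Tactic.RingSolver as ℕSolver
  open import Data.Integer.Tactic.RingSolver using (solve-∀)
  open import Relation.Binary.PropositionalEquality
  open import Relation.Nullary using (yes; no)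
  open import Defs using (falling; falling2; fallingℕ; T)

  2*n≡n+n : ∀ n → 2 ℕ.* n ≡ n ℕ.+ n
  2*n≡n+n n = cong (n ℕ.+_) (ℕP.+-identityʳ n)

  pos-∸ : ∀ {a b} → b ℕ.≤ a → + (a ∸ b) ≡ + a - + b
  pos-∸ {a} {b} b≤a = sym (trans (ℤP.m-n≡m⊖n a b) (ℤP.⊖-≥ b≤a))

  falling-unfoldˡ : ∀ x n → falling x (suc n) ≡ x * falling (x - + 1) n
  falling-unfoldˡ x zero    = base x
    where
    base : ∀ x → + 1 * (x - + 0) ≡ x * + 1
    base = solve-∀
  falling-unfoldˡ x (suc n) =
    trans (cong (_* (x - + suc n)) (falling-unfoldˡ x n)) (shift x (falling (x - + 1) n) (+ n))
    where
    shift : ∀ x F n → x * F * (x - (+ 1 + n)) ≡ x * (F * (x - + 1 - n))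
    shift = solve-∀

  falling2-unfoldˡ : ∀ x n → falling2 x (suc n) ≡ x * falling2 (x - + 2) n
  falling2-unfoldˡ x zero    = base x
    where
    base : ∀ x → + 1 * (x - + 0) ≡ x * + 1
    base = solve-∀
  falling2-unfoldˡ x (suc n) = begin
    falling2 x (suc n) * (x - + (2 ℕ.* suc n))   ≡⟨ cong₂ (λ F d → F * (x - d)) (falling2-unfoldˡ x n)
                                                          (cong +_ (ℕP.*-suc 2 n)) ⟩
    x * falling2 (x - + 2) n * (x - (+ 2 + + (2 ℕ.* n)))
                                                  ≡⟨ shift x (falling2 (x - + 2) n) (+ (2 ℕ.* n)) ⟩
    x * falling2 (x - + 2) (suc n)                ∎
    where
    open ≡-Reasoning
    shift : ∀ x F n → x * F * (x - (+ 2 + n)) ≡ x * (F * (x - + 2 - n))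
    shift = solve-∀

  falling2-+ : ∀ x a b → falling2 x (a ℕ.+ b) ≡ falling2 x a * falling2 (x - + (2 ℕ.* a)) b
  falling2-+ x zero    b = trans (cong (λ y → falling2 y b) (sym (ℤP.+-identityʳ x))) (sym (ℤP.*-identityˡ _))
  falling2-+ x (suc a) b = begin
    falling2 x (suc (a ℕ.+ b))
      ≡⟨ falling2-unfoldˡ x (a ℕ.+ b) ⟩
    x * falling2 (x - + 2) (a ℕ.+ b)
      ≡⟨ cong (x *_) (falling2-+ (x - + 2) a b) ⟩
    x * (falling2 (x - + 2) a * falling2 (x - + 2 - + (2 ℕ.* a)) b)
      ≡⟨ cong (λ y → x * (falling2 (x - + 2) a * falling2 y b)) shift ⟩
    x * (falling2 (x - + 2) a * falling2 (x - + (2 ℕ.* suc a)) b)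
      ≡⟨ sym (ℤP.*-assoc x _ _) ⟩
    x * falling2 (x - + 2) a * falling2 (x - + (2 ℕ.* suc a)) b
      ≡⟨ cong (_* falling2 (x - + (2 ℕ.* suc a)) b) (sym (falling2-unfoldˡ x a)) ⟩
    falling2 x (suc a) * falling2 (x - + (2 ℕ.* suc a)) b ∎
    where
    open ≡-Reasoning
    assoc : ∀ x n → x - + 2 - n ≡ x - (+ 2 + n)
    assoc = solve-∀
    shift : x - + 2 - + (2 ℕ.* a) ≡ x - + (2 ℕ.* suc a)
    shift = trans (assoc x (+ (2 ℕ.* a))) (cong (λ d → x - + d) (sym (ℕP.*-suc 2 a)))

  falling-pascal : ∀ x p → falling (x + + 1) p ≡ falling x p + + p * falling x (p ∸ 1)
  falling-pascal x zero    = refl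
  falling-pascal x (suc p) = begin
    falling (x + + 1) (suc p)             ≡⟨ falling-unfoldˡ (x + + 1) p ⟩
    (x + + 1) * falling (x + + 1 - + 1) p  ≡⟨ cong (λ y → (x + + 1) * falling y p) (cancel x) ⟩
    (x + + 1) * falling x p                ≡⟨ split x (falling x p) (+ p) ⟩
    falling x p * (x - + p) + + suc p * falling x p ∎
    where
    open ≡-Reasoning
    cancel : ∀ x → x + + 1 - + 1 ≡ x
    cancel = solve-∀
    split : ∀ x F p → (x + + 1) * F ≡ F * (x - p) + (+ 1 + p) * F
    split = solve-∀

  fallingℕ-vanishes : ∀ a n → a ℕ.< n → fallingℕ a n ≡ 0
  fallingℕ-vanishes a (suc n) (s≤s a≤n) with a ℕ.≟ n
  ... | yes refl = trans (cong (fallingℕ a a ℕ.*_) (ℕP.n∸n≡0 a)) (ℕP.*-zeroʳ (fallingℕ a a))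
  ... | no a≢n   = cong (ℕ._* (a ∸ n)) (fallingℕ-vanishes a n (ℕP.≤∧≢⇒< a≤n a≢n))

  falling-pos : ∀ a i → falling (+ a) i ≡ + fallingℕ a i
  falling-pos a zero    = refl
  falling-pos a (suc i) with i ℕ.≤? a
  ... | yes i≤a = trans (cong₂ _*_ (falling-pos a i) (sym (pos-∸ i≤a)))
                        (sym (ℤP.pos-* (fallingℕ a i) (a ∸ i)))
  ... | no  i≰a rewrite falling-pos a i | fallingℕ-vanishes a i (ℕP.≰⇒> i≰a) = ℤP.*-zeroˡ (+ a - + i)

  fallingℕ-unfoldˡ : ∀ a n → fallingℕ (suc a) (suc n) ≡ suc a ℕ.* fallingℕ a n
  fallingℕ-unfoldˡ a zero    = ℕP.*-comm 1 (suc a)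
  fallingℕ-unfoldˡ a (suc n) =
    trans (cong (ℕ._* (a ∸ n)) (fallingℕ-unfoldˡ a n)) (ℕP.*-assoc (suc a) (fallingℕ a n) (a ∸ n))

  fallingℕ-pascal : ∀ b n → fallingℕ (suc b) (suc n) ≡ fallingℕ b (suc n) ℕ.+ suc n ℕ.* fallingℕ b n
  fallingℕ-pascal b n with n ℕ.≤? b
  ... | yes n≤b = begin
    fallingℕ (suc b) (suc n)                            ≡⟨ fallingℕ-unfoldˡ b n ⟩
    suc b ℕ.* fallingℕ b n                              ≡⟨ cong (ℕ._* fallingℕ b n) b+1≡ ⟩
    ((b ∸ n) ℕ.+ suc n) ℕ.* fallingℕ b n                ≡⟨ regroup (b ∸ n) (suc n) (fallingℕ b n) ⟩
    fallingℕ b n ℕ.* (b ∸ n) ℕ.+ suc n ℕ.* fallingℕ b n ∎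
    where
    open ≡-Reasoning
    b+1≡ : suc b ≡ (b ∸ n) ℕ.+ suc n
    b+1≡ = sym (trans (ℕP.+-suc (b ∸ n) n) (cong suc (ℕP.m∸n+n≡m n≤b)))
    regroup : ∀ d s F → (d ℕ.+ s) ℕ.* F ≡ F ℕ.* d ℕ.+ s ℕ.* F
    regroup = ℕSolver.solve-∀
  ... | no n≰b rewrite fallingℕ-unfoldˡ b n | fallingℕ-vanishes b n (ℕP.≰⇒> n≰b) =
    trans (ℕP.*-zeroʳ (suc b)) (sym (ℕP.*-zeroʳ (suc n)))

  fallingℕ-+ : ∀ a p q → fallingℕ a (p ℕ.+ q) ≡ fallingℕ a p ℕ.* fallingℕ (a ∸ p) q
  fallingℕ-+ a p zero    = trans (cong (fallingℕ a) (ℕP.+-identityʳ p)) (sym (ℕP.*-identityʳ _))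
  fallingℕ-+ a p (suc q) = begin
    fallingℕ a (p ℕ.+ suc q)
      ≡⟨ cong (fallingℕ a) (ℕP.+-suc p q) ⟩
    fallingℕ a (p ℕ.+ q) ℕ.* (a ∸ (p ℕ.+ q))
      ≡⟨ cong₂ ℕ._*_ (fallingℕ-+ a p q) (sym (ℕP.∸-+-assoc a p q)) ⟩
    fallingℕ a p ℕ.* fallingℕ (a ∸ p) q ℕ.* ((a ∸ p) ∸ q)
      ≡⟨ ℕP.*-assoc (fallingℕ a p) _ _ ⟩
    fallingℕ a p ℕ.* fallingℕ (a ∸ p) (suc q) ∎
    where open ≡-Reasoning

  C-pascal : ∀ l p → suc l C suc p ≡ l C p ℕ.+ l C suc p
  C-pascal l p = sym (nCk+nC[k+1]≡[n+1]C[k+1] l p)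

  !*C≡fallingℕ : ∀ l i → i ! ℕ.* (l C i) ≡ fallingℕ l i
  !*C≡fallingℕ zero    zero    = refl
  !*C≡fallingℕ zero    (suc i) rewrite k>n⇒nCk≡0 {0} {suc i} (s≤s z≤n) | fallingℕ-vanishes 0 (suc i) (s≤s z≤n) =
    ℕP.*-zeroʳ (suc i !)
  !*C≡fallingℕ (suc l) zero    = refl
  !*C≡fallingℕ (suc l) (suc i) = begin
    suc i ! ℕ.* (suc l C suc i)
      ≡⟨ cong (suc i ! ℕ.*_) (C-pascal l i) ⟩
    suc i ! ℕ.* (l C i ℕ.+ l C suc i)
      ≡⟨ regroup (suc i) (i !) (l C i) (l C suc i) ⟩
    suc i ℕ.* (i ! ℕ.* (l C i)) ℕ.+ suc i ! ℕ.* (l C suc i)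
      ≡⟨ cong₂ (λ u v → suc i ℕ.* u ℕ.+ v) (!*C≡fallingℕ l i) (!*C≡fallingℕ l (suc i)) ⟩
    suc i ℕ.* fallingℕ l i ℕ.+ fallingℕ l (suc i)
      ≡⟨ ℕP.+-comm (suc i ℕ.* fallingℕ l i) _ ⟩
    fallingℕ l (suc i) ℕ.+ suc i ℕ.* fallingℕ l i
      ≡⟨ sym (fallingℕ-pascal l i) ⟩
    fallingℕ (suc l) (suc i) ∎
    where
    open ≡-Reasoning
    regroup : ∀ s f a b → s ℕ.* f ℕ.* (a ℕ.+ b) ≡ s ℕ.* (f ℕ.* a) ℕ.+ s ℕ.* f ℕ.* b
    regroup = ℕSolver.solve-∀

  private
    cancel-! : ∀ p {u v} → u ℕ.* p ! ≡ v ℕ.* p ! → u ≡ v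
    cancel-! p = ℕP.*-cancelʳ-≡ _ _ (p !) {{p !≢0}}

  -- Both absorption identities are read off from i! (l C i) = (l)_i.
  C-absorb : ∀ l p → suc p ℕ.* (l C suc p) ≡ (l ∸ p) ℕ.* (l C p)
  C-absorb l p = cancel-! p (begin
    suc p ℕ.* (l C suc p) ℕ.* p !          ≡⟨ regroup (suc p) (l C suc p) (p !) ⟩
    suc p ! ℕ.* (l C suc p)                ≡⟨ !*C≡fallingℕ l (suc p) ⟩
    fallingℕ l p ℕ.* (l ∸ p)               ≡⟨ cong (ℕ._* (l ∸ p)) (sym (!*C≡fallingℕ l p)) ⟩
    p ! ℕ.* (l C p) ℕ.* (l ∸ p)            ≡⟨ regroup′ (p !) (l C p) (l ∸ p) ⟩
    (l ∸ p) ℕ.* (l C p) ℕ.* p !            ∎)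
    where
    open ≡-Reasoning
    regroup : ∀ s c f → s ℕ.* c ℕ.* f ≡ s ℕ.* f ℕ.* c
    regroup = ℕSolver.solve-∀
    regroup′ : ∀ f c d → f ℕ.* c ℕ.* d ≡ d ℕ.* c ℕ.* f
    regroup′ = ℕSolver.solve-∀

  C-absorb-suc : ∀ s t → suc t ℕ.* (suc s C suc t) ≡ suc s ℕ.* (s C t)
  C-absorb-suc s t = cancel-! t (begin
    suc t ℕ.* (suc s C suc t) ℕ.* t !      ≡⟨ regroup (suc t) (suc s C suc t) (t !) ⟩
    suc t ! ℕ.* (suc s C suc t)            ≡⟨ !*C≡fallingℕ (suc s) (suc t) ⟩
    fallingℕ (suc s) (suc t)               ≡⟨ fallingℕ-unfoldˡ s t ⟩
    suc s ℕ.* fallingℕ s t                 ≡⟨ cong (suc s ℕ.*_) (sym (!*C≡fallingℕ s t)) ⟩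
    suc s ℕ.* (t ! ℕ.* (s C t))            ≡⟨ regroup′ (suc s) (t !) (s C t) ⟩
    suc s ℕ.* (s C t) ℕ.* t !              ∎)
    where
    open ≡-Reasoning
    regroup : ∀ s c f → s ℕ.* c ℕ.* f ≡ s ℕ.* f ℕ.* c
    regroup = ℕSolver.solve-∀
    regroup′ : ∀ a f c → a ℕ.* (f ℕ.* c) ≡ a ℕ.* c ℕ.* f
    regroup′ = ℕSolver.solve-∀

  -- matchings a j is the number of j-edge matchings of K_a: T(a,j) without division.
  matchings : ℕ → ℕ → ℕ
  matchings zero          zero    = 1
  matchings zero          (suc j) = 0
  matchings (suc a)       zero    = 1
  matchings (suc zero)    (suc j) = 0
  matchings (suc (suc a)) (suc j) = matchings (suc a) (suc j) ℕ.+ suc a ℕ.* matchings a j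

  matchings-zero : ∀ a → matchings a 0 ≡ 1
  matchings-zero zero    = refl
  matchings-zero (suc a) = refl

  matchings-vanishes : ∀ a j → a ℕ.< j ℕ.+ j → matchings a j ≡ 0
  matchings-vanishes zero          (suc j) _ = refl
  matchings-vanishes (suc zero)    (suc j) _ = refl
  matchings-vanishes (suc (suc a)) (suc j) (s≤s a+1<j+j+1)
    rewrite matchings-vanishes (suc a) (suc j) (ℕP.<-trans (ℕP.n<1+n _) (s≤s a+1<j+j+1))
          | matchings-vanishes a j (ℕP.≤-pred (subst (suc (suc a) ℕ.≤_) (ℕP.+-suc j j) a+1<j+j+1)) =
    ℕP.*-zeroʳ (suc a)

  2^j*j! : ℕ → ℕ
  2^j*j! j = 2 ^ j ℕ.* j !

  2^j*j!≢0 : ∀ j → NonZero (2^j*j! j)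
  2^j*j!≢0 j = m*n≢0 (2 ^ j) (j !) {{m^n≢0 2 j}} {{j !≢0}}

  matchings-fallingℕ : ∀ a j → matchings a j ℕ.* 2^j*j! j ≡ fallingℕ a (j ℕ.+ j)
  matchings-fallingℕ zero          zero    = refl
  matchings-fallingℕ zero          (suc j) = sym (fallingℕ-vanishes 0 (suc j ℕ.+ suc j) (s≤s z≤n))
  matchings-fallingℕ (suc a)       zero    = refl
  matchings-fallingℕ (suc zero)    (suc j) =
    sym (fallingℕ-vanishes 1 (suc j ℕ.+ suc j) (s≤s (subst (1 ℕ.≤_) (sym (ℕP.+-suc j j)) (s≤s z≤n))))
  matchings-fallingℕ (suc (suc a)) (suc j) = begin
    (matchings (suc a) (suc j) ℕ.+ suc a ℕ.* matchings a j) ℕ.* 2^j*j! (suc j)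
      ≡⟨ ℕP.*-distribʳ-+ (2^j*j! (suc j)) (matchings (suc a) (suc j)) _ ⟩
    matchings (suc a) (suc j) ℕ.* 2^j*j! (suc j) ℕ.+ suc a ℕ.* matchings a j ℕ.* 2^j*j! (suc j)
      ≡⟨ cong₂ ℕ._+_ (matchings-fallingℕ (suc a) (suc j)) (regroup (suc a) (matchings a j) (2 ^ j) (j !) j) ⟩
    fallingℕ (suc a) (suc j ℕ.+ suc j) ℕ.+ suc (suc (j ℕ.+ j)) ℕ.* (suc a ℕ.* (matchings a j ℕ.* 2^j*j! j))
      ≡⟨ cong₂ (λ u v → fallingℕ (suc a) u ℕ.+ suc (suc (j ℕ.+ j)) ℕ.* v) j+1+j+1
               (trans (cong (suc a ℕ.*_) (matchings-fallingℕ a j)) (sym (fallingℕ-unfoldˡ a (j ℕ.+ j)))) ⟩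
    fallingℕ (suc a) (suc (suc (j ℕ.+ j))) ℕ.+ suc (suc (j ℕ.+ j)) ℕ.* fallingℕ (suc a) (suc (j ℕ.+ j))
      ≡⟨ sym (fallingℕ-pascal (suc a) (suc (j ℕ.+ j))) ⟩
    fallingℕ (suc (suc a)) (suc (suc (j ℕ.+ j)))
      ≡⟨ cong (fallingℕ (suc (suc a))) (sym j+1+j+1) ⟩
    fallingℕ (suc (suc a)) (suc j ℕ.+ suc j) ∎
    where
    open ≡-Reasoning
    j+1+j+1 : suc j ℕ.+ suc j ≡ suc (suc (j ℕ.+ j))
    j+1+j+1 = cong suc (ℕP.+-suc j j)
    regroup : ∀ s m p f j →
      s ℕ.* m ℕ.* (2 ℕ.* p ℕ.* (suc j ℕ.* f)) ≡ suc (suc (j ℕ.+ j)) ℕ.* (s ℕ.* (m ℕ.* (p ℕ.* f)))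
    regroup = ℕSolver.solve-∀

  T≡matchings : ∀ a j → T a j ≡ matchings a j
  T≡matchings a j = begin
    fallingℕ a (2 ℕ.* j) / 2^j*j! j                 ≡⟨ cong (λ k → fallingℕ a k / 2^j*j! j) (2*n≡n+n j) ⟩
    fallingℕ a (j ℕ.+ j) / 2^j*j! j                 ≡⟨ cong (_/ 2^j*j! j) (sym (matchings-fallingℕ a j)) ⟩
    matchings a j ℕ.* 2^j*j! j / 2^j*j! j           ≡⟨ m*n/n≡m (matchings a j) (2^j*j! j) ⟩
    matchings a j                                   ∎
    where
    open ≡-Reasoning
    instance
      _ = 2^j*j!≢0 j

  -- Both sides count the ways to pick j disjoint pairs and then i ordered singletons out of l points.
  matchings-then-singletons : ∀ l i j →
    matchings l j ℕ.* fallingℕ (l ∸ (j ℕ.+ j)) i ≡ i ! ℕ.* (l C i) ℕ.* matchings (l ∸ i) j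
  matchings-then-singletons l i j = ℕP.*-cancelʳ-≡ _ _ (2^j*j! j) {{2^j*j!≢0 j}} (begin
    matchings l j ℕ.* fallingℕ (l ∸ (j ℕ.+ j)) i ℕ.* 2^j*j! j
      ≡⟨ regroup (matchings l j) (fallingℕ (l ∸ (j ℕ.+ j)) i) (2^j*j! j) ⟩
    matchings l j ℕ.* 2^j*j! j ℕ.* fallingℕ (l ∸ (j ℕ.+ j)) i
      ≡⟨ cong (ℕ._* fallingℕ (l ∸ (j ℕ.+ j)) i) (matchings-fallingℕ l j) ⟩
    fallingℕ l (j ℕ.+ j) ℕ.* fallingℕ (l ∸ (j ℕ.+ j)) i
      ≡⟨ sym (fallingℕ-+ l (j ℕ.+ j) i) ⟩
    fallingℕ l (j ℕ.+ j ℕ.+ i)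
      ≡⟨ cong (fallingℕ l) (ℕP.+-comm (j ℕ.+ j) i) ⟩
    fallingℕ l (i ℕ.+ (j ℕ.+ j))
      ≡⟨ fallingℕ-+ l i (j ℕ.+ j) ⟩
    fallingℕ l i ℕ.* fallingℕ (l ∸ i) (j ℕ.+ j)
      ≡⟨ cong₂ ℕ._*_ (sym (!*C≡fallingℕ l i)) (sym (matchings-fallingℕ (l ∸ i) j)) ⟩
    i ! ℕ.* (l C i) ℕ.* (matchings (l ∸ i) j ℕ.* 2^j*j! j)
      ≡⟨ sym (ℕP.*-assoc (i ! ℕ.* (l C i)) _ _) ⟩
    i ! ℕ.* (l C i) ℕ.* matchings (l ∸ i) j ℕ.* 2^j*j! j ∎)
    where
    open ≡-Reasoning
    regroup : ∀ a b c → a ℕ.* b ℕ.* c ≡ a ℕ.* c ℕ.* b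
    regroup = ℕSolver.solve-∀


module CliquePoly where

  open import Data.Nat as ℕ using (ℕ; zero; suc; s≤s; _∸_)
  import Data.Nat.Properties as ℕP
  open import Data.Nat.Combinatorics using (_C_; k>n⇒nCk≡0)
  open import Data.Integer using (ℤ; +_; _+_; _-_; _*_)
  import Data.Integer.Properties as ℤP
  open import Data.Integer.Tactic.RingSolver using (solve-∀)
  open import Function using (_∘_)
  open import Relation.Binary.PropositionalEquality
  open import Relation.Nullary using (yes; no)
  open import Defs using (falling; falling2)
  open RangeSum
  open Factorials

  -- Colouring a positive clique of a vertices, each taking a colour of a still unused pair {c, -c}
  -- (y such colours): the pair is spent, and either a later vertex takes -c or c stays alone,
  -- which increases the counter passed on to the continuation Φ.
  polyK₀ : (ℤ → ℤ → ℤ) → ℕ → ℤ → ℤ → ℤ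
  polyK₀ Φ zero          y c = Φ y c
  polyK₀ Φ (suc zero)    y c = y * Φ (y - + 2) (c + + 1)
  polyK₀ Φ (suc (suc a)) y c = y * (polyK₀ Φ (suc a) (y - + 2) (c + + 1) + + suc a * polyK₀ Φ a (y - + 2) c)

  polyK₀-suc : ∀ Φ a y c →
    polyK₀ Φ (suc a) y c ≡ y * (polyK₀ Φ a (y - + 2) (c + + 1) + + a * polyK₀ Φ (a ∸ 1) (y - + 2) c)
  polyK₀-suc Φ zero    y c = cong (y *_) (sym (ℤP.+-identityʳ _))
  polyK₀-suc Φ (suc a) y c = refl

  polyK₀-term : (ℤ → ℤ → ℤ) → ℕ → ℤ → ℤ → ℕ → ℤ
  polyK₀-term Φ a y c j = + matchings a j * (falling2 y (a ∸ j) * Φ (y - + (2 ℕ.* (a ∸ j))) (c + + a - + (2 ℕ.* j)))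

  polyK₀-term-vanishes : ∀ Φ a y c j → a ℕ.< j ℕ.+ j → polyK₀-term Φ a y c j ≡ + 0
  polyK₀-term-vanishes Φ a y c j a<2j rewrite matchings-vanishes a j a<2j = refl

  falling2-step : ∀ (G : ℤ → ℤ) y d →
    falling2 y (suc d) * G (y - + (2 ℕ.* suc d)) ≡ y * (falling2 (y - + 2) d * G (y - + 2 - + (2 ℕ.* d)))
  falling2-step G y d = begin
    falling2 y (suc d) * G (y - + (2 ℕ.* suc d))
      ≡⟨ cong₂ (λ F y′ → F * G y′) (falling2-unfoldˡ y d) (cong (λ e → y - + e) (ℕP.*-suc 2 d)) ⟩
    y * falling2 (y - + 2) d * G (y - (+ 2 + + (2 ℕ.* d)))
      ≡⟨ cong (λ y′ → y * falling2 (y - + 2) d * G y′) (assoc y (+ (2 ℕ.* d))) ⟩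
    y * falling2 (y - + 2) d * G (y - + 2 - + (2 ℕ.* d))
      ≡⟨ ℤP.*-assoc y _ _ ⟩
    y * (falling2 (y - + 2) d * G (y - + 2 - + (2 ℕ.* d))) ∎
    where
    open ≡-Reasoning
    assoc : ∀ y e → y - (+ 2 + e) ≡ y - + 2 - e
    assoc = solve-∀

  polyK₀-term-head : ∀ Φ a y c → polyK₀-term Φ (suc a) y c 0 ≡ y * polyK₀-term Φ a (y - + 2) (c + + 1) 0
  polyK₀-term-head Φ a y c = begin
    + 1 * (falling2 y (suc a) * Φ (y - + (2 ℕ.* suc a)) (c + + suc a - + 0))
      ≡⟨ cong (+ 1 *_) (falling2-step (λ y′ → Φ y′ (c + + suc a - + 0)) y a) ⟩
    + 1 * (y * (falling2 (y - + 2) a * Φ (y - + 2 - + (2 ℕ.* a)) (c + + suc a - + 0)))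
      ≡⟨ ℤP.*-identityˡ _ ⟩
    y * (falling2 (y - + 2) a * Φ (y - + 2 - + (2 ℕ.* a)) (c + + suc a - + 0))
      ≡⟨ cong (y *_) (sym (ℤP.*-identityˡ _)) ⟩
    y * (+ 1 * (falling2 (y - + 2) a * Φ (y - + 2 - + (2 ℕ.* a)) (c + + suc a - + 0)))
      ≡⟨ cong₂ (λ M c′ → y * (+ M * (falling2 (y - + 2) a * Φ (y - + 2 - + (2 ℕ.* a)) c′)))
               (sym (matchings-zero a)) (c+1+a c (+ a)) ⟩
    y * polyK₀-term Φ a (y - + 2) (c + + 1) 0 ∎
    where
    open ≡-Reasoning
    c+1+a : ∀ c a → c + (+ 1 + a) - + 0 ≡ c + + 1 + a - + 0
    c+1+a = solve-∀

  polyK₀-term-step : ∀ Φ a y c j →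
    polyK₀-term Φ (suc (suc a)) y c (suc j)
    ≡ y * polyK₀-term Φ (suc a) (y - + 2) (c + + 1) (suc j) + y * (+ suc a * polyK₀-term Φ a (y - + 2) c j)
  polyK₀-term-step Φ a y c j with j ℕ.≤? a
  ... | no j≰a = trans (polyK₀-term-vanishes Φ (suc (suc a)) y c (suc j) a+2<2j+2)
    (sym (trans (cong₂ (λ u v → y * u + y * (+ suc a * v))
                       (polyK₀-term-vanishes Φ (suc a) (y - + 2) (c + + 1) (suc j) a+1<2j+2)
                       (polyK₀-term-vanishes Φ a (y - + 2) c j a<2j))
                (vanish y (+ suc a))))
    where
    a<2j : a ℕ.< j ℕ.+ j
    a<2j = ℕP.<-≤-trans (ℕP.≰⇒> j≰a) (ℕP.m≤m+n j j)
    a+1<2j+2 : suc a ℕ.< suc j ℕ.+ suc j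
    a+1<2j+2 = s≤s (ℕP.m≤n⇒m≤o+n j (ℕP.m≤n⇒m≤1+n (ℕP.≰⇒> j≰a)))
    a+2<2j+2 : suc (suc a) ℕ.< suc j ℕ.+ suc j
    a+2<2j+2 = s≤s (subst (suc a ℕ.<_) (sym (ℕP.+-suc j j)) (s≤s a<2j))
    vanish : ∀ y s → y * + 0 + y * (s * + 0) ≡ + 0
    vanish = solve-∀
  ... | yes j≤a = begin
    + (M₁ ℕ.+ suc a ℕ.* M₀) * (falling2 y (suc a ∸ j) * Φ (y - + (2 ℕ.* (suc a ∸ j))) c′)
      ≡⟨ cong₂ (λ M d → M * (falling2 y d * Φ (y - + (2 ℕ.* d)) c′))
               (trans (ℤP.pos-+ M₁ _) (cong (_+_ (+ M₁)) (ℤP.pos-* (suc a) M₀))) a+1∸j ⟩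
    (+ M₁ + + suc a * + M₀) * (falling2 y (suc (a ∸ j)) * Φ (y - + (2 ℕ.* suc (a ∸ j))) c′)
      ≡⟨ cong ((+ M₁ + + suc a * + M₀) *_) (falling2-step (λ y′ → Φ y′ c′) y (a ∸ j)) ⟩
    (+ M₁ + + suc a * + M₀) * (y * (F * Φ y′ c′))
      ≡⟨ distrib (+ M₁) (+ suc a) (+ M₀) y (F * Φ y′ c′) ⟩
    y * (+ M₁ * (F * Φ y′ c′)) + y * (+ suc a * (+ M₀ * (F * Φ y′ c′)))
      ≡⟨ cong₂ (λ c₁ c₀ → y * (+ M₁ * (F * Φ y′ c₁)) + y * (+ suc a * (+ M₀ * (F * Φ y′ c₀))))
               (shift₁ c (+ a) (+ (2 ℕ.* suc j))) (trans (cong (λ e → c + + suc (suc a) - + e) (ℕP.*-suc 2 j))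
                                                          (shift₀ c (+ a) (+ (2 ℕ.* j)))) ⟩
    y * polyK₀-term Φ (suc a) (y - + 2) (c + + 1) (suc j) + y * (+ suc a * polyK₀-term Φ a (y - + 2) c j) ∎
    where
    open ≡-Reasoning
    M₁ = matchings (suc a) (suc j)
    M₀ = matchings a j
    F  = falling2 (y - + 2) (a ∸ j)
    y′ = y - + 2 - + (2 ℕ.* (a ∸ j))
    c′ = c + + suc (suc a) - + (2 ℕ.* suc j)
    a+1∸j : suc a ∸ j ≡ suc (a ∸ j)
    a+1∸j = ℕP.+-∸-assoc 1 j≤a
    distrib : ∀ m s n y X → (m + s * n) * (y * X) ≡ y * (m * X) + y * (s * (n * X))
    distrib = solve-∀
    shift₁ : ∀ c a e → c + (+ 1 + (+ 1 + a)) - e ≡ c + + 1 + (+ 1 + a) - e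
    shift₁ = solve-∀
    shift₀ : ∀ c a e → c + (+ 1 + (+ 1 + a)) - (+ 2 + e) ≡ c + a - e
    shift₀ = solve-∀

  polyK₀-closed : ∀ Φ a y c → polyK₀ Φ a y c ≡ ∑[ j ≤ a ] polyK₀-term Φ a y c j
  polyK₀-closed Φ zero          y c =
    sym (trans (cong₂ (λ y′ c′ → + 1 * (+ 1 * Φ y′ c′) + + 0) (ℤP.+-identityʳ y) c+0-0) (normalise (Φ y c)))
    where
    c+0-0 : c + + 0 - + 0 ≡ c
    c+0-0 = trans (ℤP.+-identityʳ (c + + 0)) (ℤP.+-identityʳ c)
    normalise : ∀ z → + 1 * (+ 1 * z) + + 0 ≡ z
    normalise = solve-∀
  polyK₀-closed Φ (suc zero)    y c = sym (normalise y (Φ (y - + 2) (c + + 1 - + 0)) (Φ (y - + 0) (c + + 1 - + 2))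
                                                ▸ cong (λ c′ → y * Φ (y - + 2) c′) (ℤP.+-identityʳ (c + + 1)))
    where
    _▸_ = trans
    normalise : ∀ y u v → + 1 * ((+ 1 * (y - + 0)) * u) + (+ 0 * (+ 1 * v) + + 0) ≡ y * u
    normalise = solve-∀
  polyK₀-closed Φ (suc (suc a)) y c = sym (begin
    T₂ 0 + ∑[ j < suc (suc a) ] T₂ (suc j)
      ≡⟨ cong₂ _+_ (polyK₀-term-head Φ (suc a) y c) (∑-cong (suc (suc a)) (polyK₀-term-step Φ a y c)) ⟩
    y * T₁ 0 + ∑[ j < suc (suc a) ] (y * T₁ (suc j) + y * (+ suc a * T₀ j))
      ≡⟨ cong (_+_ (y * T₁ 0)) (∑-distrib-+ (suc (suc a)) (λ j → y * T₁ (suc j)) (λ j → y * (+ suc a * T₀ j))) ⟩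
    y * T₁ 0 + (∑[ j < suc (suc a) ] (y * T₁ (suc j)) + ∑[ j < suc (suc a) ] (y * (+ suc a * T₀ j)))
      ≡⟨ cong₂ (λ u v → y * T₁ 0 + (u + v))
               (sym (*-distribˡ-∑ (suc (suc a)) y (T₁ ∘ suc)))
               (trans (sym (*-distribˡ-∑ (suc (suc a)) y (λ j → + suc a * T₀ j)))
                      (cong (y *_) (sym (*-distribˡ-∑ (suc (suc a)) (+ suc a) T₀)))) ⟩
    y * T₁ 0 + (y * ∑[ j < suc (suc a) ] T₁ (suc j) + y * (+ suc a * ∑< (suc (suc a)) T₀))
      ≡⟨ regroup y (T₁ 0) _ (+ suc a) _ ⟩
    y * (∑< (suc (suc (suc a))) T₁ + + suc a * ∑< (suc (suc a)) T₀)
      ≡⟨ cong₂ (λ u v → y * (u + + suc a * v))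
               (trans (∑-dropLast (suc (suc a)) T₁
                                  (polyK₀-term-vanishes Φ (suc a) (y - + 2) (c + + 1) (suc (suc a)) a+1<2a+4))
                      (sym (polyK₀-closed Φ (suc a) (y - + 2) (c + + 1))))
               (trans (∑-dropLast (suc a) T₀ (polyK₀-term-vanishes Φ a (y - + 2) c (suc a) a<2a+2))
                      (sym (polyK₀-closed Φ a (y - + 2) c))) ⟩
    y * (polyK₀ Φ (suc a) (y - + 2) (c + + 1) + + suc a * polyK₀ Φ a (y - + 2) c) ∎)
    where
    open ≡-Reasoning
    T₂ = polyK₀-term Φ (suc (suc a)) y c
    T₁ = polyK₀-term Φ (suc a) (y - + 2) (c + + 1)
    T₀ = polyK₀-term Φ a (y - + 2) c
    a<2a+2 : a ℕ.< suc a ℕ.+ suc a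
    a<2a+2 = ℕP.m≤n⇒m≤n+o (suc a) (ℕP.n<1+n a)
    a+1<2a+4 : suc a ℕ.< suc (suc a) ℕ.+ suc (suc a)
    a+1<2a+4 = ℕP.m≤n⇒m≤n+o (suc (suc a)) (ℕP.n<1+n (suc a))
    regroup : ∀ y t₀ S s S′ → y * t₀ + (y * S + y * (s * S′)) ≡ y * ((t₀ + S) + s * S′)
    regroup = solve-∀

  ∑-C-pascal : ∀ l (G : ℕ → ℕ → ℤ) →
    ∑[ p ≤ suc l ] (+ (suc l C p) * G p (suc l ∸ p))
    ≡ ∑[ p ≤ l ] (+ (l C p) * G p (suc (l ∸ p))) + ∑[ p ≤ l ] (+ (l C p) * G (suc p) (l ∸ p))
  ∑-C-pascal l G = begin
    + 1 * G 0 (suc l) + ∑[ p ≤ l ] (+ (suc l C suc p) * G (suc p) (l ∸ p))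
      ≡⟨ cong (_+_ (+ 1 * G 0 (suc l))) (trans (∑-cong (suc l) pascal) (∑-distrib-+ (suc l) same-p next-p)) ⟩
    + 1 * G 0 (suc l) + (∑≤ l same-p + ∑≤ l next-p)
      ≡⟨ cong (λ S → + 1 * G 0 (suc l) + (∑≤ l same-p + S)) (∑-dropLast l next-p last-vanishes) ⟩
    + 1 * G 0 (suc l) + (∑≤ l same-p + ∑< l next-p)
      ≡⟨ regroup (+ 1 * G 0 (suc l)) (∑≤ l same-p) _ ⟩
    + 1 * G 0 (suc l) + ∑< l next-p + ∑≤ l same-p
      ≡⟨ cong (λ S → + 1 * G 0 (suc l) + S + ∑≤ l same-p)
              (∑-cong< l (λ p p<l → cong (λ r → + (l C suc p) * G (suc p) r) (ℕP.+-∸-assoc 1 p<l))) ⟩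
    ∑[ p ≤ l ] (+ (l C p) * G p (suc (l ∸ p))) + ∑≤ l same-p ∎
    where
    open ≡-Reasoning
    same-p next-p : ℕ → ℤ
    same-p p = + (l C p) * G (suc p) (l ∸ p)
    next-p p = + (l C suc p) * G (suc p) (l ∸ p)
    pascal : ∀ p → + (suc l C suc p) * G (suc p) (l ∸ p) ≡ same-p p + next-p p
    pascal p = trans (cong (λ c → + c * G (suc p) (l ∸ p)) (C-pascal l p))
                     (trans (cong (_* G (suc p) (l ∸ p)) (ℤP.pos-+ (l C p) (l C suc p)))
                            (ℤP.*-distribʳ-+ (G (suc p) (l ∸ p)) (+ (l C p)) (+ (l C suc p))))
    last-vanishes : next-p l ≡ + 0
    last-vanishes = cong (λ c → + c * G (suc l) (l ∸ l)) (k>n⇒nCk≡0 (ℕP.n<1+n l))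
    regroup : ∀ a b d → a + (b + d) ≡ a + d + b
    regroup = solve-∀

  -- A positive clique that may also take any of h colours -c whose partner c is used by a
  -- single earlier vertex of the clique.
  polyK : (ℤ → ℤ → ℤ) → ℕ → ℤ → ℤ → ℤ
  polyK Φ zero    y h = Φ y h
  polyK Φ (suc l) y h = y * polyK Φ l (y - + 2) (h + + 1) + h * polyK Φ l y (h - + 1)

  polyK-term : (ℤ → ℤ → ℤ) → ℕ → ℤ → ℤ → ℕ → ℤ
  polyK-term Φ l y h p = + (l C p) * (falling h p * polyK₀ Φ (l ∸ p) y (h - + p))

  private
    module PolyKStep (Φ : ℤ → ℤ → ℤ) (l : ℕ) (y h : ℤ) where

      G : ℕ → ℕ → ℤ
      G p r = falling h p * polyK₀ Φ r y (h - + p)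

      reused-colour : ∑[ p ≤ l ] (+ (l C p) * G (suc p) (l ∸ p)) ≡ h * ∑[ p ≤ l ] polyK-term Φ l y (h - + 1) p
      reused-colour = trans (∑-cong (suc l) step) (sym (*-distribˡ-∑ (suc l) h (polyK-term Φ l y (h - + 1))))
        where
        regroup : ∀ c h F W → c * (h * F * W) ≡ h * (c * (F * W))
        regroup = solve-∀
        h-[1+p] : ∀ h p → h - (+ 1 + p) ≡ h - + 1 - p
        h-[1+p] = solve-∀
        step : ∀ p → + (l C p) * G (suc p) (l ∸ p) ≡ h * polyK-term Φ l y (h - + 1) p
        step p = trans (cong₂ (λ F h′ → + (l C p) * (F * polyK₀ Φ (l ∸ p) y h′))
                              (falling-unfoldˡ h p) (h-[1+p] h (+ p)))
                       (regroup (+ (l C p)) h (falling (h - + 1) p) _)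

      kept partnered shifted : ℕ → ℤ
      kept      p = + (l C p) * (falling h p * polyK₀ Φ (l ∸ p) (y - + 2) (h - + p + + 1))
      partnered p = + (l C p) * (falling h p * (+ (l ∸ p) * polyK₀ Φ (l ∸ p ∸ 1) (y - + 2) (h - + p)))
      shifted   p = + (l C p) * (+ p * falling h (p ∸ 1) * polyK₀ Φ (l ∸ p) (y - + 2) (h + + 1 - + p))

      private
        distrib : ∀ c F y u v → c * (F * (y * (u + v))) ≡ y * (c * (F * u)) + y * (c * (F * v))
        distrib = solve-∀

      kept+partnered : ∀ p → + (l C p) * G p (suc (l ∸ p)) ≡ y * kept p + y * partnered p
      kept+partnered p = trans (cong (λ W → + (l C p) * (falling h p * W)) (polyK₀-suc Φ (l ∸ p) y (h - + p)))
                               (distrib (+ (l C p)) (falling h p) y _ _)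

      kept+shifted : ∀ p → polyK-term Φ l (y - + 2) (h + + 1) p ≡ kept p + shifted p
      kept+shifted p = trans (cong (λ F → + (l C p) * (F * polyK₀ Φ (l ∸ p) (y - + 2) (h + + 1 - + p)))
                                   (falling-pascal h p))
                             (trans (distrib′ (+ (l C p)) (falling h p) _ _)
                                    (cong (λ h′ → + (l C p) * (falling h p * polyK₀ Φ (l ∸ p) (y - + 2) h′) + shifted p)
                                          (swap h (+ p))))
        where
        distrib′ : ∀ c a b W → c * ((a + b) * W) ≡ c * (a * W) + c * (b * W)
        distrib′ = solve-∀
        swap : ∀ h p → h + + 1 - p ≡ h - p + + 1
        swap = solve-∀

      -- absorption turns p (l C p) into (l - p + 1) (l C (p - 1))
      shifted≡partnered : ∑≤ l shifted ≡ ∑≤ l partnered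
      shifted≡partnered = begin
        ∑≤ l shifted               ≡⟨ ∑-dropHead l shifted (ℤP.*-zeroʳ (+ (l C 0))) ⟩
        ∑[ p < l ] shifted (suc p) ≡⟨ ∑-cong< l absorbed ⟩
        ∑< l partnered             ≡⟨ sym (∑-dropLast l partnered last-vanishes) ⟩
        ∑≤ l partnered             ∎
        where
        open ≡-Reasoning
        vanish : ∀ c F W → c * (F * (+ 0 * W)) ≡ + 0
        vanish = solve-∀
        last-vanishes : partnered l ≡ + 0
        last-vanishes = trans (cong (λ d → + (l C l) * (falling h l * (+ d * polyK₀ Φ (d ∸ 1) (y - + 2) (h - + l))))
                                    (ℕP.n∸n≡0 l))
                              (vanish (+ (l C l)) (falling h l) (polyK₀ Φ 0 (y - + 2) (h - + l)))
        regroup : ∀ c s F W → c * (s * F * W) ≡ s * c * (F * W)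
        regroup = solve-∀
        regroup′ : ∀ c d F W → c * (F * (d * W)) ≡ d * c * (F * W)
        regroup′ = solve-∀
        h+1-[1+p] : ∀ h p → h + + 1 - (+ 1 + p) ≡ h - p
        h+1-[1+p] = solve-∀
        absorbed : ∀ p → p ℕ.< l → shifted (suc p) ≡ partnered p
        absorbed p p<l = begin
          shifted (suc p)
            ≡⟨ regroup (+ (l C suc p)) (+ suc p) (falling h p) _ ⟩
          + suc p * + (l C suc p) * (falling h p * polyK₀ Φ (l ∸ suc p) (y - + 2) (h + + 1 - + suc p))
            ≡⟨ cong₂ (λ c W → c * (falling h p * W))
                     (trans (sym (ℤP.pos-* (suc p) (l C suc p))) (trans (cong +_ (C-absorb l p)) (ℤP.pos-* (l ∸ p) (l C p))))
                     (cong₂ (λ r h′ → polyK₀ Φ r (y - + 2) h′)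
                            (sym (ℕP.pred[m∸n]≡m∸[1+n] l p)) (h+1-[1+p] h (+ p))) ⟩
          + (l ∸ p) * + (l C p) * (falling h p * polyK₀ Φ (l ∸ p ∸ 1) (y - + 2) (h - + p))
            ≡⟨ sym (regroup′ (+ (l C p)) (+ (l ∸ p)) (falling h p) _) ⟩
          partnered p ∎

      new-pair : ∑[ p ≤ l ] (+ (l C p) * G p (suc (l ∸ p))) ≡ y * ∑[ p ≤ l ] polyK-term Φ l (y - + 2) (h + + 1) p
      new-pair = begin
        ∑[ p ≤ l ] (+ (l C p) * G p (suc (l ∸ p)))
          ≡⟨ trans (∑-cong (suc l) kept+partnered)
                   (∑-distrib-+ (suc l) (λ p → y * kept p) (λ p → y * partnered p)) ⟩
        ∑[ p ≤ l ] (y * kept p) + ∑[ p ≤ l ] (y * partnered p)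
          ≡⟨ sym (trans (ℤP.*-distribˡ-+ y _ _)
                        (cong₂ _+_ (*-distribˡ-∑ (suc l) y kept) (*-distribˡ-∑ (suc l) y partnered))) ⟩
        y * (∑≤ l kept + ∑≤ l partnered)
          ≡⟨ cong (λ S → y * (∑≤ l kept + S)) (sym shifted≡partnered) ⟩
        y * (∑≤ l kept + ∑≤ l shifted)
          ≡⟨ cong (y *_) (sym (trans (∑-cong (suc l) kept+shifted) (∑-distrib-+ (suc l) kept shifted))) ⟩
        y * ∑[ p ≤ l ] polyK-term Φ l (y - + 2) (h + + 1) p ∎
        where open ≡-Reasoning

  polyK-closed : ∀ Φ l y h → polyK Φ l y h ≡ ∑[ p ≤ l ] polyK-term Φ l y h p
  polyK-closed Φ zero    y h =
    sym (trans (cong (λ h′ → + 1 * (+ 1 * Φ y h′) + + 0) (ℤP.+-identityʳ h)) (normalise (Φ y h)))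
    where
    normalise : ∀ z → + 1 * (+ 1 * z) + + 0 ≡ z
    normalise = solve-∀
  polyK-closed Φ (suc l) y h = sym (begin
    ∑[ p ≤ suc l ] polyK-term Φ (suc l) y h p
      ≡⟨ ∑-C-pascal l G ⟩
    ∑[ p ≤ l ] (+ (l C p) * G p (suc (l ∸ p))) + ∑[ p ≤ l ] (+ (l C p) * G (suc p) (l ∸ p))
      ≡⟨ cong₂ _+_ new-pair reused-colour ⟩
    y * ∑[ p ≤ l ] polyK-term Φ l (y - + 2) (h + + 1) p + h * ∑[ p ≤ l ] polyK-term Φ l y (h - + 1) p
      ≡⟨ sym (cong₂ (λ u v → y * u + h * v) (polyK-closed Φ l (y - + 2) (h + + 1)) (polyK-closed Φ l y (h - + 1))) ⟩
    polyK Φ (suc l) y h ∎)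
    where
    open ≡-Reasoning
    open PolyKStep Φ l y h

  polyK-at-0 : ∀ Φ l y → polyK Φ l y (+ 0) ≡ polyK₀ Φ l y (+ 0)
  polyK-at-0 Φ l y = begin
    polyK Φ l y (+ 0)
      ≡⟨ polyK-closed Φ l y (+ 0) ⟩
    polyK-term Φ l y (+ 0) 0 + ∑[ p < l ] polyK-term Φ l y (+ 0) (suc p)
      ≡⟨ cong (_+_ (polyK-term Φ l y (+ 0) 0)) (∑-zero l (λ p _ → no-reuse p)) ⟩
    + 1 * (+ 1 * polyK₀ Φ l y (+ 0 - + 0)) + + 0
      ≡⟨ normalise (polyK₀ Φ l y (+ 0)) ⟩
    polyK₀ Φ l y (+ 0) ∎
    where
    open ≡-Reasoning
    normalise : ∀ z → + 1 * (+ 1 * z) + + 0 ≡ z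
    normalise = solve-∀
    no-reuse : ∀ p → polyK-term Φ l y (+ 0) (suc p) ≡ + 0
    no-reuse p rewrite falling-unfoldˡ (+ 0) p = ℤP.*-zeroʳ (+ (l C suc p))


module BlockPoly where

  open import Data.Nat as ℕ using (ℕ; zero; suc; s≤s; _∸_)
  import Data.Nat.Properties as ℕP
  open import Data.Nat.Combinatorics using (_C_)
  open import Data.Integer using (ℤ; +_; _+_; _-_; _*_)
  import Data.Integer.Properties as ℤP
  open import Data.Integer.Tactic.RingSolver using (solve-∀)
  open import Relation.Binary.PropositionalEquality
  open import Defs using (falling; falling2; S)
  open RangeSum
  open Factorials
  open CliquePoly

  polyB : (ℤ → ℤ → ℤ) → ℕ → ℤ → ℤ → ℤ → ℤ → ℤ
  polyB Ω zero    y ha hb r = Ω y r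
  polyB Ω (suc m) y ha hb r =
    y * polyB Ω m (y - + 2) ha (hb + + 1) (r + + 1) + ha * polyB Ω m y (ha - + 1) hb r
    + hb * polyB Ω m y ha (hb - + 1) (r - + 1)

  shift : (ℤ → ℤ → ℤ) → ℤ → ℤ → ℤ → ℤ
  shift Ω d y h = Ω y (h + d)

  polyB-term : (ℤ → ℤ → ℤ) → ℕ → ℤ → ℤ → ℤ → ℤ → ℕ → ℤ
  polyB-term Ω m y ha hb r i = + (m C i) * (falling ha i * polyK (shift Ω (r - hb)) (m ∸ i) y hb)

  private
    module PolyBStep (Ω : ℤ → ℤ → ℤ) (m : ℕ) (y ha hb r : ℤ) where

      G : ℕ → ℕ → ℤ
      G i k = falling ha i * polyK (shift Ω (r - hb)) k y hb

      Tʸ Tʰ Tᵃ : ℕ → ℤ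
      Tʸ = polyB-term Ω m (y - + 2) ha (hb + + 1) (r + + 1)
      Tʰ = polyB-term Ω m y ha (hb - + 1) (r - + 1)
      Tᵃ = polyB-term Ω m y (ha - + 1) hb r

      new-or-B-partner : ∑[ i ≤ m ] (+ (m C i) * G i (suc (m ∸ i))) ≡ y * ∑≤ m Tʸ + hb * ∑≤ m Tʰ
      new-or-B-partner = begin
        ∑[ i ≤ m ] (+ (m C i) * G i (suc (m ∸ i)))
          ≡⟨ ∑-cong (suc m) split ⟩
        ∑[ i ≤ m ] (y * Tʸ i + hb * Tʰ i)
          ≡⟨ ∑-distrib-+ (suc m) (λ i → y * Tʸ i) (λ i → hb * Tʰ i) ⟩
        ∑[ i ≤ m ] (y * Tʸ i) + ∑[ i ≤ m ] (hb * Tʰ i)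
          ≡⟨ sym (cong₂ _+_ (*-distribˡ-∑ (suc m) y Tʸ) (*-distribˡ-∑ (suc m) hb Tʰ)) ⟩
        y * ∑≤ m Tʸ + hb * ∑≤ m Tʰ ∎
        where
        open ≡-Reasoning
        distrib : ∀ c F y P hb Q → c * (F * (y * P + hb * Q)) ≡ y * (c * (F * P)) + hb * (c * (F * Q))
        distrib = solve-∀
        invariant₊ : ∀ r hb → r + + 1 - (hb + + 1) ≡ r - hb
        invariant₊ = solve-∀
        invariant₋ : ∀ r hb → r - + 1 - (hb - + 1) ≡ r - hb
        invariant₋ = solve-∀
        split : ∀ i → + (m C i) * G i (suc (m ∸ i)) ≡ y * Tʸ i + hb * Tʰ i
        split i = trans (distrib (+ (m C i)) (falling ha i) y _ hb _)
          (cong₂ (λ d₁ d₂ → y * (+ (m C i) * (falling ha i * polyK (shift Ω d₁) (m ∸ i) (y - + 2) (hb + + 1)))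
                            + hb * (+ (m C i) * (falling ha i * polyK (shift Ω d₂) (m ∸ i) y (hb - + 1))))
                 (sym (invariant₊ r hb)) (sym (invariant₋ r hb)))

      A-colour : ∑[ i ≤ m ] (+ (m C i) * G (suc i) (m ∸ i)) ≡ ha * ∑≤ m Tᵃ
      A-colour = trans (∑-cong (suc m) unfold) (sym (*-distribˡ-∑ (suc m) ha Tᵃ))
        where
        regroup : ∀ c ha F P → c * (ha * F * P) ≡ ha * (c * (F * P))
        regroup = solve-∀
        unfold : ∀ i → + (m C i) * G (suc i) (m ∸ i) ≡ ha * Tᵃ i
        unfold i = trans (cong (λ F → + (m C i) * (F * polyK (shift Ω (r - hb)) (m ∸ i) y hb)) (falling-unfoldˡ ha i))
                         (regroup (+ (m C i)) ha (falling (ha - + 1) i) _)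

  polyB-closed : ∀ Ω m y ha hb r → polyB Ω m y ha hb r ≡ ∑[ i ≤ m ] polyB-term Ω m y ha hb r i
  polyB-closed Ω zero    y ha hb r = trans (cong (Ω y) (r≡hb+[r-hb] r hb)) (sym (normalise (Ω y (hb + (r - hb)))))
    where
    r≡hb+[r-hb] : ∀ r hb → r ≡ hb + (r - hb)
    r≡hb+[r-hb] = solve-∀
    normalise : ∀ z → + 1 * (+ 1 * z) + + 0 ≡ z
    normalise = solve-∀
  polyB-closed Ω (suc m) y ha hb r = sym (begin
    ∑[ i ≤ suc m ] polyB-term Ω (suc m) y ha hb r i
      ≡⟨ ∑-C-pascal m G ⟩
    ∑[ i ≤ m ] (+ (m C i) * G i (suc (m ∸ i))) + ∑[ i ≤ m ] (+ (m C i) * G (suc i) (m ∸ i))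
      ≡⟨ cong₂ _+_ new-or-B-partner A-colour ⟩
    y * ∑≤ m Tʸ + hb * ∑≤ m Tʰ + ha * ∑≤ m Tᵃ
      ≡⟨ regroup (y * ∑≤ m Tʸ) (hb * ∑≤ m Tʰ) (ha * ∑≤ m Tᵃ) ⟩
    y * ∑≤ m Tʸ + ha * ∑≤ m Tᵃ + hb * ∑≤ m Tʰ
      ≡⟨ sym (cong₂ _+_ (cong₂ _+_ (cong (y *_) (polyB-closed Ω m (y - + 2) ha (hb + + 1) (r + + 1)))
                                   (cong (ha *_) (polyB-closed Ω m y (ha - + 1) hb r)))
                        (cong (hb *_) (polyB-closed Ω m y ha (hb - + 1) (r - + 1)))) ⟩
    polyB Ω (suc m) y ha hb r ∎)
    where
    open ≡-Reasoning
    open PolyBStep Ω m y ha hb r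
    regroup : ∀ a b d → a + b + d ≡ a + d + b
    regroup = solve-∀

  -- The A-block, where h counts colours available again to A (opposite to a lone A-colour) and
  -- h′ the colours that B may share with A; the two move together.
  polyA : (ℤ → ℤ → ℤ → ℤ) → ℕ → ℤ → ℤ → ℤ → ℤ
  polyA Θ zero    y h h′ = Θ y h h′
  polyA Θ (suc l) y h h′ = y * polyA Θ l (y - + 2) (h + + 1) (h′ + + 1) + h * polyA Θ l y (h - + 1) (h′ - + 1)

  polyA≡polyK : ∀ Θ l y h h′ → polyA Θ l y h h′ ≡ polyK (λ y′ k → Θ y′ k (k + (h′ - h))) l y h
  polyA≡polyK Θ zero    y h h′ = cong (Θ y h) (h′≡h+[h′-h] h h′)
    where
    h′≡h+[h′-h] : ∀ h h′ → h′ ≡ h + (h′ - h)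
    h′≡h+[h′-h] = solve-∀
  polyA≡polyK Θ (suc l) y h h′ = cong₂ (λ u v → y * u + h * v)
    (trans (polyA≡polyK Θ l (y - + 2) (h + + 1) (h′ + + 1))
           (cong (λ d → polyK (λ y′ k → Θ y′ k (k + d)) l (y - + 2) (h + + 1)) (invariant₊ h′ h)))
    (trans (polyA≡polyK Θ l y (h - + 1) (h′ - + 1))
           (cong (λ d → polyK (λ y′ k → Θ y′ k (k + d)) l y (h - + 1)) (invariant₋ h′ h)))
    where
    invariant₊ : ∀ h′ h → h′ + + 1 - (h + + 1) ≡ h′ - h
    invariant₊ = solve-∀
    invariant₋ : ∀ h′ h → h′ - + 1 - (h - + 1) ≡ h′ - h
    invariant₋ = solve-∀

  -- The N-block, a negative clique: a vertex takes a new pair (y), after which its colour stays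
  -- available to later N-vertices while the opposite one does not, or one of the r colours
  -- already available.
  polyN : ℕ → ℤ → ℤ → ℤ
  polyN zero    y r = + 1
  polyN (suc n) y r = y * polyN n (y - + 2) (r + + 1) + r * polyN n y r

  -- Colourings of s labelled classes by distinct colours, t of which come from the r available ones.
  polyClasses : ℕ → ℤ → ℤ → ℤ
  polyClasses s y r = ∑[ t ≤ s ] (+ (s C t) * (falling2 y (s ∸ t) * falling r t))

  polyClasses-suc : ∀ s y r →
    polyClasses (suc s) y r ≡ y * polyClasses s (y - + 2) r + r * polyClasses s y (r - + 1)
  polyClasses-suc s y r = trans (∑-C-pascal s (λ t k → falling2 y k * falling r t))
    (cong₂ _+_
      (trans (∑-cong (suc s) (λ t → trans (cong (λ F → + (s C t) * (F * falling r t)) (falling2-unfoldˡ y (s ∸ t)))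
                                          (pull-y (+ (s C t)) y (falling2 (y - + 2) (s ∸ t)) (falling r t))))
             (sym (*-distribˡ-∑ (suc s) y (λ t → + (s C t) * (falling2 (y - + 2) (s ∸ t) * falling r t)))))
      (trans (∑-cong (suc s) (λ t → trans (cong (λ F → + (s C t) * (falling2 y (s ∸ t) * F)) (falling-unfoldˡ r t))
                                          (pull-r (+ (s C t)) r (falling2 y (s ∸ t)) (falling (r - + 1) t))))
             (sym (*-distribˡ-∑ (suc s) r (λ t → + (s C t) * (falling2 y (s ∸ t) * falling (r - + 1) t))))))
    where
    pull-y : ∀ c y F G → c * (y * F * G) ≡ y * (c * (F * G))
    pull-y = solve-∀
    pull-r : ∀ c r F G → c * (F * (r * G)) ≡ r * (c * (F * G))
    pull-r = solve-∀

  polyClasses-+1 : ∀ s y r → polyClasses s y (r + + 1) ≡ polyClasses s y r + + s * polyClasses (s ∸ 1) y r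
  polyClasses-+1 zero    y r = refl
  polyClasses-+1 (suc s) y r = begin
    polyClasses (suc s) y (r + + 1)
      ≡⟨ ∑-cong (suc (suc s)) split ⟩
    ∑[ t ≤ suc s ] (term t + shifted t)
      ≡⟨ ∑-distrib-+ (suc (suc s)) term shifted ⟩
    polyClasses (suc s) y r + ∑[ t ≤ suc s ] shifted t
      ≡⟨ cong (_+_ (polyClasses (suc s) y r))
              (trans (∑-dropHead (suc s) shifted (cong (+ (suc s C 0) *_) (ℤP.*-zeroʳ (falling2 y (suc s)))))
                     (trans (∑-cong (suc s) absorbed) (sym (*-distribˡ-∑ (suc s) (+ suc s) term′)))) ⟩
    polyClasses (suc s) y r + + suc s * polyClasses s y r ∎
    where
    open ≡-Reasoning
    term shifted term′ : ℕ → ℤ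
    term    t = + (suc s C t) * (falling2 y (suc s ∸ t) * falling r t)
    shifted t = + (suc s C t) * (falling2 y (suc s ∸ t) * (+ t * falling r (t ∸ 1)))
    term′   t = + (s C t) * (falling2 y (s ∸ t) * falling r t)
    distrib : ∀ c F a b → c * (F * (a + b)) ≡ c * (F * a) + c * (F * b)
    distrib = solve-∀
    split : ∀ t → + (suc s C t) * (falling2 y (suc s ∸ t) * falling (r + + 1) t) ≡ term t + shifted t
    split t = trans (cong (λ F → + (suc s C t) * (falling2 y (suc s ∸ t) * F)) (falling-pascal r t))
                    (distrib (+ (suc s C t)) (falling2 y (suc s ∸ t)) (falling r t) (+ t * falling r (t ∸ 1)))
    regroup : ∀ c F t G → c * (F * (t * G)) ≡ t * c * (F * G)
    regroup = solve-∀
    absorbed : ∀ t → shifted (suc t) ≡ + suc s * term′ t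
    absorbed t = begin
      shifted (suc t)
        ≡⟨ regroup (+ (suc s C suc t)) (falling2 y (s ∸ t)) (+ suc t) (falling r t) ⟩
      + suc t * + (suc s C suc t) * (falling2 y (s ∸ t) * falling r t)
        ≡⟨ cong (_* (falling2 y (s ∸ t) * falling r t))
                (trans (sym (ℤP.pos-* (suc t) (suc s C suc t)))
                       (trans (cong +_ (C-absorb-suc s t)) (ℤP.pos-* (suc s) (s C t)))) ⟩
      + suc s * + (s C t) * (falling2 y (s ∸ t) * falling r t)
        ≡⟨ ℤP.*-assoc (+ suc s) (+ (s C t)) _ ⟩
      + suc s * (+ (s C t) * (falling2 y (s ∸ t) * falling r t)) ∎

  -- A new N-vertex joins one of the s existing classes or opens a new one.
  polyClasses-Stirling-step : ∀ s y r →
    + s * polyClasses s y r + polyClasses (suc s) y r ≡ y * polyClasses s (y - + 2) (r + + 1) + r * polyClasses s y r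
  polyClasses-Stirling-step s y r = begin
    + s * polyClasses s y r + polyClasses (suc s) y r
      ≡⟨ cong₂ _+_ (s*classes s) (polyClasses-suc s y r) ⟩
    + s * (y * P₋ʸ + r * P₋ʳ) + (y * Pʸ + r * Pʳ)
      ≡⟨ regroup (+ s) y r P₋ʸ P₋ʳ Pʸ Pʳ ⟩
    y * (Pʸ + + s * P₋ʸ) + r * (Pʳ + + s * P₋ʳ)
      ≡⟨ sym (cong₂ (λ u v → y * u + r * v) (polyClasses-+1 s (y - + 2) r)
                    (trans (cong (polyClasses s y) (r≡r-1+1 r)) (polyClasses-+1 s y (r - + 1)))) ⟩
    y * polyClasses s (y - + 2) (r + + 1) + r * polyClasses s y r ∎
    where
    open ≡-Reasoning
    P₋ʸ = polyClasses (s ∸ 1) (y - + 2) r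
    P₋ʳ = polyClasses (s ∸ 1) y (r - + 1)
    Pʸ = polyClasses s (y - + 2) r
    Pʳ = polyClasses s y (r - + 1)
    s*classes : ∀ s → + s * polyClasses s y r
                      ≡ + s * (y * polyClasses (s ∸ 1) (y - + 2) r + r * polyClasses (s ∸ 1) y (r - + 1))
    s*classes zero    = refl
    s*classes (suc s) = cong (+ suc s *_) (polyClasses-suc s y r)
    r≡r-1+1 : ∀ r → r ≡ r - + 1 + + 1
    r≡r-1+1 = solve-∀
    regroup : ∀ s y r a b c d → s * (y * a + r * b) + (y * c + r * d) ≡ y * (c + s * a) + r * (d + s * b)
    regroup = solve-∀

  S-vanishes : ∀ n s → n ℕ.< s → S n s ≡ 0
  S-vanishes zero    (suc s) _ = refl
  S-vanishes (suc n) (suc s) (s≤s n<s)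
    rewrite S-vanishes n (suc s) (ℕP.m≤n⇒m≤1+n n<s) | S-vanishes n s n<s =
    trans (ℕP.+-identityʳ _) (ℕP.*-zeroʳ (suc s))

  private
    module PolyNStep (n : ℕ) (y r : ℤ) where

      P : ℕ → ℤ
      P s = polyClasses s y r

      Stirling-split : ∑[ s ≤ n ] (+ S (suc n) (suc s) * P (suc s))
                       ≡ ∑[ s ≤ n ] (+ s * (+ S n s * P s) + + S n s * P (suc s))
      Stirling-split = begin
        ∑[ s ≤ n ] (+ S (suc n) (suc s) * P (suc s))
          ≡⟨ ∑-cong (suc n) recurrence ⟩
        ∑[ s ≤ n ] (+ suc s * (+ S n (suc s) * P (suc s)) + joins s)
          ≡⟨ ∑-distrib-+ (suc n) (λ s → + suc s * (+ S n (suc s) * P (suc s))) joins ⟩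
        ∑[ s ≤ n ] (+ suc s * (+ S n (suc s) * P (suc s))) + ∑≤ n joins
          ≡⟨ cong (_+ ∑≤ n joins) reindex ⟩
        ∑[ s ≤ n ] (+ s * (+ S n s * P s)) + ∑≤ n joins
          ≡⟨ sym (∑-distrib-+ (suc n) (λ s → + s * (+ S n s * P s)) joins) ⟩
        ∑[ s ≤ n ] (+ s * (+ S n s * P s) + joins s) ∎
        where
        open ≡-Reasoning
        joins : ℕ → ℤ
        joins s = + S n s * P (suc s)
        distrib : ∀ a b c P → (a * b + c) * P ≡ a * (b * P) + c * P
        distrib = solve-∀
        recurrence : ∀ s → + S (suc n) (suc s) * P (suc s) ≡ + suc s * (+ S n (suc s) * P (suc s)) + joins s
        recurrence s = trans (cong (_* P (suc s)) (trans (ℤP.pos-+ (suc s ℕ.* S n (suc s)) (S n s))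
                                                         (cong (_+ + S n s) (ℤP.pos-* (suc s) (S n (suc s))))))
                             (distrib (+ suc s) (+ S n (suc s)) (+ S n s) (P (suc s)))
        vanish : ∀ a P → a * (+ 0 * P) ≡ + 0
        vanish = solve-∀
        reindex : ∑[ s ≤ n ] (+ suc s * (+ S n (suc s) * P (suc s))) ≡ ∑[ s ≤ n ] (+ s * (+ S n s * P s))
        reindex = trans (sym (∑-dropHead (suc n) (λ s → + s * (+ S n s * P s)) refl))
                        (∑-dropLast (suc n) (λ s → + s * (+ S n s * P s))
                                    (trans (cong (λ c → + suc n * (+ c * P (suc n))) (S-vanishes n (suc n) (ℕP.n<1+n n)))
                                           (vanish (+ suc n) (P (suc n)))))

      step : ∀ s → + s * (+ S n s * P s) + + S n s * P (suc s)
                   ≡ y * (+ S n s * polyClasses s (y - + 2) (r + + 1)) + r * (+ S n s * P s)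
      step s = trans (factor (+ s) (+ S n s) (P s) (P (suc s)))
                     (trans (cong (+ S n s *_) (polyClasses-Stirling-step s y r)) (distrib (+ S n s) y r _ _))
        where
        factor : ∀ s c P Q → s * (c * P) + c * Q ≡ c * (s * P + Q)
        factor = solve-∀
        distrib : ∀ c y r a b → c * (y * a + r * b) ≡ y * (c * a) + r * (c * b)
        distrib = solve-∀

  polyN-closed : ∀ n y r → polyN n y r ≡ ∑[ s ≤ n ] (+ S n s * polyClasses s y r)
  polyN-closed zero    y r = refl
  polyN-closed (suc n) y r = sym (begin
    + 0 * P 0 + ∑[ s ≤ n ] (+ S (suc n) (suc s) * P (suc s))
      ≡⟨ trans (ℤP.+-identityˡ _) Stirling-split ⟩
    ∑[ s ≤ n ] (+ s * (+ S n s * P s) + + S n s * P (suc s))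
      ≡⟨ ∑-cong (suc n) step ⟩
    ∑[ s ≤ n ] (y * newʸ s + r * same s)
      ≡⟨ trans (∑-distrib-+ (suc n) (λ s → y * newʸ s) (λ s → r * same s))
               (sym (cong₂ _+_ (*-distribˡ-∑ (suc n) y newʸ) (*-distribˡ-∑ (suc n) r same))) ⟩
    y * ∑≤ n newʸ + r * ∑≤ n same
      ≡⟨ sym (cong₂ (λ u v → y * u + r * v) (polyN-closed n (y - + 2) (r + + 1)) (polyN-closed n y r)) ⟩
    polyN (suc n) y r ∎)
    where
    open ≡-Reasoning
    open PolyNStep n y r
    newʸ same : ℕ → ℤ
    newʸ s = + S n s * polyClasses s (y - + 2) (r + + 1)
    same s = + S n s * P s


module Expansion where

  open import Data.Nat as ℕ using (ℕ; suc; s≤s; _∸_; _!; _⊓_)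
  import Data.Nat.Properties as ℕP
  open import Data.Nat.Combinatorics using (_C_; k>n⇒nCk≡0)
  open import Data.Nat.DivMod using (_/_; m/n≤m; /-monoˡ-≤; m*n/n≡m)
  open import Data.Integer using (ℤ; +_; _+_; _-_; _*_)
  import Data.Integer.Properties as ℤP
  open import Data.Integer.Tactic.RingSolver using (solve-∀)
  import Data.Nat.Tactic.RingSolver as ℕSolver
  open import Function using (_∘_)
  open import Relation.Binary.PropositionalEquality
  open import Relation.Nullary using (yes; no)
  open import Data.Empty using (⊥-elim)
  open import Defs using (falling; falling2; fallingℕ; S; T; U; H4ℕ; sumTo)
  open RangeSum
  open Factorials
  open CliquePoly
  open BlockPoly

  polyBN : ℕ → ℕ → ℤ → ℤ → ℤ → ℤ
  polyBN m n y h h′ = polyB (polyN n) m y h′ (+ 0) h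

  -- the number of proper colourings of Σ by x colours closed under negation and without 0
  polyΣ : ℕ → ℕ → ℕ → ℤ → ℤ
  polyΣ l m n x = polyA (polyBN m n) l x (+ 0) (+ 0)

  polyBN-summand : ℕ → ℕ → ℤ → ℤ → ℕ → ℕ → ℤ
  polyBN-summand m n y h i k =
    + matchings (m ∸ i) k * (falling2 y (m ∸ i ∸ k) * polyN n (y - + (2 ℕ.* (m ∸ i ∸ k))) (+ (m ∸ i) - + (2 ℕ.* k) + h))

  polyBN-expand : ∀ m n y h →
    polyBN m n y h h ≡ ∑[ i ≤ m ] (+ (m C i) * (falling h i * ∑≤ (m ∸ i) (polyBN-summand m n y h i)))
  polyBN-expand m n y h = trans (polyB-closed (polyN n) m y h (+ 0) h) (∑-cong (suc m) expand-i)
    where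
    Φ = shift (polyN n) (h - + 0)
    normalise : ∀ a b h → + 0 + a - b + (h - + 0) ≡ a - b + h
    normalise = solve-∀
    expand-k : ∀ i k → polyK₀-term Φ (m ∸ i) y (+ 0) k ≡ polyBN-summand m n y h i k
    expand-k i k = cong (λ r → + matchings (m ∸ i) k * (falling2 y (m ∸ i ∸ k) * polyN n (y - + (2 ℕ.* (m ∸ i ∸ k))) r))
                        (normalise (+ (m ∸ i)) (+ (2 ℕ.* k)) h)
    expand-i : ∀ i → polyB-term (polyN n) m y h (+ 0) h i ≡ + (m C i) * (falling h i * ∑≤ (m ∸ i) (polyBN-summand m n y h i))
    expand-i i = cong (λ P → + (m C i) * (falling h i * P))
      (trans (polyK-at-0 Φ (m ∸ i) y) (trans (polyK₀-closed Φ (m ∸ i) y (+ 0)) (∑-cong (suc (m ∸ i)) (expand-k i))))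

  polyΣ-summand : ℕ → ℕ → ℕ → ℤ → ℕ → ℤ
  polyΣ-summand l m n x j =
    + matchings l j * (falling2 x (l ∸ j) * polyBN m n (x - + (2 ℕ.* (l ∸ j))) (+ l - + (2 ℕ.* j)) (+ l - + (2 ℕ.* j)))

  polyΣ-expand : ∀ l m n x → polyΣ l m n x ≡ ∑[ j ≤ l ] polyΣ-summand l m n x j
  polyΣ-expand l m n x = begin
    polyΣ l m n x                        ≡⟨ polyA≡polyK (polyBN m n) l x (+ 0) (+ 0) ⟩
    polyK Φ l x (+ 0)                    ≡⟨ polyK-at-0 Φ l x ⟩
    polyK₀ Φ l x (+ 0)                   ≡⟨ polyK₀-closed Φ l x (+ 0) ⟩
    ∑≤ l (polyK₀-term Φ l x (+ 0))       ≡⟨ ∑-cong (suc l) expand-j ⟩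
    ∑≤ l (polyΣ-summand l m n x)         ∎
    where
    open ≡-Reasoning
    Φ : ℤ → ℤ → ℤ
    Φ y k = polyBN m n y k (k + (+ 0 - + 0))
    expand-j : ∀ j → polyK₀-term Φ l x (+ 0) j ≡ polyΣ-summand l m n x j
    expand-j j = cong₂ (λ h h′ → + matchings l j * (falling2 x (l ∸ j) * polyBN m n (x - + (2 ℕ.* (l ∸ j))) h h′))
      h≡ (trans (ℤP.+-identityʳ _) h≡)
      where
      h≡ : + 0 + + l - + (2 ℕ.* j) ≡ + l - + (2 ℕ.* j)
      h≡ = cong (_- + (2 ℕ.* j)) (ℤP.+-identityˡ (+ l))

  m/2<n⇒m<n+n : ∀ a k → a / 2 ℕ.< k → a ℕ.< k ℕ.+ k
  m/2<n⇒m<n+n a k a/2<k with k ℕ.+ k ℕ.≤? a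
  ... | no  2k≰a = ℕP.≰⇒> 2k≰a
  ... | yes 2k≤a = ⊥-elim (ℕP.<⇒≱ a/2<k (subst (ℕ._≤ a / 2) [k+k]/2≡k (/-monoˡ-≤ 2 2k≤a)))
    where
    [k+k]/2≡k : (k ℕ.+ k) / 2 ≡ k
    [k+k]/2≡k = trans (cong (_/ 2) (trans (sym (2*n≡n+n k)) (ℕP.*-comm 2 k))) (m*n/n≡m k 2)

  -- Summation indices: j pairs {c, -c} inside A, i colours shared by A and B, k pairs inside B,
  -- s colour classes of N, t of which take the opposite of a colour used by a single vertex.
  module _ (l m n : ℕ) (x : ℤ) where

    yA : ℕ → ℤ
    yA j = x - + (2 ℕ.* (l ∸ j))

    hA : ℕ → ℤ
    hA j = + l - + (2 ℕ.* j)

    yB : ℕ → ℕ → ℕ → ℤ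
    yB j i k = yA j - + (2 ℕ.* (m ∸ i ∸ k))

    rB : ℕ → ℕ → ℕ → ℤ
    rB j i k = + (m ∸ i) - + (2 ℕ.* k) + hA j

    ctxA : ℕ → ℤ → ℤ
    ctxA j = (+ matchings l j *_) ∘ (falling2 x (l ∸ j) *_)

    ctxB : ℕ → ℕ → ℤ → ℤ
    ctxB j i = ctxA j ∘ (+ (m C i) *_) ∘ (falling (hA j) i *_)

    ctxK : ℕ → ℕ → ℕ → ℤ → ℤ
    ctxK j i k = ctxB j i ∘ (+ matchings (m ∸ i) k *_) ∘ (falling2 (yA j) (m ∸ i ∸ k) *_)

    ctxS : ℕ → ℕ → ℕ → ℕ → ℤ → ℤ
    ctxS j i k s = ctxK j i k ∘ (+ S n s *_)

    ctxA-additive : ∀ j → Additive (ctxA j)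
    ctxA-additive j = ∘-additive (*-additive (+ matchings l j)) (*-additive (falling2 x (l ∸ j)))

    ctxB-additive : ∀ j i → Additive (ctxB j i)
    ctxB-additive j i = ∘-additive (∘-additive (ctxA-additive j) (*-additive (+ (m C i)))) (*-additive (falling (hA j) i))

    ctxK-additive : ∀ j i k → Additive (ctxK j i k)
    ctxK-additive j i k = ∘-additive (∘-additive (ctxB-additive j i) (*-additive (+ matchings (m ∸ i) k)))
                                     (*-additive (falling2 (yA j) (m ∸ i ∸ k)))

    ctxS-additive : ∀ j i k s → Additive (ctxS j i k s)
    ctxS-additive j i k s = ∘-additive (ctxK-additive j i k) (*-additive (+ S n s))

    term : ℕ → ℕ → ℕ → ℕ → ℕ → ℤ
    term j i k s t = ctxS j i k s (+ (s C t) * (falling2 (yB j i k) (s ∸ t) * falling (rB j i k) t))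

    ∑ₛₜ : (ℕ → ℕ → ℤ) → ℤ
    ∑ₛₜ g = ∑[ s ≤ n ] ∑[ t ≤ s ] g s t

    polyΣ-flatten : polyΣ l m n x ≡ ∑[ j ≤ l ] ∑[ i ≤ m ] ∑[ k ≤ m ∸ i ] ∑ₛₜ (term j i k)
    polyΣ-flatten = trans (polyΣ-expand l m n x) (∑-cong (suc l) expand-j)
      where
      summandK : ℕ → ℕ → ℕ → ℤ
      summandK j = polyBN-summand m n (yA j) (hA j)
      summandB : ℕ → ℕ → ℤ
      summandB j i = + (m C i) * (falling (hA j) i * ∑≤ (m ∸ i) (summandK j i))
      expand-k : ∀ j i k → ctxB j i (summandK j i k) ≡ ∑ₛₜ (term j i k)
      expand-k j i k = trans (cong (ctxK j i k) (polyN-closed n (yB j i k) (rB j i k)))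
        (trans (∑-additive (ctxK-additive j i k) (suc n) (λ s → + S n s * polyClasses s (yB j i k) (rB j i k)))
               (∑-cong (suc n) (λ s → ∑-additive (ctxS-additive j i k s) (suc s)
                                                  (λ t → + (s C t) * (falling2 (yB j i k) (s ∸ t) * falling (rB j i k) t)))))
      expand-i : ∀ j i → ctxA j (summandB j i) ≡ ∑[ k ≤ m ∸ i ] ∑ₛₜ (term j i k)
      expand-i j i = trans (∑-additive (ctxB-additive j i) (suc (m ∸ i)) (summandK j i))
                           (∑-cong (suc (m ∸ i)) (expand-k j i))
      expand-j : ∀ j → ctxA j (polyBN m n (yA j) (hA j) (hA j)) ≡ ∑[ i ≤ m ] ∑[ k ≤ m ∸ i ] ∑ₛₜ (term j i k)
      expand-j j = trans (cong (ctxA j) (polyBN-expand m n (yA j) (hA j)))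
        (trans (∑-additive (ctxA-additive j) (suc m) (summandB j)) (∑-cong (suc m) (expand-i j)))

    coeff : ℕ → ℕ → ℕ → ℕ → ℕ → ℕ
    coeff i j k s t = i ! ℕ.* (l C i) ℕ.* (m C i) ℕ.* (s C t) ℕ.* S n s ℕ.* T (l ∸ i) j ℕ.* T (m ∸ i) k

    H4-term : ℕ → ℕ → ℕ → ℕ → ℕ → ℤ
    H4-term i j k s t = + coeff i j k s t * U x i j k l m s t

    coeff-vanishes-Cˡ : ∀ i j k s t → l ℕ.< i → coeff i j k s t ≡ 0
    coeff-vanishes-Cˡ i j k s t l<i rewrite k>n⇒nCk≡0 l<i | ℕP.*-zeroʳ (i !) = refl

    coeff-vanishes-Cᵐ : ∀ i j k s t → m ℕ.< i → coeff i j k s t ≡ 0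
    coeff-vanishes-Cᵐ i j k s t m<i rewrite k>n⇒nCk≡0 m<i | ℕP.*-zeroʳ (i ! ℕ.* (l C i)) = refl

    coeff-vanishes-Cˢ : ∀ i j k s t → s ℕ.< t → coeff i j k s t ≡ 0
    coeff-vanishes-Cˢ i j k s t s<t rewrite k>n⇒nCk≡0 s<t | ℕP.*-zeroʳ (i ! ℕ.* (l C i) ℕ.* (m C i)) = refl

    coeff-vanishes-Tˡ : ∀ i j k s t → l ∸ i ℕ.< j ℕ.+ j → coeff i j k s t ≡ 0
    coeff-vanishes-Tˡ i j k s t <2j
      rewrite T≡matchings (l ∸ i) j | matchings-vanishes (l ∸ i) j <2j
            | ℕP.*-zeroʳ (i ! ℕ.* (l C i) ℕ.* (m C i) ℕ.* (s C t) ℕ.* S n s) = refl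

    coeff-vanishes-Tᵐ : ∀ i j k s t → m ∸ i ℕ.< k ℕ.+ k → coeff i j k s t ≡ 0
    coeff-vanishes-Tᵐ i j k s t <2k
      rewrite T≡matchings (m ∸ i) k | matchings-vanishes (m ∸ i) k <2k
            | ℕP.*-zeroʳ (i ! ℕ.* (l C i) ℕ.* (m C i) ℕ.* (s C t) ℕ.* S n s ℕ.* T (l ∸ i) j) = refl

    ∑ₛₜ-vanishes : ∀ i j k → (∀ s t → coeff i j k s t ≡ 0) → ∑ₛₜ (H4-term i j k) ≡ + 0
    ∑ₛₜ-vanishes i j k vanishes = ∑-zero (suc n) (λ s _ → ∑-zero (suc s) (λ t _ →
      cong (λ c → + c * U x i j k l m s t) (vanishes s t)))

    zero-scales-equally : ∀ {c u v} → c ≡ 0 → + c * u ≡ + c * v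
    zero-scales-equally refl = refl

    coeff-scaled : ∀ i j k s t {u v} → (i ℕ.≤ m → k ℕ.+ k ℕ.≤ m ∸ i → t ℕ.≤ s → u ≡ v) →
      + coeff i j k s t * u ≡ + coeff i j k s t * v
    coeff-scaled i j k s t {u} {v} u≡v with i ℕ.≤? m | k ℕ.+ k ℕ.≤? m ∸ i | t ℕ.≤? s
    ... | yes i≤m | yes 2k≤m-i | yes t≤s = cong (+ coeff i j k s t *_) (u≡v i≤m 2k≤m-i t≤s)
    ... | no i≰m  | _          | _        = zero-scales-equally (coeff-vanishes-Cᵐ i j k s t (ℕP.≰⇒> i≰m))
    ... | yes _   | no 2k≰m-i  | _        = zero-scales-equally (coeff-vanishes-Tᵐ i j k s t (ℕP.≰⇒> 2k≰m-i))
    ... | yes _   | yes _      | no t≰s   = zero-scales-equally (coeff-vanishes-Cˢ i j k s t (ℕP.≰⇒> t≰s))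

    falling-part : ℕ → ℕ → ℕ → ℕ → ℕ → ℤ
    falling-part j i k s t =
      falling2 x (l ∸ j) * (falling2 (yA j) (m ∸ i ∸ k) * falling2 (yB j i k) (s ∸ t)) * falling (rB j i k) t

    term-factorised : ∀ j i k s t → term j i k s t ≡
      + matchings l j * falling (hA j) i * + (m C i) * + matchings (m ∸ i) k * + S n s * + (s C t) * falling-part j i k s t
    term-factorised j i k s t =
      rearrange (+ matchings l j) (falling2 x (l ∸ j)) (+ (m C i)) (falling (hA j) i) (+ matchings (m ∸ i) k)
                (falling2 (yA j) (m ∸ i ∸ k)) (+ S n s) (+ (s C t)) (falling2 (yB j i k) (s ∸ t)) (falling (rB j i k) t)
      where
      rearrange : ∀ a F₁ c d e F₂ g h F₃ R →
        a * (F₁ * (c * (d * (e * (F₂ * (g * (h * (F₃ * R)))))))) ≡ a * d * c * e * g * h * (F₁ * (F₂ * F₃) * R)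
      rearrange = solve-∀

    index : ∀ {i j k s t} → j ℕ.≤ l → i ℕ.≤ m → k ℕ.≤ m ∸ i → t ℕ.≤ s →
      l ∸ j ℕ.+ (m ∸ i ∸ k ℕ.+ (s ∸ t)) ≡ l ℕ.+ m ℕ.+ s ∸ (i ℕ.+ j ℕ.+ k ℕ.+ t)
    index {i} {j} {k} {s} {t} j≤l i≤m k≤m-i t≤s = sym (begin
      l ℕ.+ m ℕ.+ s ∸ (i ℕ.+ j ℕ.+ k ℕ.+ t)
        ≡⟨ cong (_∸ (i ℕ.+ j ℕ.+ k ℕ.+ t)) (cong₂ ℕ._+_ (cong₂ ℕ._+_ l≡ m≡) s≡) ⟩
      (l ∸ j ℕ.+ j) ℕ.+ (m ∸ i ∸ k ℕ.+ k ℕ.+ i) ℕ.+ (s ∸ t ℕ.+ t) ∸ (i ℕ.+ j ℕ.+ k ℕ.+ t)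
        ≡⟨ cong (_∸ (i ℕ.+ j ℕ.+ k ℕ.+ t)) (regroup (l ∸ j) j (m ∸ i ∸ k) k i (s ∸ t) t) ⟩
      l ∸ j ℕ.+ (m ∸ i ∸ k ℕ.+ (s ∸ t)) ℕ.+ (i ℕ.+ j ℕ.+ k ℕ.+ t) ∸ (i ℕ.+ j ℕ.+ k ℕ.+ t)
        ≡⟨ ℕP.m+n∸n≡m _ (i ℕ.+ j ℕ.+ k ℕ.+ t) ⟩
      l ∸ j ℕ.+ (m ∸ i ∸ k ℕ.+ (s ∸ t)) ∎)
      where
      open ≡-Reasoning
      l≡ = sym (ℕP.m∸n+n≡m j≤l)
      m≡ = sym (trans (cong (ℕ._+ i) (ℕP.m∸n+n≡m k≤m-i)) (ℕP.m∸n+n≡m i≤m))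
      s≡ = sym (ℕP.m∸n+n≡m t≤s)
      regroup : ∀ a j b k i c t →
        a ℕ.+ j ℕ.+ (b ℕ.+ k ℕ.+ i) ℕ.+ (c ℕ.+ t) ≡ a ℕ.+ (b ℕ.+ c) ℕ.+ (i ℕ.+ j ℕ.+ k ℕ.+ t)
      regroup = ℕSolver.solve-∀

    rB≡ : ∀ j {i} k → i ℕ.≤ m → rB j i k ≡ + (l ℕ.+ m) - + i - + (2 ℕ.* j) - + (2 ℕ.* k)
    rB≡ j {i} k i≤m = trans (cong (λ d → d - + (2 ℕ.* k) + hA j) (pos-∸ i≤m))
                            (regroup (+ l) (+ m) (+ i) (+ (2 ℕ.* j)) (+ (2 ℕ.* k)))
      where
      regroup : ∀ l m i j k → m - i - k + (l - j) ≡ l + m - i - j - k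
      regroup = solve-∀

    falling-part≡U : ∀ {i j k s t} → j ℕ.≤ l → i ℕ.≤ m → k ℕ.≤ m ∸ i → t ℕ.≤ s →
      falling-part j i k s t ≡ U x i j k l m s t
    falling-part≡U {i} {j} {k} {s} {t} j≤l i≤m k≤m-i t≤s = cong₂ _*_
      (trans (cong (falling2 x (l ∸ j) *_) (sym (falling2-+ (yA j) (m ∸ i ∸ k) (s ∸ t))))
             (trans (sym (falling2-+ x (l ∸ j) (m ∸ i ∸ k ℕ.+ (s ∸ t))))
                    (cong (falling2 x) (index j≤l i≤m k≤m-i t≤s))))
      (cong (λ r → falling r t) (rB≡ j k i≤m))

    falling-hA : ∀ {j} i → j ℕ.+ j ℕ.≤ l → falling (hA j) i ≡ + fallingℕ (l ∸ (j ℕ.+ j)) i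
    falling-hA {j} i 2j≤l =
      trans (cong (λ h → falling h i) (trans (cong (λ d → + l - + d) (2*n≡n+n j)) (sym (pos-∸ 2j≤l))))
            (falling-pos (l ∸ (j ℕ.+ j)) i)

    pos-product : ∀ a b c d e f → + (a ℕ.* b ℕ.* c ℕ.* d ℕ.* e ℕ.* f) ≡ + a * + b * + c * + d * + e * + f
    pos-product a b c d e f =
      trans (ℤP.pos-* (a ℕ.* b ℕ.* c ℕ.* d ℕ.* e) f) (cong (_* + f)
      (trans (ℤP.pos-* (a ℕ.* b ℕ.* c ℕ.* d) e) (cong (_* + e)
      (trans (ℤP.pos-* (a ℕ.* b ℕ.* c) d) (cong (_* + d)
      (trans (ℤP.pos-* (a ℕ.* b) c) (cong (_* + c) (ℤP.pos-* a b))))))))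

    coeff-from-matchings : ∀ i j k s t →
      matchings l j ℕ.* fallingℕ (l ∸ (j ℕ.+ j)) i ℕ.* (m C i) ℕ.* matchings (m ∸ i) k ℕ.* S n s ℕ.* (s C t)
      ≡ coeff i j k s t
    coeff-from-matchings i j k s t = begin
      matchings l j ℕ.* fallingℕ (l ∸ (j ℕ.+ j)) i ℕ.* (m C i) ℕ.* matchings (m ∸ i) k ℕ.* S n s ℕ.* (s C t)
        ≡⟨ cong (λ z → z ℕ.* (m C i) ℕ.* matchings (m ∸ i) k ℕ.* S n s ℕ.* (s C t))
                (matchings-then-singletons l i j) ⟩
      i ! ℕ.* (l C i) ℕ.* matchings (l ∸ i) j ℕ.* (m C i) ℕ.* matchings (m ∸ i) k ℕ.* S n s ℕ.* (s C t)
        ≡⟨ regroup (i !) (l C i) (matchings (l ∸ i) j) (m C i) (matchings (m ∸ i) k) (S n s) (s C t) ⟩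
      i ! ℕ.* (l C i) ℕ.* (m C i) ℕ.* (s C t) ℕ.* S n s ℕ.* matchings (l ∸ i) j ℕ.* matchings (m ∸ i) k
        ≡⟨ sym (cong₂ (λ u v → i ! ℕ.* (l C i) ℕ.* (m C i) ℕ.* (s C t) ℕ.* S n s ℕ.* u ℕ.* v)
                      (T≡matchings (l ∸ i) j) (T≡matchings (m ∸ i) k)) ⟩
      coeff i j k s t ∎
      where
      open ≡-Reasoning
      regroup : ∀ f c ml cm mm sn cs →
        f ℕ.* c ℕ.* ml ℕ.* cm ℕ.* mm ℕ.* sn ℕ.* cs ≡ f ℕ.* c ℕ.* cm ℕ.* cs ℕ.* sn ℕ.* ml ℕ.* mm
      regroup = ℕSolver.solve-∀

    term≡H4-term : ∀ i j k s t → term j i k s t ≡ H4-term i j k s t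
    term≡H4-term i j k s t with j ℕ.+ j ℕ.≤? l
    ... | no 2j≰l = trans (term-factorised j i k s t) (trans
      (cong (λ M → + M * falling (hA j) i * + (m C i) * + matchings (m ∸ i) k * + S n s * + (s C t) * falling-part j i k s t)
            (matchings-vanishes l j (ℕP.≰⇒> 2j≰l)))
      (sym (cong (λ c → + c * U x i j k l m s t)
                 (coeff-vanishes-Tˡ i j k s t (ℕP.≤-<-trans (ℕP.m∸n≤m l i) (ℕP.≰⇒> 2j≰l))))))
    ... | yes 2j≤l = begin
      term j i k s t
        ≡⟨ term-factorised j i k s t ⟩
      + matchings l j * falling (hA j) i * + (m C i) * + matchings (m ∸ i) k * + S n s * + (s C t) * falling-part j i k s t
        ≡⟨ cong (λ F → + matchings l j * F * + (m C i) * + matchings (m ∸ i) k * + S n s * + (s C t) * falling-part j i k s t)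
                (falling-hA {j} i 2j≤l) ⟩
      + matchings l j * + fallingℕ (l ∸ (j ℕ.+ j)) i * + (m C i) * + matchings (m ∸ i) k * + S n s * + (s C t)
        * falling-part j i k s t
        ≡⟨ cong (_* falling-part j i k s t) (sym (pos-product (matchings l j) (fallingℕ (l ∸ (j ℕ.+ j)) i) (m C i)
                                                              (matchings (m ∸ i) k) (S n s) (s C t))) ⟩
      + (matchings l j ℕ.* fallingℕ (l ∸ (j ℕ.+ j)) i ℕ.* (m C i) ℕ.* matchings (m ∸ i) k ℕ.* S n s ℕ.* (s C t))
        * falling-part j i k s t
        ≡⟨ cong (λ c → + c * falling-part j i k s t) (coeff-from-matchings i j k s t) ⟩
      + coeff i j k s t * falling-part j i k s t
        ≡⟨ coeff-scaled i j k s t (λ i≤m 2k≤m-i t≤s →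
             falling-part≡U (ℕP.≤-trans (ℕP.m≤m+n j j) 2j≤l) i≤m (ℕP.≤-trans (ℕP.m≤m+n k k) 2k≤m-i) t≤s)
         ⟩
      H4-term i j k s t ∎
      where open ≡-Reasoning

    ∑ₛₜ-cong : ∀ {g h} → (∀ s t → g s t ≡ h s t) → ∑ₛₜ g ≡ ∑ₛₜ h
    ∑ₛₜ-cong g≡h = ∑-cong (suc n) (λ s → ∑-cong (suc s) (g≡h s))

    term-vanishes : ∀ j i k → (∀ s t → coeff i j k s t ≡ 0) → ∑ₛₜ (term j i k) ≡ + 0
    term-vanishes j i k vanishes = trans (∑ₛₜ-cong (term≡H4-term i j k)) (∑ₛₜ-vanishes i j k vanishes)

    B : ℕ
    B = suc (l ℕ.+ m)

    l<B : l ℕ.< B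
    l<B = s≤s (ℕP.m≤m+n l m)

    m<B : m ℕ.< B
    m<B = s≤s (ℕP.m≤n+m m l)

    polyΣ-box : ∑[ j ≤ l ] ∑[ i ≤ m ] ∑[ k ≤ m ∸ i ] ∑ₛₜ (term j i k)
                ≡ ∑[ j < B ] ∑[ i < B ] ∑[ k < B ] ∑ₛₜ (term j i k)
    polyΣ-box = ∑-box B (λ j i k → ∑ₛₜ (term j i k)) l (λ _ → m) (λ _ i → m ∸ i)
      l<B (λ _ → m<B) (λ _ i → ℕP.≤-<-trans (ℕP.m∸n≤m m i) m<B)
      (λ j i k l<j → term-vanishes j i k (λ s t →
         coeff-vanishes-Tˡ i j k s t (ℕP.≤-<-trans (ℕP.m∸n≤m l i) (ℕP.<-≤-trans l<j (ℕP.m≤m+n j j)))))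
      (λ j i k m<i → term-vanishes j i k (λ s t → coeff-vanishes-Cᵐ i j k s t m<i))
      (λ j i k m-i<k → term-vanishes j i k (λ s t →
         coeff-vanishes-Tᵐ i j k s t (ℕP.<-≤-trans m-i<k (ℕP.m≤m+n k k))))

    H4ℕ-∑ : H4ℕ l m n x
            ≡ ∑[ i ≤ l ⊓ m ] ∑[ j ≤ (l ∸ i) / 2 ] ∑[ k ≤ (m ∸ i) / 2 ] ∑ₛₜ (H4-term i j k)
    H4ℕ-∑ = trans (sumTo≡∑≤ (l ⊓ m) sumⱼ) (∑-cong (suc (l ⊓ m)) λ i →
            trans (sumTo≡∑≤ ((l ∸ i) / 2) (sumₖ i)) (∑-cong (suc ((l ∸ i) / 2)) λ j →
            trans (sumTo≡∑≤ ((m ∸ i) / 2) (sumₛₜ i j)) (∑-cong (suc ((m ∸ i) / 2)) λ k →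
            trans (sumTo≡∑≤ n (λ s → sumTo s (H4-term i j k s)))
                  (∑-cong (suc n) λ s → sumTo≡∑≤ s (H4-term i j k s)))))
      where
      sumₛₜ : ℕ → ℕ → ℕ → ℤ
      sumₛₜ i j k = sumTo n λ s → sumTo s (H4-term i j k s)
      sumₖ : ℕ → ℕ → ℤ
      sumₖ i j = sumTo ((m ∸ i) / 2) (sumₛₜ i j)
      sumⱼ : ℕ → ℤ
      sumⱼ i = sumTo ((l ∸ i) / 2) (sumₖ i)

    H4ℕ-box : H4ℕ l m n x ≡ ∑[ i < B ] ∑[ j < B ] ∑[ k < B ] ∑ₛₜ (H4-term i j k)
    H4ℕ-box = trans H4ℕ-∑ (∑-box B (λ i j k → ∑ₛₜ (H4-term i j k))
                                 (l ⊓ m) (λ i → (l ∸ i) / 2) (λ i _ → (m ∸ i) / 2)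
      (ℕP.≤-<-trans (ℕP.m⊓n≤m l m) l<B)
      (λ i → ℕP.≤-<-trans (ℕP.≤-trans (m/n≤m (l ∸ i) 2) (ℕP.m∸n≤m l i)) l<B)
      (λ i _ → ℕP.≤-<-trans (ℕP.≤-trans (m/n≤m (m ∸ i) 2) (ℕP.m∸n≤m m i)) m<B)
      (λ i j k l⊓m<i → ∑ₛₜ-vanishes i j k (A-or-B-missing l⊓m<i j k))
      (λ i j k <j → ∑ₛₜ-vanishes i j k (λ s t → coeff-vanishes-Tˡ i j k s t (m/2<n⇒m<n+n (l ∸ i) j <j)))
      (λ i j k <k → ∑ₛₜ-vanishes i j k (λ s t → coeff-vanishes-Tᵐ i j k s t (m/2<n⇒m<n+n (m ∸ i) k <k))))
      where
      A-or-B-missing : ∀ {i} → l ⊓ m ℕ.< i → ∀ j k s t → coeff i j k s t ≡ 0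
      A-or-B-missing {i} l⊓m<i j k s t with l ℕ.<? i | m ℕ.<? i
      ... | yes l<i | _       = coeff-vanishes-Cˡ i j k s t l<i
      ... | no _    | yes m<i = coeff-vanishes-Cᵐ i j k s t m<i
      ... | no l≮i  | no m≮i  = ⊥-elim (ℕP.<⇒≱ l⊓m<i (ℕP.⊓-glb (ℕP.≮⇒≥ l≮i) (ℕP.≮⇒≥ m≮i)))

    polyΣ≡H4ℕ : polyΣ l m n x ≡ H4ℕ l m n x
    polyΣ≡H4ℕ = begin
      polyΣ l m n x
        ≡⟨ polyΣ-flatten ⟩
      ∑[ j ≤ l ] ∑[ i ≤ m ] ∑[ k ≤ m ∸ i ] ∑ₛₜ (term j i k)
        ≡⟨ polyΣ-box ⟩
      ∑[ j < B ] ∑[ i < B ] ∑[ k < B ] ∑ₛₜ (term j i k)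
        ≡⟨ ∑-comm B B (λ j i → ∑[ k < B ] ∑ₛₜ (term j i k)) ⟩
      ∑[ i < B ] ∑[ j < B ] ∑[ k < B ] ∑ₛₜ (term j i k)
        ≡⟨ ∑-cong B (λ i → ∑-cong B (λ j → ∑-cong B (λ k → ∑ₛₜ-cong (term≡H4-term i j k)))) ⟩
      ∑[ i < B ] ∑[ j < B ] ∑[ k < B ] ∑ₛₜ (H4-term i j k)
        ≡⟨ sym H4ℕ-box ⟩
      H4ℕ l m n x ∎
      where open ≡-Reasoning


module ListSum where

  open import Data.Nat as ℕ using (ℕ; suc)
  import Data.Nat.Properties as ℕP
  import Data.Nat.Tactic.RingSolver as ℕSolver
  open import Data.Integer as ℤ using (ℤ)
  open import Data.Bool using (Bool; if_then_else_)
  open import Data.List as List using (List; []; _∷_; map; concatMap; length)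
  open import Data.List.Membership.Propositional using (_∈_; _∉_)
  open import Data.List.Relation.Unary.Any using (here; there)
  import Data.List.Relation.Unary.All as All
  open import Data.List.Relation.Unary.AllPairs using (_∷_)
  open import Data.List.Relation.Unary.Unique.Propositional using (Unique)
  open import Data.Empty using (⊥-elim)
  open import Function using (_∘_)
  open import Relation.Nullary using (does; yes; no)
  open import Relation.Nullary.Decidable using (dec-true; dec-false)
  open import Relation.Binary.PropositionalEquality

  sumOver : ∀ {X : Set} → List X → (X → ℕ) → ℕ
  sumOver []       g = 0
  sumOver (x ∷ xs) g = g x ℕ.+ sumOver xs g

  countTrue : ∀ {X : Set} → (X → Bool) → List X → ℕ
  countTrue b xs = sumOver xs (λ x → if b x then 1 else 0)


  sumOver-cong : ∀ {X : Set} (xs : List X) {g h} → (∀ x → x ∈ xs → g x ≡ h x) → sumOver xs g ≡ sumOver xs h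
  sumOver-cong []       eq = refl
  sumOver-cong (x ∷ xs) eq = cong₂ ℕ._+_ (eq x (here refl)) (sumOver-cong xs (λ y y∈ → eq y (there y∈)))

  sumOver-zero : ∀ {X : Set} (xs : List X) {g} → (∀ x → x ∈ xs → g x ≡ 0) → sumOver xs g ≡ 0
  sumOver-zero []       eq = refl
  sumOver-zero (x ∷ xs) eq = cong₂ ℕ._+_ (eq x (here refl)) (sumOver-zero xs (λ y y∈ → eq y (there y∈)))

  sumOver-++ : ∀ {X : Set} (xs ys : List X) g → sumOver (xs List.++ ys) g ≡ sumOver xs g ℕ.+ sumOver ys g
  sumOver-++ []       ys g = refl
  sumOver-++ (x ∷ xs) ys g = trans (cong (g x ℕ.+_) (sumOver-++ xs ys g)) (sym (ℕP.+-assoc (g x) _ _))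

  sumOver-distrib-+ : ∀ {X : Set} (xs : List X) g h → sumOver xs (λ x → g x ℕ.+ h x) ≡ sumOver xs g ℕ.+ sumOver xs h
  sumOver-distrib-+ []       g h = refl
  sumOver-distrib-+ (x ∷ xs) g h = trans (cong (g x ℕ.+ h x ℕ.+_) (sumOver-distrib-+ xs g h))
                                         (interchange (g x) (h x) _ _)
    where
    interchange : ∀ a b c d → a ℕ.+ b ℕ.+ (c ℕ.+ d) ≡ a ℕ.+ c ℕ.+ (b ℕ.+ d)
    interchange = ℕSolver.solve-∀

  *-distribˡ-sumOver : ∀ {X : Set} (xs : List X) k g → k ℕ.* sumOver xs g ≡ sumOver xs (λ x → k ℕ.* g x)
  *-distribˡ-sumOver []       k g = ℕP.*-zeroʳ k
  *-distribˡ-sumOver (x ∷ xs) k g =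
    trans (ℕP.*-distribˡ-+ k (g x) _) (cong (k ℕ.* g x ℕ.+_) (*-distribˡ-sumOver xs k g))

  sumOver-map : ∀ {X Y : Set} (f : X → Y) xs g → sumOver (map f xs) g ≡ sumOver xs (g ∘ f)
  sumOver-map f []       g = refl
  sumOver-map f (x ∷ xs) g = cong (g (f x) ℕ.+_) (sumOver-map f xs g)

  sumOver-concatMap : ∀ {X Y : Set} (f : X → List Y) xs g →
    sumOver (concatMap f xs) g ≡ sumOver xs (λ x → sumOver (f x) g)
  sumOver-concatMap f []       g = refl
  sumOver-concatMap f (x ∷ xs) g =
    trans (sumOver-++ (f x) (concatMap f xs) g) (cong (sumOver (f x) g ℕ.+_) (sumOver-concatMap f xs g))

  sumOver-1≡length : ∀ {X : Set} (xs : List X) → sumOver xs (λ _ → 1) ≡ length xs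
  sumOver-1≡length []       = refl
  sumOver-1≡length (x ∷ xs) = cong suc (sumOver-1≡length xs)

  erase : ℤ → (ℤ → ℕ) → ℤ → ℕ
  erase x g y = if does (y ℤ.≟ x) then 0 else g y

  erase-≢ : ∀ {x y} g → y ≢ x → erase x g y ≡ g y
  erase-≢ {x} {y} g y≢x rewrite dec-false (y ℤ.≟ x) y≢x = refl

  erase-≡ : ∀ x g → erase x g x ≡ 0
  erase-≡ x g rewrite dec-true (x ℤ.≟ x) refl = refl

  sumOver-remove : ∀ (xs : List ℤ) → Unique xs → ∀ {x} g → x ∈ xs →
    sumOver xs g ≡ g x ℕ.+ sumOver xs (erase x g)
  sumOver-remove (c ∷ xs) (c∉ ∷ _) g (here refl) = cong₂ ℕ._+_ refl
    (trans (sumOver-cong xs (λ y y∈ → sym (erase-≢ g (λ y≡c → All.lookup c∉ y∈ (sym y≡c)))))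
           (cong (ℕ._+ sumOver xs (erase c g)) (sym (erase-≡ c g))))
  sumOver-remove (c ∷ xs) (c∉ ∷ unique) {x} g (there x∈) = begin
    g c ℕ.+ sumOver xs g                                   ≡⟨ cong (g c ℕ.+_) (sumOver-remove xs unique g x∈) ⟩
    g c ℕ.+ (g x ℕ.+ sumOver xs (erase x g))               ≡⟨ swap (g c) (g x) _ ⟩
    g x ℕ.+ (g c ℕ.+ sumOver xs (erase x g))               ≡⟨ cong (λ v → g x ℕ.+ (v ℕ.+ sumOver xs (erase x g)))
                                                                   (sym (erase-≢ g (All.lookup c∉ x∈))) ⟩
    g x ℕ.+ sumOver (c ∷ xs) (erase x g)                   ∎
    where
    open ≡-Reasoning
    swap : ∀ a b c → a ℕ.+ (b ℕ.+ c) ≡ b ℕ.+ (a ℕ.+ c)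
    swap = ℕSolver.solve-∀

  sumOver-⊆ : ∀ (xs ys : List ℤ) → Unique xs → Unique ys → (∀ {x} → x ∈ xs → x ∈ ys) →
    ∀ g → (∀ y → y ∈ ys → y ∉ xs → g y ≡ 0) → sumOver xs g ≡ sumOver ys g
  sumOver-⊆ []       ys _              _  _  g outside = sym (sumOver-zero ys (λ y y∈ → outside y y∈ (λ ())))
  sumOver-⊆ (x ∷ xs) ys (x∉ ∷ uniqueˣ) uniqueʸ xs⊆ys g outside = begin
    g x ℕ.+ sumOver xs g
      ≡⟨ cong (g x ℕ.+_) (sumOver-cong xs (λ y y∈ → sym (erase-≢ g (λ y≡x → All.lookup x∉ y∈ (sym y≡x))))) ⟩
    g x ℕ.+ sumOver xs (erase x g)
      ≡⟨ cong (g x ℕ.+_) (sumOver-⊆ xs ys uniqueˣ uniqueʸ (xs⊆ys ∘ there) (erase x g) outside′) ⟩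
    g x ℕ.+ sumOver ys (erase x g)
      ≡⟨ sym (sumOver-remove ys uniqueʸ g (xs⊆ys (here refl))) ⟩
    sumOver ys g ∎
    where
    open ≡-Reasoning
    outside′ : ∀ y → y ∈ ys → y ∉ xs → erase x g y ≡ 0
    outside′ y y∈ y∉ with y ℤ.≟ x
    ... | yes _   = refl
    ... | no  y≢x = outside y y∈ λ { (here y≡x) → y≢x y≡x ; (there y∈′) → y∉ y∈′ }

  sumOver-same : ∀ (xs ys : List ℤ) → Unique xs → Unique ys →
    (∀ {x} → x ∈ xs → x ∈ ys) → (∀ {x} → x ∈ ys → x ∈ xs) →
    ∀ g → sumOver xs g ≡ sumOver ys g
  sumOver-same xs ys uniqueˣ uniqueʸ xs⊆ys ys⊆xs g =
    sumOver-⊆ xs ys uniqueˣ uniqueʸ xs⊆ys g (λ y y∈ y∉ → ⊥-elim (y∉ (ys⊆xs y∈)))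


module SequentialCount where

  open import Data.Nat as ℕ using (ℕ; zero; suc)
  open import Data.Integer as ℤ using (ℤ; -_; _*_)
  import Data.Integer.Properties as ℤP
  open import Data.Bool using (Bool; true; false; not; _∧_; _∨_; if_then_else_)
  import Data.Bool.Properties as BoolP
  open import Data.Fin as Fin using (Fin; zero; suc; splitAt)
  import Data.Fin.Properties as FinP
  open import Data.Vec as Vec using (Vec; []; _∷_; lookup; replicate; _++_)
  import Data.Vec.Properties as VecP
  open import Data.List using (List; []; _∷_; map; filter; length)
  open import Data.Maybe using (just; nothing)
  open import Data.Sum using (inj₁; inj₂; [_,_]′)
  import Data.Sum.Properties as SumP
  open import Data.Product using (_×_; _,_; proj₁; proj₂)
  open import Data.Unit using (tt)
  open import Data.Empty using (⊥-elim)
  open import Function using (_∘_; _⇔_; mk⇔; Equivalence)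
  open import Relation.Nullary using (yes; no; does)
  open import Relation.Nullary.Decidable using (does-⇔; dec-true; dec-false)
  open import Relation.Unary using (Decidable)
  open import Relation.Binary.PropositionalEquality
  open import Defs
  open ListSum

  -- The vertices of Σ come in three parts: A = +K_l, B = +K_m, N = -K_n.
  data Part : Set where
    A B N : Part

  edgeSign : Part → Part → Sign
  edgeSign A B = neg
  edgeSign B A = neg
  edgeSign N N = neg
  edgeSign A A = pos
  edgeSign A N = pos
  edgeSign B B = pos
  edgeSign B N = pos
  edgeSign N A = pos
  edgeSign N B = pos

  edgeSign-sym : ∀ t t′ → edgeSign t t′ ≡ edgeSign t′ t
  edgeSign-sym A A = refl
  edgeSign-sym A B = refl
  edgeSign-sym A N = refl
  edgeSign-sym B A = refl
  edgeSign-sym B B = refl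
  edgeSign-sym B N = refl
  edgeSign-sym N A = refl
  edgeSign-sym N B = refl
  edgeSign-sym N N = refl

  partGraph : ∀ {n} → (Fin n → Part) → SGraph n
  partGraph part i j = if does (i Fin.≟ j) then nothing else just (edgeSign (part i) (part j))

  K≡partGraph : ∀ t n (i j : Fin n) → K (edgeSign t t) n i j ≡ partGraph (λ _ → t) i j
  K≡partGraph t n i j with i Fin.≟ j
  ... | yes _ = refl
  ... | no  _ = refl

  ≟-splitAt : ∀ a {b} (i j : Fin (a ℕ.+ b)) →
    does (i Fin.≟ j) ≡ does (SumP.≡-dec Fin._≟_ Fin._≟_ (splitAt a i) (splitAt a j))
  ≟-splitAt a {b} i j =
    does-⇔ (mk⇔ (cong (splitAt a)) splitAt-injective) (i Fin.≟ j) (SumP.≡-dec Fin._≟_ Fin._≟_ (splitAt a i) (splitAt a j))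
    where
    splitAt-injective : splitAt a i ≡ splitAt a j → i ≡ j
    splitAt-injective eq =
      trans (sym (FinP.join-splitAt a b i)) (trans (cong (Fin.join a b) eq) (FinP.join-splitAt a b j))

  join≡partGraph : ∀ {a b} s (E₁ : SGraph a) (E₂ : SGraph b) part₁ part₂ →
    (∀ i j → E₁ i j ≡ partGraph part₁ i j) → (∀ i j → E₂ i j ≡ partGraph part₂ i j) →
    (∀ x y → edgeSign (part₁ x) (part₂ y) ≡ s) → (∀ x y → edgeSign (part₂ y) (part₁ x) ≡ s) →
    ∀ i j → join s E₁ E₂ i j ≡ partGraph ([ part₁ , part₂ ]′ ∘ splitAt a) i j
  join≡partGraph {a} s E₁ E₂ part₁ part₂ E₁≡ E₂≡ s₁₂ s₂₁ i j
    rewrite ≟-splitAt a i j with splitAt a i | splitAt a j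
  ... | inj₁ x | inj₁ y = E₁≡ x y
  ... | inj₂ x | inj₂ y = E₂≡ x y
  ... | inj₁ x | inj₂ y = cong just (sym (s₁₂ x y))
  ... | inj₂ x | inj₁ y = cong just (sym (s₂₁ y x))

  parts : ∀ l m n → Vec Part ((l ℕ.+ m) ℕ.+ n)
  parts l m n = (replicate l A ++ replicate m B) ++ replicate n N

  lookup-++ : ∀ {X : Set} {a b} (xs : Vec X a) (ys : Vec X b) i →
    lookup (xs ++ ys) i ≡ [ lookup xs , lookup ys ]′ (splitAt a i)
  lookup-++ []       ys i       = refl
  lookup-++ (x ∷ xs) ys zero    = refl
  lookup-++ {a = suc a} (x ∷ xs) ys (suc i) with splitAt a i | lookup-++ xs ys i
  ... | inj₁ _ | eq = eq
  ... | inj₂ _ | eq = eq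

  lookup-parts : ∀ l m n i →
    lookup (parts l m n) i ≡ [ [ (λ _ → A) , (λ _ → B) ]′ ∘ splitAt l , (λ _ → N) ]′ (splitAt (l ℕ.+ m) i)
  lookup-parts l m n i = trans (lookup-++ (replicate l A ++ replicate m B) (replicate n N) i) (outer (splitAt (l ℕ.+ m) i))
    where
    outer : ∀ u → [ lookup (replicate l A ++ replicate m B) , lookup (replicate n N) ]′ u
                  ≡ [ [ (λ _ → A) , (λ _ → B) ]′ ∘ splitAt l , (λ _ → N) ]′ u
    outer (inj₂ z) = VecP.lookup-replicate z N
    outer (inj₁ z) = trans (lookup-++ (replicate l A) (replicate m B) z) (inner (splitAt l z))
      where
      inner : ∀ w → [ lookup (replicate l A) , lookup (replicate m B) ]′ w ≡ [ (λ _ → A) , (λ _ → B) ]′ w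
      inner (inj₁ w) = VecP.lookup-replicate w A
      inner (inj₂ w) = VecP.lookup-replicate w B

  Σgraph≡partGraph : ∀ l m n i j → Σgraph l m n i j ≡ partGraph (lookup (parts l m n)) i j
  Σgraph≡partGraph l m n i j = trans (join≡partGraph pos _ (K neg n) _ (λ _ → N)
      (join≡partGraph neg (K pos l) (K pos m) (λ _ → A) (λ _ → B) (K≡partGraph A l) (K≡partGraph B m)
                      (λ _ _ → refl) (λ _ _ → refl))
      (K≡partGraph N n) AB-N N-AB i j)
    (cong₂ (λ u v → if does (i Fin.≟ j) then nothing else just (edgeSign u v))
           (sym (lookup-parts l m n i)) (sym (lookup-parts l m n j)))
    where
    AB-N : ∀ x y → edgeSign ([ (λ _ → A) , (λ _ → B) ]′ (splitAt l x)) N ≡ pos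
    AB-N x y with splitAt l x
    ... | inj₁ _ = refl
    ... | inj₂ _ = refl
    N-AB : ∀ x y → edgeSign N ([ (λ _ → A) , (λ _ → B) ]′ (splitAt l x)) ≡ pos
    N-AB x y with splitAt l x
    ... | inj₁ _ = refl
    ... | inj₂ _ = refl

  record Used : Set where
    constructor used
    field
      byA byB byN : List ℤ

  none : Used
  none = used [] [] []

  use : Part → ℤ → Used → Used
  use A x (used a b n) = used (x ∷ a) b n
  use B x (used a b n) = used a (x ∷ b) n
  use N x (used a b n) = used a b (x ∷ n)

  clash : Sign → ℤ → ℤ → Bool
  clash pos y x = does (y ℤ.≟ x)
  clash neg y x = does (- y ℤ.≟ x)

  clashes : Sign → ℤ → List ℤ → Bool
  clashes s y []      = false
  clashes s y (x ∷ L) = clash s y x ∨ clashes s y L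

  allowed : Part → ℤ → Used → Bool
  allowed t y (used a b n) =
    not (clashes (edgeSign t N) y n) ∧ (not (clashes (edgeSign t B) y b) ∧ not (clashes (edgeSign t A) y a))

  allowed-none : ∀ t y → allowed t y none ≡ true
  allowed-none A y = refl
  allowed-none B y = refl
  allowed-none N y = refl

  private
    true≢false : true ≢ false
    true≢false ()

    clash-lastᴬ : ∀ c p q r → p ∧ (q ∧ not (c ∨ r)) ≡ (p ∧ (q ∧ not r)) ∧ not c
    clash-lastᴬ true  p q r = trans (cong (p ∧_) (BoolP.∧-zeroʳ q)) (trans (BoolP.∧-zeroʳ p) (sym (BoolP.∧-zeroʳ _)))
    clash-lastᴬ false p q r = sym (BoolP.∧-identityʳ _)

    clash-lastᴮ : ∀ c p q r → p ∧ (not (c ∨ q) ∧ r) ≡ (p ∧ (not q ∧ r)) ∧ not c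
    clash-lastᴮ true  p q r = trans (BoolP.∧-zeroʳ p) (sym (BoolP.∧-zeroʳ _))
    clash-lastᴮ false p q r = sym (BoolP.∧-identityʳ _)

    clash-lastᴺ : ∀ c p q r → not (c ∨ p) ∧ (q ∧ r) ≡ (not p ∧ (q ∧ r)) ∧ not c
    clash-lastᴺ true  p q r = sym (BoolP.∧-zeroʳ _)
    clash-lastᴺ false p q r = sym (BoolP.∧-identityʳ _)

  allowed-use : ∀ t′ y t x P → allowed t′ y (use t x P) ≡ allowed t′ y P ∧ not (clash (edgeSign t′ t) y x)
  allowed-use t′ y A x (used a b n) =
    clash-lastᴬ (clash (edgeSign t′ A) y x) (not (clashes (edgeSign t′ N) y n)) (not (clashes (edgeSign t′ B) y b))
                (clashes (edgeSign t′ A) y a)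
  allowed-use t′ y B x (used a b n) =
    clash-lastᴮ (clash (edgeSign t′ B) y x) (not (clashes (edgeSign t′ N) y n)) (clashes (edgeSign t′ B) y b)
                (not (clashes (edgeSign t′ A) y a))
  allowed-use t′ y N x (used a b n) =
    clash-lastᴺ (clash (edgeSign t′ N) y x) (clashes (edgeSign t′ N) y n) (not (clashes (edgeSign t′ B) y b))
                (not (clashes (edgeSign t′ A) y a))

  clash≡false⇔ : ∀ s y x → clash s y x ≡ false ⇔ y ≢ ⟦ s ⟧ * x
  clash≡false⇔ s y x = mk⇔ (to s) (from s)
    where
    -y≡x⇒y≡-x : ∀ {y x} → - y ≡ x → y ≡ - x
    -y≡x⇒y≡-x {y} refl = sym (ℤP.neg-involutive y)
    to : ∀ s → clash s y x ≡ false → y ≢ ⟦ s ⟧ * x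
    to pos c≡f y≡x  = true≢false (trans (sym (dec-true (y ℤ.≟ x) (trans y≡x (ℤP.*-identityˡ x)))) c≡f)
    to neg c≡f y≡-x = true≢false (trans (sym (dec-true (- y ℤ.≟ x) -y≡x)) c≡f)
      where
      -y≡x : - y ≡ x
      -y≡x = trans (cong -_ (trans y≡-x (ℤP.-1*i≡-i x))) (ℤP.neg-involutive x)
    from : ∀ s → y ≢ ⟦ s ⟧ * x → clash s y x ≡ false
    from pos y≢x = dec-false (y ℤ.≟ x) (λ y≡x → y≢x (trans y≡x (sym (ℤP.*-identityˡ x))))
    from neg y≢-x = dec-false (- y ℤ.≟ x) (λ -y≡x → y≢-x (trans (-y≡x⇒y≡-x -y≡x) (sym (ℤP.-1*i≡-i x))))

  ≢⟦⟧-sym : ∀ s y x → y ≢ ⟦ s ⟧ * x → x ≢ ⟦ s ⟧ * y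
  ≢⟦⟧-sym pos y x y≢x x≡y = y≢x (trans (sym (trans x≡y (ℤP.*-identityˡ y))) (sym (ℤP.*-identityˡ x)))
  ≢⟦⟧-sym neg y x y≢-x x≡-y = y≢-x (trans (sym (ℤP.neg-involutive y))
    (trans (cong -_ (sym (trans x≡-y (ℤP.-1*i≡-i y)))) (sym (ℤP.-1*i≡-i x))))

  allowed-use⇔ : ∀ t′ y t x P →
    allowed t′ y (use t x P) ≡ true ⇔ (allowed t′ y P ≡ true × y ≢ ⟦ edgeSign t′ t ⟧ * x)
  allowed-use⇔ t′ y t x P = mk⇔ to from
    where
    to : allowed t′ y (use t x P) ≡ true → allowed t′ y P ≡ true × y ≢ ⟦ edgeSign t′ t ⟧ * x
    to h with allowed t′ y P | clash (edgeSign t′ t) y x in c | trans (sym (allowed-use t′ y t x P)) h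
    ... | true | false | _ = refl , Equivalence.to (clash≡false⇔ (edgeSign t′ t) y x) c
    from : allowed t′ y P ≡ true × y ≢ ⟦ edgeSign t′ t ⟧ * x → allowed t′ y (use t x P) ≡ true
    from (h , y≢) = trans (allowed-use t′ y t x P)
      (cong₂ (λ u v → u ∧ not v) h (Equivalence.from (clash≡false⇔ (edgeSign t′ t) y x) y≢))

  fits : ∀ {n} → Vec Part n → Used → Vec ℤ n → Bool
  fits []       P []      = true
  fits (t ∷ ts) P (x ∷ κ) = allowed t x P ∧ fits ts (use t x P) κ

  Compatible : ∀ {n} → Vec Part n → Used → Vec ℤ n → Set
  Compatible ts P κ = ∀ i → allowed (lookup ts i) (lookup κ i) P ≡ true

  fits-sound : ∀ {n} (ts : Vec Part n) P κ → fits ts P κ ≡ true →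
    Proper (partGraph (lookup ts)) κ × Compatible ts P κ
  fits-sound []       P []      _ = (λ ()) , (λ ())
  fits-sound (t ∷ ts) P (x ∷ κ) h with allowed t x P in x-allowed | fits ts (use t x P) κ in rest
  ... | true | true with fits-sound ts (use t x P) κ rest
  ... | proper , compatible = proper′ , compatible′
    where
    earlier : ∀ i → allowed (lookup ts i) (lookup κ i) P ≡ true × lookup κ i ≢ ⟦ edgeSign (lookup ts i) t ⟧ * x
    earlier i = Equivalence.to (allowed-use⇔ (lookup ts i) (lookup κ i) t x P) (compatible i)
    proper′ : Proper (partGraph (lookup (t ∷ ts))) (x ∷ κ)
    proper′ zero    zero    = tt
    proper′ zero    (suc j) = subst (λ s → x ≢ ⟦ s ⟧ * lookup κ j) (edgeSign-sym (lookup ts j) t)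
                                    (≢⟦⟧-sym (edgeSign (lookup ts j) t) (lookup κ j) x (proj₂ (earlier j)))
    proper′ (suc i) zero    = proj₂ (earlier i)
    proper′ (suc i) (suc j) = proper i j
    compatible′ : Compatible (t ∷ ts) P (x ∷ κ)
    compatible′ zero    = x-allowed
    compatible′ (suc i) = proj₁ (earlier i)

  fits-complete : ∀ {n} (ts : Vec Part n) P κ →
    Proper (partGraph (lookup ts)) κ → Compatible ts P κ → fits ts P κ ≡ true
  fits-complete []       P []      _      _          = refl
  fits-complete (t ∷ ts) P (x ∷ κ) proper compatible =
    cong₂ _∧_ (compatible zero)
      (fits-complete ts (use t x P) κ (λ i j → proper (suc i) (suc j))
        (λ i → Equivalence.from (allowed-use⇔ (lookup ts i) (lookup κ i) t x P) (compatible (suc i) , proper (suc i) zero)))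

  length-filter≡countTrue : ∀ {X : Set} {P : X → Set} (P? : Decidable P) (b : X → Bool) →
    (∀ x → P x → b x ≡ true) → (∀ x → b x ≡ true → P x) → ∀ xs → length (filter P? xs) ≡ countTrue b xs
  length-filter≡countTrue P? b P⇒b b⇒P []       = refl
  length-filter≡countTrue P? b P⇒b b⇒P (x ∷ xs) with P? x
  ... | yes px rewrite P⇒b x px = cong suc (length-filter≡countTrue P? b P⇒b b⇒P xs)
  ... | no ¬px with b x in bx
  ...   | true  = ⊥-elim (¬px (b⇒P x bx))
  ...   | false = length-filter≡countTrue P? b P⇒b b⇒P xs

  extensions : List ℤ → ∀ {n} → Vec Part n → Used → ℕ
  extensions C []       P = 1
  extensions C (t ∷ ts) P = sumOver C (λ x → if allowed t x P then extensions C ts (use t x P) else 0)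

  countTrue-fits : ∀ C {n} (ts : Vec Part n) P → countTrue (fits ts P) (allVecs C n) ≡ extensions C ts P
  countTrue-fits C []               P = refl
  countTrue-fits C {suc n} (t ∷ ts) P =
    trans (sumOver-concatMap (λ x → map (x ∷_) (allVecs C n)) C _)
          (sumOver-cong C (λ x _ → trans (sumOver-map (x ∷_) (allVecs C n) _) (first-colour x)))
    where
    first-colour : ∀ x → countTrue (λ κ → allowed t x P ∧ fits ts (use t x P) κ) (allVecs C n)
                         ≡ (if allowed t x P then extensions C ts (use t x P) else 0)
    first-colour x with allowed t x P
    ... | true  = countTrue-fits C ts (use t x P)
    ... | false = sumOver-zero (allVecs C n) (λ _ _ → refl)

  Proper-cong : ∀ {n} {E E′ : SGraph n} → (∀ i j → E i j ≡ E′ i j) → ∀ κ → Proper E κ → Proper E′ κ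
  Proper-cong E≡E′ κ proper i j = subst (λ e → EdgeOK e (lookup κ i) (lookup κ j)) (E≡E′ i j) (proper i j)

  f≡extensions : ∀ l m n λ′ → f (Σgraph l m n) λ′ ≡ extensions (Cλ λ′) (parts l m n) none
  f≡extensions l m n λ′ = trans
    (length-filter≡countTrue (Proper? (Σgraph l m n)) (fits (parts l m n) none)
      (λ κ proper → fits-complete (parts l m n) none κ (Proper-cong (Σgraph≡partGraph l m n) κ proper)
                                  (λ i → allowed-none (lookup (parts l m n) i) (lookup κ i)))
      (λ κ fit → Proper-cong (λ i j → sym (Σgraph≡partGraph l m n i j)) κ
                             (proj₁ (fits-sound (parts l m n) none κ fit)))
      (allVecs (Cλ λ′) ((l ℕ.+ m) ℕ.+ n)))
    (countTrue-fits (Cλ λ′) (parts l m n) none)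


module EvenCount where

  open import Data.Nat as ℕ using (ℕ; zero; suc)
  open import Data.Integer as ℤ using (ℤ; +_; -[1+_]; _+_; _-_; _*_; -_)
  import Data.Integer.Properties as ℤP
  open import Data.Integer.Tactic.RingSolver using (solve-∀)
  open import Data.Bool using (Bool; true; false; not; _∧_; _∨_; if_then_else_)
  import Data.Bool.Properties as BoolP
  open import Data.Vec using ([]; _∷_; replicate; _++_)
  open import Data.List using (List; []; _∷_; length)
  open import Data.List.Membership.Propositional using (_∈_)
  open import Data.List.Relation.Unary.Any using (here; there)
  open import Data.List.Relation.Unary.Unique.Propositional using (Unique)
  open import Relation.Nullary using (yes; no; does)
  open import Relation.Nullary.Decidable using (dec-true; dec-false)
  open import Relation.Binary.PropositionalEquality
  open import Defs using (Sign; pos; neg)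
  open ListSum
  open SequentialCount
  open BlockPoly using (polyN; polyB; polyA)
  open Expansion using (polyBN; polyΣ)

  [_]ℤ : Bool → ℤ
  [ b ]ℤ = if b then + 1 else + 0

  -- Which parts already use the colour y (⁺) and which use -y (⁻).
  record Usage : Set where
    constructor usage
    field
      A⁺ A⁻ B⁺ B⁻ N⁺ N⁻ : Bool
  open Usage

  usageOf : Used → ℤ → Usage
  usageOf (used a b n) y =
    usage (clashes pos y a) (clashes neg y a) (clashes pos y b) (clashes neg y b) (clashes pos y n) (clashes neg y n)

  opposite : Usage → Usage
  opposite (usage a a′ b b′ n n′) = usage a′ a b′ b n′ n

  usedBy : Part → Usage → Usage
  usedBy A (usage a a′ b b′ n n′) = usage true a′ b b′ n n′
  usedBy B (usage a a′ b b′ n n′) = usage a a′ true b′ n n′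
  usedBy N (usage a a′ b b′ n n′) = usage a a′ b b′ true n′

  oppositeUsedBy : Part → Usage → Usage
  oppositeUsedBy A (usage a a′ b b′ n n′) = usage a true b b′ n n′
  oppositeUsedBy B (usage a a′ b b′ n n′) = usage a a′ b true n n′
  oppositeUsedBy N (usage a a′ b b′ n n′) = usage a a′ b b′ n true

  opposite-sign : Sign → Sign
  opposite-sign pos = neg
  opposite-sign neg = pos

  select : Sign → Bool → Bool → Bool
  select pos u u′ = u
  select neg u u′ = u′

  allowedᵘ : Part → Usage → Bool
  allowedᵘ t β = not (select (edgeSign t N) (N⁺ β) (N⁻ β))
               ∧ (not (select (edgeSign t B) (B⁺ β) (B⁻ β)) ∧ not (select (edgeSign t A) (A⁺ β) (A⁻ β)))

  allowed≡allowedᵘ : ∀ t y P → allowed t y P ≡ allowedᵘ t (usageOf P y)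
  allowed≡allowedᵘ A y (used a b n) = refl
  allowed≡allowedᵘ B y (used a b n) = refl
  allowed≡allowedᵘ N y (used a b n) = refl

  -- Counted over the colours, these are the arguments y, r, ha and hb of polyN, polyB and polyA.
  freePair halfFree sharedWithA opposedInB : Usage → Bool
  freePair    β = allowedᵘ N β ∧ allowedᵘ N (opposite β)
  halfFree    β = allowedᵘ N β ∧ not (allowedᵘ N (opposite β))
  sharedWithA β = allowedᵘ B β ∧ A⁺ β
  opposedInB  β = allowedᵘ B β ∧ B⁻ β

  clashes-opposite : ∀ s x L → clashes s (- x) L ≡ clashes (opposite-sign s) x L
  clashes-opposite s   x []      = refl
  clashes-opposite pos x (c ∷ L) = cong (does (- x ℤ.≟ c) ∨_) (clashes-opposite pos x L)
  clashes-opposite neg x (c ∷ L) rewrite ℤP.neg-involutive x = cong (does (x ℤ.≟ c) ∨_) (clashes-opposite neg x L)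

  usage-neg : ∀ P x → usageOf P (- x) ≡ opposite (usageOf P x)
  usage-neg (used a b n) x
    rewrite clashes-opposite pos x a | clashes-opposite neg x a | clashes-opposite pos x b
          | clashes-opposite neg x b | clashes-opposite pos x n | clashes-opposite neg x n = refl

  private
    does-≢ : ∀ {y x} → y ≢ x → does (y ℤ.≟ x) ≡ false
    does-≢ {y} {x} = dec-false (y ℤ.≟ x)

    does-refl : ∀ x → does (x ℤ.≟ x) ≡ true
    does-refl x = dec-true (x ℤ.≟ x) refl

    -≢ : ∀ {y x} → y ≢ - x → - y ≢ x
    -≢ {y} y≢-x -y≡x = y≢-x (trans (sym (ℤP.neg-involutive y)) (cong -_ -y≡x))

  usage-elsewhere : ∀ t x P y → y ≢ x → y ≢ - x → usageOf (use t x P) y ≡ usageOf P y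
  usage-elsewhere A x (used a b n) y y≢x y≢-x rewrite does-≢ y≢x | does-≢ (-≢ y≢-x) = refl
  usage-elsewhere B x (used a b n) y y≢x y≢-x rewrite does-≢ y≢x | does-≢ (-≢ y≢-x) = refl
  usage-elsewhere N x (used a b n) y y≢x y≢-x rewrite does-≢ y≢x | does-≢ (-≢ y≢-x) = refl

  usage-self : ∀ t x P → x ≢ - x → usageOf (use t x P) x ≡ usedBy t (usageOf P x)
  usage-self A x (used a b n) x≢-x rewrite does-refl x | does-≢ (-≢ x≢-x) = refl
  usage-self B x (used a b n) x≢-x rewrite does-refl x | does-≢ (-≢ x≢-x) = refl
  usage-self N x (used a b n) x≢-x rewrite does-refl x | does-≢ (-≢ x≢-x) = refl

  usage-negated-self : ∀ t x P → x ≢ - x → usageOf (use t x P) (- x) ≡ oppositeUsedBy t (usageOf P (- x))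
  usage-negated-self A x (used a b n) x≢-x rewrite ℤP.neg-involutive x | does-refl x | does-≢ (≢-sym x≢-x) = refl
  usage-negated-self B x (used a b n) x≢-x rewrite ℤP.neg-involutive x | does-refl x | does-≢ (≢-sym x≢-x) = refl
  usage-negated-self N x (used a b n) x≢-x rewrite ℤP.neg-involutive x | does-refl x | does-≢ (≢-sym x≢-x) = refl

  +indicator : ∀ b → + (if b then 1 else 0) ≡ [ b ]ℤ
  +indicator true  = refl
  +indicator false = refl

  sumOver-split₃ : ∀ (L : List ℤ) (F : ℤ → ℕ) (b₁ b₂ b₃ : ℤ → Bool) (c₁ c₂ c₃ : ℤ) →
    (∀ x → x ∈ L → + F x ≡ [ b₁ x ]ℤ * c₁ + [ b₂ x ]ℤ * c₂ + [ b₃ x ]ℤ * c₃) →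
    + sumOver L F ≡ + countTrue b₁ L * c₁ + + countTrue b₂ L * c₂ + + countTrue b₃ L * c₃
  sumOver-split₃ []      F b₁ b₂ b₃ c₁ c₂ c₃ split = refl
  sumOver-split₃ (x ∷ L) F b₁ b₂ b₃ c₁ c₂ c₃ split = begin
    + (F x ℕ.+ sumOver L F)
      ≡⟨ ℤP.pos-+ (F x) (sumOver L F) ⟩
    + F x + + sumOver L F
      ≡⟨ cong₂ _+_ (split x (here refl)) (sumOver-split₃ L F b₁ b₂ b₃ c₁ c₂ c₃ (λ y y∈ → split y (there y∈))) ⟩
    [ b₁ x ]ℤ * c₁ + [ b₂ x ]ℤ * c₂ + [ b₃ x ]ℤ * c₃
      + (+ countTrue b₁ L * c₁ + + countTrue b₂ L * c₂ + + countTrue b₃ L * c₃)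
      ≡⟨ collect [ b₁ x ]ℤ [ b₂ x ]ℤ [ b₃ x ]ℤ (+ countTrue b₁ L) (+ countTrue b₂ L) (+ countTrue b₃ L) c₁ c₂ c₃ ⟩
    ([ b₁ x ]ℤ + + countTrue b₁ L) * c₁ + ([ b₂ x ]ℤ + + countTrue b₂ L) * c₂
      + ([ b₃ x ]ℤ + + countTrue b₃ L) * c₃
      ≡⟨ sym (cong₂ _+_ (cong₂ (λ u v → u * c₁ + v * c₂) (+count-cons b₁) (+count-cons b₂))
                        (cong (_* c₃) (+count-cons b₃))) ⟩
    + countTrue b₁ (x ∷ L) * c₁ + + countTrue b₂ (x ∷ L) * c₂ + + countTrue b₃ (x ∷ L) * c₃ ∎
    where
    open ≡-Reasoning
    collect : ∀ a b e m n o c d f → a * c + b * d + e * f + (m * c + n * d + o * f) ≡ (a + m) * c + (b + n) * d + (e + o) * f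
    collect = solve-∀
    +count-cons : ∀ b → + countTrue b (x ∷ L) ≡ [ b x ]ℤ + + countTrue b L
    +count-cons b = trans (ℤP.pos-+ (if b x then 1 else 0) _) (cong (_+ + countTrue b L) (+indicator (b x)))

  sumOver-split₂ : ∀ (L : List ℤ) (F : ℤ → ℕ) (b₁ b₂ : ℤ → Bool) (c₁ c₂ : ℤ) →
    (∀ x → x ∈ L → + F x ≡ [ b₁ x ]ℤ * c₁ + [ b₂ x ]ℤ * c₂) →
    + sumOver L F ≡ + countTrue b₁ L * c₁ + + countTrue b₂ L * c₂
  sumOver-split₂ L F b₁ b₂ c₁ c₂ split =
    trans (sumOver-split₃ L F b₁ b₂ (λ _ → false) c₁ c₂ (+ 0) (λ x x∈ → trans (split x x∈) (sym (ℤP.+-identityʳ _))))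
          (trans (cong (_+_ (+ countTrue b₁ L * c₁ + + countTrue b₂ L * c₂)) (ℤP.*-zeroʳ (+ countTrue (λ _ → false) L)))
                 (ℤP.+-identityʳ _))

  private
    cong₃ : ∀ {A : Set} (f : Usage → Usage → Usage → A) {a a′ b b′ c c′} →
      a ≡ a′ → b ≡ b′ → c ≡ c′ → f a b c ≡ f a′ b′ c′
    cong₃ f refl refl refl = refl

    polyA-cong : ∀ Θ l {y y′ h h′ k k′} → y ≡ y′ → h ≡ h′ → k ≡ k′ →
      polyA Θ l y h k ≡ polyA Θ l y′ h′ k′
    polyA-cong Θ l refl refl refl = refl

    polyB-cong : ∀ Ω m {y y′ ha ha′ hb hb′ r r′} → y ≡ y′ → ha ≡ ha′ → hb ≡ hb′ → r ≡ r′ →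
      polyB Ω m y ha hb r ≡ polyB Ω m y′ ha′ hb′ r′
    polyB-cong Ω m refl refl refl refl = refl

  module _ (C : List ℤ) (unique : Unique C) (closed : ∀ {x} → x ∈ C → - x ∈ C)
           (nonzero : ∀ {x} → x ∈ C → x ≢ + 0) where

    x≢-x : ∀ {x} → x ∈ C → x ≢ - x
    x≢-x {x} x∈ x≡-x = nonzero x∈ (self-opposite x x≡-x)
      where
      self-opposite : ∀ x → x ≡ - x → x ≡ + 0
      self-opposite (+ zero)  _ = refl
      self-opposite (+ suc n) ()
      self-opposite -[1+ n ]  ()

    countTrue-update : ∀ {x} (g g′ : ℤ → Bool) → x ∈ C → (∀ y → y ≢ x → y ≢ - x → g′ y ≡ g y) →
      + countTrue g′ C ≡ + countTrue g C + [ g′ x ]ℤ + [ g′ (- x) ]ℤ - [ g x ]ℤ - [ g (- x) ]ℤ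
    countTrue-update {x} g g′ x∈ agree = begin
      + countTrue g′ C
        ≡⟨ split g′ ⟩
      [ g′ x ]ℤ + [ g′ (- x) ]ℤ + + rest g′
        ≡⟨ cong (λ r → [ g′ x ]ℤ + [ g′ (- x) ]ℤ + + r) rest-agrees ⟩
      [ g′ x ]ℤ + [ g′ (- x) ]ℤ + + rest g
        ≡⟨ regroup [ g′ x ]ℤ [ g′ (- x) ]ℤ (+ rest g) [ g x ]ℤ [ g (- x) ]ℤ ⟩
      [ g x ]ℤ + [ g (- x) ]ℤ + + rest g + [ g′ x ]ℤ + [ g′ (- x) ]ℤ - [ g x ]ℤ - [ g (- x) ]ℤ
        ≡⟨ cong (λ c → c + [ g′ x ]ℤ + [ g′ (- x) ]ℤ - [ g x ]ℤ - [ g (- x) ]ℤ) (sym (split g)) ⟩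
      + countTrue g C + [ g′ x ]ℤ + [ g′ (- x) ]ℤ - [ g x ]ℤ - [ g (- x) ]ℤ ∎
      where
      open ≡-Reasoning
      indicator : (ℤ → Bool) → ℤ → ℕ
      indicator h y = if h y then 1 else 0
      rest : (ℤ → Bool) → ℕ
      rest h = sumOver C (erase (- x) (erase x (indicator h)))
      -x≢x : - x ≢ x
      -x≢x -x≡x = x≢-x x∈ (sym -x≡x)
      split : ∀ h → + countTrue h C ≡ [ h x ]ℤ + [ h (- x) ]ℤ + + rest h
      split h = begin
        + countTrue h C
          ≡⟨ cong +_ (sumOver-remove C unique (indicator h) x∈) ⟩
        + (indicator h x ℕ.+ sumOver C (erase x (indicator h)))
          ≡⟨ cong (λ r → + (indicator h x ℕ.+ r)) (sumOver-remove C unique (erase x (indicator h)) (closed x∈)) ⟩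
        + (indicator h x ℕ.+ (erase x (indicator h) (- x) ℕ.+ rest h))
          ≡⟨ cong (λ i → + (indicator h x ℕ.+ (i ℕ.+ rest h))) (erase-≢ (indicator h) -x≢x) ⟩
        + (indicator h x ℕ.+ (indicator h (- x) ℕ.+ rest h))
          ≡⟨ trans (ℤP.pos-+ (indicator h x) _) (cong (_+_ (+ indicator h x)) (ℤP.pos-+ (indicator h (- x)) (rest h))) ⟩
        + indicator h x + (+ indicator h (- x) + + rest h)
          ≡⟨ cong₂ (λ a b → a + (b + + rest h)) (+indicator (h x)) (+indicator (h (- x))) ⟩
        [ h x ]ℤ + ([ h (- x) ]ℤ + + rest h)
          ≡⟨ sym (ℤP.+-assoc [ h x ]ℤ _ _) ⟩
        [ h x ]ℤ + [ h (- x) ]ℤ + + rest h ∎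
      rest-agrees : rest g′ ≡ rest g
      rest-agrees = sumOver-cong C (λ y _ → outside y)
        where
        outside : ∀ y → erase (- x) (erase x (indicator g′)) y ≡ erase (- x) (erase x (indicator g)) y
        outside y with y ℤ.≟ - x | y ℤ.≟ x
        ... | yes _   | _       = refl
        ... | no _    | yes _   = refl
        ... | no y≢-x | no y≢x  = cong (λ b → if b then 1 else 0) (agree y y≢x y≢-x)
      regroup : ∀ a′ b′ r a b → a′ + b′ + r ≡ a + b + r + a′ + b′ - a - b
      regroup = solve-∀

    number : (Usage → Bool) → Used → ℕ
    number φ P = countTrue (λ y → φ (usageOf P y)) C

    -- the change of number φ when a vertex of part t takes a colour with usage β
    Δ : (Usage → Bool) → Part → Usage → ℤ
    Δ φ t β = [ φ (usedBy t β) ]ℤ + [ φ (oppositeUsedBy t (opposite β)) ]ℤ - [ φ β ]ℤ - [ φ (opposite β) ]ℤ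

    number-use : ∀ φ t P x → x ∈ C → + number φ (use t x P) ≡ + number φ P + Δ φ t (usageOf P x)
    number-use φ t P x x∈ = trans
      (countTrue-update (λ y → φ (usageOf P y)) (λ y → φ (usageOf (use t x P) y)) x∈
                        (λ y y≢x y≢-x → cong φ (usage-elsewhere t x P y y≢x y≢-x)))
      (trans (cong₃ (λ a′ b′ b → + number φ P + [ φ a′ ]ℤ + [ φ b′ ]ℤ - [ φ β ]ℤ - [ φ b ]ℤ)
                    (usage-self t x P (x≢-x x∈))
                    (trans (usage-negated-self t x P (x≢-x x∈)) (cong (oppositeUsedBy t) (usage-neg P x)))
                    (usage-neg P x))
             (regroup (+ number φ P) [ φ (usedBy t β) ]ℤ [ φ (oppositeUsedBy t (opposite β)) ]ℤ
                      [ φ β ]ℤ [ φ (opposite β) ]ℤ))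
      where
      β = usageOf P x
      regroup : ∀ n a′ b′ a b → n + a′ + b′ - a - b ≡ n + (a′ + b′ - a - b)
      regroup = solve-∀

    private
      first₂ : ∀ u v → u ≡ + 1 * u + + 0 * v
      first₂ = solve-∀
      second₂ : ∀ u v → v ≡ + 0 * u + + 1 * v
      second₂ = solve-∀
      first₃ : ∀ u v w → u ≡ + 1 * u + + 0 * v + + 0 * w
      first₃ = solve-∀
      second₃ : ∀ u v w → v ≡ + 0 * u + + 1 * v + + 0 * w
      second₃ = solve-∀
      third₃ : ∀ u v w → w ≡ + 0 * u + + 0 * v + + 1 * w
      third₃ = solve-∀
      unchanged : ∀ a → a + + 0 ≡ a
      unchanged = ℤP.+-identityʳ

    -- A new N-vertex takes a colour x of a free pair or a half-free one; any other usage forbids x.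
    extensions-N : ∀ n P → + extensions C (replicate n N) P ≡ polyN n (+ number freePair P) (+ number halfFree P)
    extensions-N zero    P = refl
    extensions-N (suc n) P =
      sumOver-split₂ C next (λ y → freePair (usageOf P y)) (λ y → halfFree (usageOf P y)) new-pair same per-colour
      where
      next : ℤ → ℕ
      next x = if allowed N x P then extensions C (replicate n N) (use N x P) else 0
      Y = + number freePair P
      R = + number halfFree P
      new-pair = polyN n (Y - + 2) (R + + 1)
      same     = polyN n Y R
      recurse : ∀ x {β} → x ∈ C → usageOf P x ≡ β →
        + extensions C (replicate n N) (use N x P) ≡ polyN n (Y + Δ freePair N β) (R + Δ halfFree N β)
      recurse x x∈ refl = trans (extensions-N n (use N x P))
                                (cong₂ (polyN n) (number-use freePair N P x x∈) (number-use halfFree N P x x∈))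
      half-free : polyN n (Y + + 0) (R + + 0) ≡ + 0 * new-pair + + 1 * same
      half-free = trans (cong₂ (polyN n) (unchanged Y) (unchanged R)) (second₂ new-pair same)
      by-usage : ∀ x → x ∈ C → ∀ β → usageOf P x ≡ β →
        + (if allowedᵘ N β then extensions C (replicate n N) (use N x P) else 0)
        ≡ [ freePair β ]ℤ * new-pair + [ halfFree β ]ℤ * same
      by-usage x x∈ (usage a a′ b b′ u true)                     _  = refl
      by-usage x x∈ (usage a a′ true b′ u false)                 _  = refl
      by-usage x x∈ (usage true a′ false b′ u false)             _  = refl
      by-usage x x∈ (usage false false false false false false) eq = trans (recurse x x∈ eq) (first₂ new-pair same)
      by-usage x x∈ (usage false a′ false b′ true false)        eq = trans (recurse x x∈ eq) half-free
      by-usage x x∈ (usage false a′ false true false false)     eq = trans (recurse x x∈ eq) half-free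
      by-usage x x∈ (usage false true false false false false)  eq = trans (recurse x x∈ eq) half-free
      per-colour : ∀ x → x ∈ C → + next x ≡ [ freePair (usageOf P x) ]ℤ * new-pair + [ halfFree (usageOf P x) ]ℤ * same
      per-colour x x∈ rewrite allowed≡allowedᵘ N x P = by-usage x x∈ (usageOf P x) refl

    -- No colour is used by A while its opposite is used by B; this keeps the colours shared with A
    -- and those opposed in B apart.
    Apart : Used → Set
    Apart P = ∀ y → A⁺ (usageOf P y) ∧ B⁻ (usageOf P y) ≡ false

    apart-use : ∀ P x → x ∈ C → Apart P → allowed B x P ≡ true → Apart (use B x P)
    apart-use P x x∈ apart x-allowed y with y ℤ.≟ x | y ℤ.≟ - x
    ... | yes refl | _ = subst (λ β → A⁺ β ∧ B⁻ β ≡ false) (sym (usage-self B y P (x≢-x x∈))) (apart y)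
    ... | no _ | yes refl = subst (λ β → A⁺ β ∧ B⁻ β ≡ false)
                                  (sym (trans (usage-negated-self B x P (x≢-x x∈)) (cong (oppositeUsedBy B) (usage-neg P x))))
                                  (cong (_∧ true) (last-conjunct {not (N⁺ (usageOf P x))} {not (B⁺ (usageOf P x))}
                                                                 (trans (sym (allowed≡allowedᵘ B x P)) x-allowed)))
      where
      last-conjunct : ∀ {p q r} → p ∧ (q ∧ not r) ≡ true → r ≡ false
      last-conjunct {true}  {true}  {false} _ = refl
      last-conjunct {true}  {true}  {true}  ()
      last-conjunct {true}  {false}         ()
      last-conjunct {false}                 ()
    ... | no y≢x | no y≢-x = subst (λ β → A⁺ β ∧ B⁻ β ≡ false) (sym (usage-elsewhere B x P y y≢x y≢-x)) (apart y)

    module _ (n : ℕ) where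

      -- A new B-vertex takes a new pair, the colour of an A-vertex, or the opposite of a B-colour.
      extensions-BN : ∀ m a b → Apart (used a b []) →
        + extensions C (replicate m B ++ replicate n N) (used a b []) ≡
        polyB (polyN n) m (+ number freePair (used a b [])) (+ number sharedWithA (used a b []))
                          (+ number opposedInB (used a b [])) (+ number halfFree (used a b []))
      extensions-BN zero    a b _     = extensions-N n (used a b [])
      extensions-BN (suc m) a b apart =
        sumOver-split₃ C next (λ y → freePair (usageOf P y)) (λ y → sharedWithA (usageOf P y)) (λ y → opposedInB (usageOf P y))
                       new-pair share-A oppose-B per-colour
        where
        P = used a b []
        next : ℤ → ℕ
        next x = if allowed B x P then extensions C (replicate m B ++ replicate n N) (use B x P) else 0
        Y  = + number freePair P
        HA = + number sharedWithA P
        HB = + number opposedInB P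
        R  = + number halfFree P
        new-pair = polyB (polyN n) m (Y - + 2) HA (HB + + 1) (R + + 1)
        share-A  = polyB (polyN n) m Y (HA - + 1) HB R
        oppose-B = polyB (polyN n) m Y HA (HB - + 1) (R - + 1)
        recurse : ∀ x {β} → x ∈ C → usageOf P x ≡ β → allowedᵘ B β ≡ true →
          + extensions C (replicate m B ++ replicate n N) (use B x P)
          ≡ polyB (polyN n) m (Y + Δ freePair B β) (HA + Δ sharedWithA B β) (HB + Δ opposedInB B β) (R + Δ halfFree B β)
        recurse x x∈ refl β-allowed =
          trans (extensions-BN m a (x ∷ b) (apart-use P x x∈ apart (trans (allowed≡allowedᵘ B x P) β-allowed)))
                (polyB-cong (polyN n) m (number-use freePair B P x x∈) (number-use sharedWithA B P x x∈)
                            (number-use opposedInB B P x x∈) (number-use halfFree B P x x∈))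
        by-usage : ∀ x → x ∈ C → ∀ a a′ b b′ → usageOf P x ≡ usage a a′ b b′ false false →
          + (if allowedᵘ B (usage a a′ b b′ false false) then extensions C (replicate m B ++ replicate n N) (use B x P) else 0)
          ≡ [ freePair (usage a a′ b b′ false false) ]ℤ * new-pair + [ sharedWithA (usage a a′ b b′ false false) ]ℤ * share-A
            + [ opposedInB (usage a a′ b b′ false false) ]ℤ * oppose-B
        by-usage x x∈ a     a′    true  b′    _  = refl
        by-usage x x∈ true  true  false false _  = refl
        by-usage x x∈ true  true  false true  _  = refl
        by-usage x x∈ false true  false false _  = refl
        by-usage x x∈ false true  false true  _  = refl
        by-usage x x∈ false false false false eq = trans (recurse x x∈ eq refl)
          (trans (polyB-cong (polyN n) m refl (unchanged HA) refl refl) (first₃ new-pair share-A oppose-B))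
        by-usage x x∈ true  false false false eq = trans (recurse x x∈ eq refl)
          (trans (polyB-cong (polyN n) m (unchanged Y) refl (unchanged HB) (unchanged R)) (second₃ new-pair share-A oppose-B))
        by-usage x x∈ false false false true  eq = trans (recurse x x∈ eq refl)
          (trans (polyB-cong (polyN n) m (unchanged Y) (unchanged HA) refl refl) (third₃ new-pair share-A oppose-B))
        by-usage x x∈ true  false false true  eq with () ← trans (cong (λ β → A⁺ β ∧ B⁻ β) (sym eq)) (apart x)
        per-colour : ∀ x → x ∈ C → + next x ≡ [ freePair (usageOf P x) ]ℤ * new-pair + [ sharedWithA (usageOf P x) ]ℤ * share-A
                                                + [ opposedInB (usageOf P x) ]ℤ * oppose-B
        per-colour x x∈ rewrite allowed≡allowedᵘ B x P =
          by-usage x x∈ (clashes pos x a) (clashes neg x a) (clashes pos x b) (clashes neg x b) refl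

      module _ (m : ℕ) where

        -- A new A-vertex takes a new pair or the opposite of an A-colour.
        extensions-ABN : ∀ l a →
          + extensions C ((replicate l A ++ replicate m B) ++ replicate n N) (used a [] []) ≡
          polyA (polyBN m n) l (+ number freePair (used a [] [])) (+ number halfFree (used a [] []))
                               (+ number sharedWithA (used a [] []))
        extensions-ABN zero    a = trans (extensions-BN m a [] (λ y → BoolP.∧-zeroʳ (A⁺ (usageOf (used a [] []) y))))
          (cong (λ hb → polyB (polyN n) m (+ number freePair P) (+ number sharedWithA P) (+ hb) (+ number halfFree P)) no-B-colours)
          where
          P = used a [] []
          no-B-colours : number opposedInB P ≡ 0
          no-B-colours = sumOver-zero C (λ y _ → cong (λ b → if b then 1 else 0) (BoolP.∧-zeroʳ (allowedᵘ B (usageOf P y))))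
        extensions-ABN (suc l) a =
          sumOver-split₂ C next (λ y → freePair (usageOf P y)) (λ y → halfFree (usageOf P y)) new-pair reuse per-colour
          where
          P = used a [] []
          next : ℤ → ℕ
          next x = if allowed A x P then extensions C ((replicate l A ++ replicate m B) ++ replicate n N) (use A x P) else 0
          Y  = + number freePair P
          R  = + number halfFree P
          HA = + number sharedWithA P
          new-pair = polyA (polyBN m n) l (Y - + 2) (R + + 1) (HA + + 1)
          reuse    = polyA (polyBN m n) l Y (R - + 1) (HA - + 1)
          recurse : ∀ x {β} → x ∈ C → usageOf P x ≡ β →
            + extensions C ((replicate l A ++ replicate m B) ++ replicate n N) (use A x P)
            ≡ polyA (polyBN m n) l (Y + Δ freePair A β) (R + Δ halfFree A β) (HA + Δ sharedWithA A β)
          recurse x x∈ refl = trans (extensions-ABN l (x ∷ a))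
            (polyA-cong (polyBN m n) l (number-use freePair A P x x∈) (number-use halfFree A P x x∈) (number-use sharedWithA A P x x∈))
          by-usage : ∀ x → x ∈ C → ∀ a a′ → usageOf P x ≡ usage a a′ false false false false →
            + (if allowedᵘ A (usage a a′ false false false false)
               then extensions C ((replicate l A ++ replicate m B) ++ replicate n N) (use A x P) else 0)
            ≡ [ freePair (usage a a′ false false false false) ]ℤ * new-pair
              + [ halfFree (usage a a′ false false false false) ]ℤ * reuse
          by-usage x x∈ true  a′    _  = refl
          by-usage x x∈ false false eq = trans (recurse x x∈ eq) (first₂ new-pair reuse)
          by-usage x x∈ false true  eq = trans (recurse x x∈ eq)
            (trans (cong (λ y → polyA (polyBN m n) l y (R - + 1) (HA - + 1)) (unchanged Y)) (second₂ new-pair reuse))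
          per-colour : ∀ x → x ∈ C → + next x ≡ [ freePair (usageOf P x) ]ℤ * new-pair + [ halfFree (usageOf P x) ]ℤ * reuse
          per-colour x x∈ rewrite allowed≡allowedᵘ A x P = by-usage x x∈ (clashes pos x a) (clashes neg x a) refl

    extensions≡polyΣ : ∀ l m n → + extensions C (parts l m n) none ≡ polyΣ l m n (+ length C)
    extensions≡polyΣ l m n = trans (extensions-ABN n m l [])
      (polyA-cong (polyBN m n) l (cong +_ (sumOver-1≡length C))
                  (cong +_ (sumOver-zero C (λ _ _ → refl))) (cong +_ (sumOver-zero C (λ _ _ → refl))))


module Colours where

  open import Data.Nat as ℕ using (ℕ; zero; suc; z≤n; s≤s)
  import Data.Nat.Properties as ℕP
  open import Data.Nat.DivMod using (_%_; m*n%n≡0; [m+kn]%n≡m%n)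
  open import Data.Integer as ℤ using (ℤ; +_; -[1+_]; _+_; _-_; -_; ∣_∣)
  import Data.Integer.Properties as ℤP
  open import Data.Integer.Tactic.RingSolver using (solve-∀)
  open import Data.List using (List; []; _∷_; length)
  open import Data.List.Membership.Propositional using (_∈_)
  open import Data.List.Membership.Propositional.Properties using (∈-filter⁺; ∈-filter⁻; ∈-map⁺; ∈-upTo⁺)
  open import Data.List.Relation.Unary.Unique.Propositional using (Unique)
  import Data.List.Relation.Unary.Unique.Propositional.Properties as UniqueP
  open import Data.List.Relation.Unary.AllPairs using (_∷_; [])
  import Data.List.Relation.Unary.All as All
  open import Data.List.Relation.Unary.Any using (here; there)
  open import Data.Sum using (inj₁; inj₂)
  open import Data.Product using (_×_; _,_; proj₁; proj₂)
  open import Data.Empty using (⊥-elim)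
  open import Function using (_⇔_; mk⇔; Equivalence)
  open import Relation.Nullary using (yes; no)
  open import Relation.Binary.PropositionalEquality
  open import Defs using (InC; InC?; range; Cλ)
  open ListSum
  open Factorials using (pos-∸)

  range-∋ : ∀ λ′ x → ∣ x ∣ ℕ.≤ λ′ → x ∈ range λ′
  range-∋ λ′ (+ a) a≤λ = subst (_∈ range λ′) (cancel (+ a) (+ λ′)) (∈-map⁺ (λ i → + i - + λ′) (∈-upTo⁺ a+λ<))
    where
    cancel : ∀ a l → a + l - l ≡ a
    cancel = solve-∀
    a+λ< : a ℕ.+ λ′ ℕ.< suc (2 ℕ.* λ′)
    a+λ< = s≤s (subst (a ℕ.+ λ′ ℕ.≤_) (cong (λ′ ℕ.+_) (sym (ℕP.+-identityʳ λ′))) (ℕP.+-monoˡ-≤ λ′ a≤λ))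
  range-∋ λ′ -[1+ a ] a<λ = subst (_∈ range λ′) (trans (cong (_- + λ′) (pos-∸ a<λ)) (cancel (+ λ′) (+ suc a)))
                                  (∈-map⁺ (λ i → + i - + λ′) (∈-upTo⁺ λ-a-1<))
    where
    cancel : ∀ l s → l - s - l ≡ - s
    cancel = solve-∀
    λ-a-1< : λ′ ℕ.∸ suc a ℕ.< suc (2 ℕ.* λ′)
    λ-a-1< = s≤s (ℕP.≤-trans (ℕP.m∸n≤m λ′ (suc a)) (ℕP.m≤m+n λ′ _))

  range-unique : ∀ λ′ → Unique (range λ′)
  range-unique λ′ = UniqueP.map⁺ shift-injective (UniqueP.upTo⁺ (suc (2 ℕ.* λ′)))
    where
    cancel : ∀ a l → a - l + l ≡ a
    cancel = solve-∀
    shift-injective : ∀ {i j} → + i - + λ′ ≡ + j - + λ′ → i ≡ j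
    shift-injective {i} {j} eq =
      ℤP.+-injective (trans (sym (cancel (+ i) (+ λ′))) (trans (cong (_+ + λ′) eq) (cancel (+ j) (+ λ′))))

  Cλ-unique : ∀ λ′ → Unique (Cλ λ′)
  Cλ-unique λ′ = UniqueP.filter⁺ (InC? λ′) (range-unique λ′)

  ∈Cλ⇔ : ∀ λ′ {x} → x ∈ Cλ λ′ ⇔ InC λ′ x
  ∈Cλ⇔ λ′ {x} = mk⇔ (λ x∈ → proj₂ (∈-filter⁻ (InC? λ′) x∈))
                     (λ h → ∈-filter⁺ (InC? λ′) (range-∋ λ′ x (bound h)) h)
    where
    a≤2a : ∀ a → a ℕ.≤ 2 ℕ.* a
    a≤2a a = ℕP.m≤m+n a _
    bound : InC λ′ x → ∣ x ∣ ℕ.≤ λ′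
    bound (inj₁ (_ , _ , 2∣x∣≤λ)) = ℕP.≤-trans (a≤2a ∣ x ∣) 2∣x∣≤λ
    bound (inj₂ (_ , 2∣x∣≤λ-1))   = ℕP.≤-trans (a≤2a ∣ x ∣) (ℕP.≤-trans 2∣x∣≤λ-1 (ℕP.m∸n≤m λ′ 1))

  module _ (k : ℕ) where

    private
      even%2 : 2 ℕ.* k % 2 ≡ 0
      even%2 = trans (cong (_% 2) (ℕP.*-comm 2 k)) (m*n%n≡0 k 2)

      odd%2 : suc (2 ℕ.* k) % 2 ≡ 1
      odd%2 = trans (cong (λ z → suc z % 2) (ℕP.*-comm 2 k)) ([m+kn]%n≡m%n 1 k 2)

      0≢1 : 0 ≢ 1
      0≢1 ()

    ∈C-even⇔ : ∀ {x} → x ∈ Cλ (2 ℕ.* k) ⇔ (x ≢ + 0 × ∣ x ∣ ℕ.≤ k)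
    ∈C-even⇔ {x} = mk⇔ (λ x∈ → to (Equivalence.to (∈Cλ⇔ (2 ℕ.* k)) x∈))
      (λ (x≢0 , ∣x∣≤k) → Equivalence.from (∈Cλ⇔ (2 ℕ.* k)) (inj₁ (even%2 , x≢0 , ℕP.*-monoʳ-≤ 2 ∣x∣≤k)))
      where
      to : InC (2 ℕ.* k) x → x ≢ + 0 × ∣ x ∣ ℕ.≤ k
      to (inj₁ (_ , x≢0 , 2∣x∣≤2k)) = x≢0 , ℕP.*-cancelˡ-≤ 2 2∣x∣≤2k
      to (inj₂ (2k%2≡1 , _))        = ⊥-elim (0≢1 (trans (sym even%2) 2k%2≡1))

    ∈C-odd⇔ : ∀ {x} → x ∈ Cλ (suc (2 ℕ.* k)) ⇔ ∣ x ∣ ℕ.≤ k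
    ∈C-odd⇔ {x} = mk⇔ (λ x∈ → to (Equivalence.to (∈Cλ⇔ (suc (2 ℕ.* k))) x∈))
      (λ ∣x∣≤k → Equivalence.from (∈Cλ⇔ (suc (2 ℕ.* k))) (inj₂ (odd%2 , ℕP.*-monoʳ-≤ 2 ∣x∣≤k)))
      where
      to : InC (suc (2 ℕ.* k)) x → ∣ x ∣ ℕ.≤ k
      to (inj₁ (2k+1%2≡0 , _)) = ⊥-elim (0≢1 (trans (sym 2k+1%2≡0) odd%2))
      to (inj₂ (_ , 2∣x∣≤2k))  = ℕP.*-cancelˡ-≤ 2 2∣x∣≤2k

    C-even-nonzero : ∀ {x} → x ∈ Cλ (2 ℕ.* k) → x ≢ + 0
    C-even-nonzero x∈ = proj₁ (Equivalence.to ∈C-even⇔ x∈)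

    C-even-closed : ∀ {x} → x ∈ Cλ (2 ℕ.* k) → - x ∈ Cλ (2 ℕ.* k)
    C-even-closed {x} x∈ with Equivalence.to ∈C-even⇔ x∈
    ... | x≢0 , ∣x∣≤k = Equivalence.from ∈C-even⇔ ((λ -x≡0 → x≢0 (trans (sym (ℤP.neg-involutive x)) (cong -_ -x≡0))) ,
                                                   subst (ℕ._≤ k) (sym (ℤP.∣-i∣≡∣i∣ x)) ∣x∣≤k)

    C-even-unique : Unique (Cλ (2 ℕ.* k))
    C-even-unique = Cλ-unique (2 ℕ.* k)

  palette : ℕ → List ℤ
  palette zero    = []
  palette (suc j) = + suc j ∷ -[1+ j ] ∷ palette j

  ∈palette⇔ : ∀ j {x} → x ∈ palette j ⇔ (x ≢ + 0 × ∣ x ∣ ℕ.≤ j)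
  ∈palette⇔ j = mk⇔ (to j) (from j)
    where
    to : ∀ j {x} → x ∈ palette j → x ≢ + 0 × ∣ x ∣ ℕ.≤ j
    to (suc j) (here refl)         = (λ ()) , ℕP.≤-refl
    to (suc j) (there (here refl)) = (λ ()) , ℕP.≤-refl
    to (suc j) (there (there x∈)) with to j x∈
    ... | x≢0 , ∣x∣≤j = x≢0 , ℕP.m≤n⇒m≤1+n ∣x∣≤j
    from : ∀ j {x} → x ≢ + 0 × ∣ x ∣ ℕ.≤ j → x ∈ palette j
    from zero    {+ zero}   (x≢0 , _) = ⊥-elim (x≢0 refl)
    from zero    {+ suc a}  (_ , ())
    from zero    { -[1+ a ]} (_ , ())
    from (suc j) {x} (x≢0 , ∣x∣≤j+1) with ∣ x ∣ ℕ.≟ suc j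
    from (suc j) {+ zero}    (x≢0 , _) | _        = ⊥-elim (x≢0 refl)
    from (suc j) {+ suc a}   _         | yes refl = here refl
    from (suc j) { -[1+ a ]} _         | yes refl = there (here refl)
    from (suc j) {x} (x≢0 , ∣x∣≤j+1)  | no ∣x∣≢j+1 =
      there (there (from j (x≢0 , ℕP.≤-pred (ℕP.≤∧≢⇒< ∣x∣≤j+1 ∣x∣≢j+1))))

  palette-unique : ∀ j → Unique (palette j)
  palette-unique zero    = []
  palette-unique (suc j) = All.tabulate first-fresh ∷ All.tabulate (larger -[1+ j ] refl) ∷ palette-unique j
    where
    larger : ∀ z → ∣ z ∣ ≡ suc j → ∀ {y} → y ∈ palette j → z ≢ y
    larger z ∣z∣≡ y∈ z≡y =
      ℕP.<⇒≱ (ℕP.n<1+n j)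
             (subst (ℕ._≤ j) (trans (cong ∣_∣ (sym z≡y)) ∣z∣≡) (proj₂ (Equivalence.to (∈palette⇔ j) y∈)))
    first-fresh : ∀ {y} → y ∈ (-[1+ j ] ∷ palette j) → + suc j ≢ y
    first-fresh (here refl) ()
    first-fresh (there y∈)  = larger (+ suc j) refl y∈

  length-palette : ∀ j → length (palette j) ≡ 2 ℕ.* j
  length-palette zero    = refl
  length-palette (suc j) = trans (cong (λ z → suc (suc z)) (length-palette j)) (sym (ℕP.*-suc 2 j))

  module _ (k : ℕ) where

    length-C-even : length (Cλ (2 ℕ.* k)) ≡ 2 ℕ.* k
    length-C-even = begin
      length (Cλ (2 ℕ.* k))
        ≡⟨ sym (sumOver-1≡length (Cλ (2 ℕ.* k))) ⟩
      sumOver (Cλ (2 ℕ.* k)) (λ _ → 1)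
        ≡⟨ sumOver-same (Cλ (2 ℕ.* k)) (palette k) (C-even-unique k) (palette-unique k) C⊆palette palette⊆C (λ _ → 1) ⟩
      sumOver (palette k) (λ _ → 1)
        ≡⟨ sumOver-1≡length (palette k) ⟩
      length (palette k)
        ≡⟨ length-palette k ⟩
      2 ℕ.* k ∎
      where
      open ≡-Reasoning
      C⊆palette : ∀ {x} → x ∈ Cλ (2 ℕ.* k) → x ∈ palette k
      C⊆palette x∈ = Equivalence.from (∈palette⇔ k) (Equivalence.to (∈C-even⇔ k) x∈)
      palette⊆C : ∀ {x} → x ∈ palette k → x ∈ Cλ (2 ℕ.* k)
      palette⊆C x∈ = Equivalence.from (∈C-even⇔ k) (Equivalence.to (∈palette⇔ k) x∈)

    sumOver-C-odd : ∀ g → sumOver (Cλ (suc (2 ℕ.* k))) g ≡ g (+ 0) ℕ.+ sumOver (Cλ (2 ℕ.* k)) g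
    sumOver-C-odd = sumOver-same (Cλ (suc (2 ℕ.* k))) (+ 0 ∷ Cλ (2 ℕ.* k)) (Cλ-unique (suc (2 ℕ.* k)))
      (All.tabulate (λ x∈ 0≡x → C-even-nonzero k x∈ (sym 0≡x)) ∷ C-even-unique k) odd⊆ ⊆odd
      where
      odd⊆ : ∀ {x} → x ∈ Cλ (suc (2 ℕ.* k)) → x ∈ (+ 0 ∷ Cλ (2 ℕ.* k))
      odd⊆ {x} x∈ with x ℤ.≟ + 0
      ... | yes x≡0 = here x≡0
      ... | no  x≢0 = there (Equivalence.from (∈C-even⇔ k) (x≢0 , Equivalence.to (∈C-odd⇔ k) x∈))
      ⊆odd : ∀ {x} → x ∈ (+ 0 ∷ Cλ (2 ℕ.* k)) → x ∈ Cλ (suc (2 ℕ.* k))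
      ⊆odd (here refl) = Equivalence.from (∈C-odd⇔ k) z≤n
      ⊆odd (there x∈)  = Equivalence.from (∈C-odd⇔ k) (proj₂ (Equivalence.to (∈C-even⇔ k) x∈))


module ZeroColour where

  open import Data.Nat as ℕ using (ℕ; zero; suc; pred)
  import Data.Nat.Properties as ℕP
  import Data.Nat.Tactic.RingSolver as ℕSolver
  open import Data.Integer as ℤ using (ℤ; +_; -_)
  import Data.Integer.Properties as ℤP
  open import Data.Bool using (Bool; true; false; not; _∧_; if_then_else_)
  import Data.Bool.Properties as BoolP
  open import Data.Vec using (Vec; []; _∷_)
  open import Data.List using (List; []; _∷_)
  open import Data.List.Membership.Propositional using (_∈_)
  open import Data.Product using (_×_; _,_)
  open import Relation.Nullary.Decidable using (dec-false)
  open import Relation.Binary.PropositionalEquality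
  open import Defs using (pos; neg)
  open ListSum
  open SequentialCount

  extensions-colours : ∀ (L M : List ℤ) → (∀ g → sumOver L g ≡ sumOver M g) → ∀ {n} (ts : Vec Part n) P →
    extensions L ts P ≡ extensions M ts P
  extensions-colours L M same []       P = refl
  extensions-colours L M same (t ∷ ts) P =
    trans (sumOver-cong L (λ x _ → cong (λ e → if allowed t x P then e else 0) (extensions-colours L M same ts (use t x P))))
          (same _)

  private
    clash-0x : ∀ s {x} → x ≢ + 0 → clash s (+ 0) x ≡ false
    clash-0x pos x≢0 = dec-false (+ 0 ℤ.≟ _) (λ 0≡x → x≢0 (sym 0≡x))
    clash-0x neg x≢0 = dec-false (+ 0 ℤ.≟ _) (λ 0≡x → x≢0 (sym 0≡x))

    clash-y0 : ∀ s {y} → y ≢ + 0 → clash s y (+ 0) ≡ false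
    clash-y0 pos y≢0 = dec-false (_ ℤ.≟ + 0) y≢0
    clash-y0 neg {y} y≢0 = dec-false (- y ℤ.≟ + 0) (λ -y≡0 → y≢0 (trans (sym (ℤP.neg-involutive y)) (cong -_ -y≡0)))

    clash-00 : ∀ s → clash s (+ 0) (+ 0) ≡ true
    clash-00 pos = refl
    clash-00 neg = refl

  -- The colour 0 clashes with itself across every edge, and Σ is complete: at most one vertex is 0.
  module _ (C : List ℤ) (nonzero : ∀ {x} → x ∈ C → x ≢ + 0) where

    ZeroFree : Used → Set
    ZeroFree P = ∀ t → allowed t (+ 0) P ≡ true

    zeroFree-none : ZeroFree none
    zeroFree-none t = allowed-none t (+ 0)

    zeroFree-use : ∀ P t x → x ≢ + 0 → ZeroFree P → ZeroFree (use t x P)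
    zeroFree-use P t x x≢0 free t′ =
      trans (allowed-use t′ (+ 0) t x P) (cong₂ _∧_ (free t′) (cong not (clash-0x (edgeSign t′ t) x≢0)))

    -- Q is P with the colour 0 used somewhere.
    ZeroUsed : Used → Used → Set
    ZeroUsed Q P = (∀ t → allowed t (+ 0) Q ≡ false) × (∀ t y → y ≢ + 0 → allowed t y Q ≡ allowed t y P)

    zeroUsed-use0 : ∀ t₀ P → ZeroUsed (use t₀ (+ 0) P) P
    zeroUsed-use0 t₀ P =
      (λ t → trans (allowed-use t (+ 0) t₀ (+ 0) P)
                   (trans (cong (λ c → allowed t (+ 0) P ∧ not c) (clash-00 (edgeSign t t₀))) (BoolP.∧-zeroʳ _))) ,
      (λ t y y≢0 → trans (allowed-use t y t₀ (+ 0) P)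
                         (trans (cong (λ c → allowed t y P ∧ not c) (clash-y0 (edgeSign t t₀) y≢0)) (BoolP.∧-identityʳ _)))

    zeroUsed-use : ∀ Q P t x → ZeroUsed Q P → ZeroUsed (use t x Q) (use t x P)
    zeroUsed-use Q P t x (0-forbidden , same) =
      (λ t′ → trans (allowed-use t′ (+ 0) t x Q) (cong (_∧ not (clash (edgeSign t′ t) (+ 0) x)) (0-forbidden t′))) ,
      (λ t′ y y≢0 → trans (allowed-use t′ y t x Q)
                          (trans (cong (_∧ not (clash (edgeSign t′ t) y x)) (same t′ y y≢0)) (sym (allowed-use t′ y t x P))))

    extensions-zeroUsed : ∀ {n} (ts : Vec Part n) Q P → ZeroUsed Q P → extensions (+ 0 ∷ C) ts Q ≡ extensions C ts P
    extensions-zeroUsed []       Q P _ = refl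
    extensions-zeroUsed (t ∷ ts) Q P zero-used@(0-forbidden , same) rewrite 0-forbidden t = sumOver-cong C per-colour
      where
      per-colour : ∀ x → x ∈ C → (if allowed t x Q then extensions (+ 0 ∷ C) ts (use t x Q) else 0)
                                 ≡ (if allowed t x P then extensions C ts (use t x P) else 0)
      per-colour x x∈ rewrite same t x (nonzero x∈) =
        cong (λ e → if allowed t x P then e else 0) (extensions-zeroUsed ts (use t x Q) (use t x P) (zeroUsed-use Q P t x zero-used))

    -- colourings from 0 ∷ C in which exactly one vertex gets the colour 0
    withZero : ∀ {n} → Vec Part n → Used → ℕ
    withZero []       P = 0
    withZero (t ∷ ts) P = extensions C ts P ℕ.+ sumOver C (λ x → if allowed t x P then withZero ts (use t x P) else 0)

    private
      if-+ : ∀ b u v → (if b then u ℕ.+ v else 0) ≡ (if b then u else 0) ℕ.+ (if b then v else 0)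
      if-+ true  u v = refl
      if-+ false u v = refl

      if-* : ∀ b k u → (if b then k ℕ.* u else 0) ≡ k ℕ.* (if b then u else 0)
      if-* true  k u = refl
      if-* false k u = sym (ℕP.*-zeroʳ k)

    extensions-with-zero : ∀ {n} (ts : Vec Part n) P → ZeroFree P →
      extensions (+ 0 ∷ C) ts P ≡ extensions C ts P ℕ.+ withZero ts P
    extensions-with-zero []       P _    = refl
    extensions-with-zero (t ∷ ts) P free rewrite free t = begin
      extensions (+ 0 ∷ C) ts (use t (+ 0) P) ℕ.+ sumOver C (λ x → if allowed t x P then extensions (+ 0 ∷ C) ts (use t x P) else 0)
        ≡⟨ cong₂ ℕ._+_ (extensions-zeroUsed ts (use t (+ 0) P) P (zeroUsed-use0 t P))
                       (sumOver-cong C (λ x x∈ → cong (λ e → if allowed t x P then e else 0)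
                                                      (extensions-with-zero ts (use t x P) (zeroFree-use P t x (nonzero x∈) free)))) ⟩
      extensions C ts P ℕ.+ sumOver C (λ x → if allowed t x P then extensions C ts (use t x P) ℕ.+ withZero ts (use t x P) else 0)
        ≡⟨ cong (extensions C ts P ℕ.+_) (trans (sumOver-cong C (λ x _ → if-+ (allowed t x P) _ _)) (sumOver-distrib-+ C _ _)) ⟩
      extensions C ts P ℕ.+ (extensions C (t ∷ ts) P ℕ.+ sumOver C (λ x → if allowed t x P then withZero ts (use t x P) else 0))
        ≡⟨ swap (extensions C ts P) (extensions C (t ∷ ts) P) _ ⟩
      extensions C (t ∷ ts) P ℕ.+ withZero (t ∷ ts) P ∎
      where
      open ≡-Reasoning
      swap : ∀ a b c → a ℕ.+ (b ℕ.+ c) ≡ b ℕ.+ (a ℕ.+ c)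
      swap = ℕSolver.solve-∀

    private
      sumOver-if-linear : ∀ (b : ℤ → Bool) a₁ a₂ a₃ (F₁ F₂ F₃ : ℤ → ℕ) →
        sumOver C (λ x → if b x then a₁ ℕ.* F₁ x ℕ.+ a₂ ℕ.* F₂ x ℕ.+ a₃ ℕ.* F₃ x else 0)
        ≡ a₁ ℕ.* sumOver C (λ x → if b x then F₁ x else 0) ℕ.+ a₂ ℕ.* sumOver C (λ x → if b x then F₂ x else 0)
          ℕ.+ a₃ ℕ.* sumOver C (λ x → if b x then F₃ x else 0)
      sumOver-if-linear b a₁ a₂ a₃ F₁ F₂ F₃ = begin
        sumOver C (λ x → if b x then a₁ ℕ.* F₁ x ℕ.+ a₂ ℕ.* F₂ x ℕ.+ a₃ ℕ.* F₃ x else 0)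
          ≡⟨ sumOver-cong C (λ x _ → trans (if-+ (b x) _ _) (cong₂ ℕ._+_ (if-+ (b x) _ _) refl)) ⟩
        sumOver C (λ x → part a₁ F₁ x ℕ.+ part a₂ F₂ x ℕ.+ part a₃ F₃ x)
          ≡⟨ trans (sumOver-distrib-+ C _ (part a₃ F₃))
                   (cong (ℕ._+ sumOver C (part a₃ F₃)) (sumOver-distrib-+ C (part a₁ F₁) (part a₂ F₂))) ⟩
        sumOver C (part a₁ F₁) ℕ.+ sumOver C (part a₂ F₂) ℕ.+ sumOver C (part a₃ F₃)
          ≡⟨ cong₂ ℕ._+_ (cong₂ ℕ._+_ (pull a₁ F₁) (pull a₂ F₂)) (pull a₃ F₃) ⟩
        _ ∎
        where
        open ≡-Reasoning
        part : ℕ → (ℤ → ℕ) → ℤ → ℕ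
        part a F x = if b x then a ℕ.* F x else 0
        pull : ∀ a F → sumOver C (part a F) ≡ a ℕ.* sumOver C (λ x → if b x then F x else 0)
        pull a F = trans (sumOver-cong C (λ x _ → if-* (b x) a (F x))) (sym (*-distribˡ-sumOver C a _))

    after : Part → Used → (Used → ℕ) → ℕ
    after t P F = sumOver C (λ x → if allowed t x P then F (use t x P) else 0)

    withZero-step : ∀ t {n} (ts : Vec Part n) P a b c (F₁ F₂ F₃ : Used → ℕ) →
      (∀ Q → withZero ts Q ≡ a ℕ.* F₁ Q ℕ.+ b ℕ.* F₂ Q ℕ.+ c ℕ.* F₃ Q) →
      withZero (t ∷ ts) P ≡ extensions C ts P ℕ.+ (a ℕ.* after t P F₁ ℕ.+ b ℕ.* after t P F₂ ℕ.+ c ℕ.* after t P F₃)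
    withZero-step t ts P a b c F₁ F₂ F₃ withZero≡ = cong (extensions C ts P ℕ.+_)
      (trans (sumOver-cong C (λ x _ → cong (λ w → if allowed t x P then w else 0) (withZero≡ (use t x P))))
             (sumOver-if-linear (λ x → allowed t x P) a b c
                                (λ x → F₁ (use t x P)) (λ x → F₂ (use t x P)) (λ x → F₃ (use t x P))))

    private
      *-pred : ∀ k {G H : ℕ → ℕ} → (∀ k′ → G k′ ≡ H (suc k′)) → k ℕ.* G (pred k) ≡ k ℕ.* H k
      *-pred zero    _    = refl
      *-pred (suc k) G≡H = cong (suc k ℕ.*_) (G≡H k)

    E : ℕ → ℕ → ℕ → Used → ℕ
    E l m n = extensions C (parts l m n)

    -- the vertex coloured 0 is one of the l vertices of A, m of B or n of N
    withZero-parts : ∀ l m n P →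
      withZero (parts l m n) P ≡ l ℕ.* E (pred l) m n P ℕ.+ m ℕ.* E l (pred m) n P ℕ.+ n ℕ.* E l m (pred n) P
    withZero-parts (suc l) m n P =
      trans (withZero-step A (parts l m n) P l m n _ _ _ (withZero-parts l m n))
            (trans (cong (λ u → E l m n P ℕ.+ (u ℕ.+ m ℕ.* E (suc l) (pred m) n P ℕ.+ n ℕ.* E (suc l) m (pred n) P))
                         (*-pred l {λ l′ → after A P (E l′ m n)} {λ l′ → E l′ m n P} (λ _ → refl)))
                   (regroup (E l m n P) (l ℕ.* E l m n P) _ _))
      where
      regroup : ∀ a b c d → a ℕ.+ (b ℕ.+ c ℕ.+ d) ≡ a ℕ.+ b ℕ.+ c ℕ.+ d
      regroup = ℕSolver.solve-∀
    withZero-parts zero (suc m) n P =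
      trans (withZero-step B (parts 0 m n) P 0 m n (E 0 m n) _ _ (withZero-parts 0 m n))
            (trans (cong (λ u → E 0 m n P ℕ.+ (u ℕ.+ n ℕ.* E 0 (suc m) (pred n) P))
                         (*-pred m {λ m′ → after B P (E 0 m′ n)} {λ m′ → E 0 m′ n P} (λ _ → refl)))
                   (sym (ℕP.+-assoc (E 0 m n P) _ _)))
    withZero-parts zero zero (suc n) P =
      trans (withZero-step N (parts 0 0 n) P 0 0 n (E 0 0 n) (E 0 0 n) _ (withZero-parts 0 0 n))
            (cong (E 0 0 n P ℕ.+_) (*-pred n {λ n′ → after N P (E 0 0 n′)} {λ n′ → E 0 0 n′ P} (λ _ → refl)))
    withZero-parts zero zero zero P = refl


open import Defs
open import Data.Nat using (ℕ; suc)
import Data.Nat as ℕ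
open import Data.Integer using (ℤ; +_; _+_; _-_; _*_)
open import Data.Product using (_×_)
open import Relation.Binary.PropositionalEquality using (_≡_)

open import Data.Nat using (zero; pred)
open import Data.List using (_∷_; length)
import Data.Integer.Properties as ℤP
import Data.Nat.Tactic.RingSolver as ℕSolver
open import Data.Integer.Tactic.RingSolver using (solve-∀)
open import Data.Product using (_,_)
open import Relation.Binary.PropositionalEquality using (refl; sym; trans; cong; cong₂; module ≡-Reasoning)
open SequentialCount using (parts; none; extensions; f≡extensions)
open EvenCount using (extensions≡polyΣ)
open Expansion using (polyΣ; polyΣ≡H4ℕ)
open Colours using (C-even-unique; C-even-closed; C-even-nonzero; length-C-even; sumOver-C-odd)
open ZeroColour using (extensions-colours; extensions-with-zero; zeroFree-none; withZero; withZero-parts)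

f-even : ∀ l m n k → + f (Σgraph l m n) (2 ℕ.* k) ≡ H4ℕ l m n (+ (2 ℕ.* k))
f-even l m n k = begin
  + f (Σgraph l m n) (2 ℕ.* k)
    ≡⟨ cong +_ (f≡extensions l m n (2 ℕ.* k)) ⟩
  + extensions (Cλ (2 ℕ.* k)) (parts l m n) none
    ≡⟨ extensions≡polyΣ (Cλ (2 ℕ.* k)) (C-even-unique k) (C-even-closed k) (C-even-nonzero k) l m n ⟩
  polyΣ l m n (+ length (Cλ (2 ℕ.* k)))
    ≡⟨ cong (λ c → polyΣ l m n (+ c)) (length-C-even k) ⟩
  polyΣ l m n (+ (2 ℕ.* k))
    ≡⟨ polyΣ≡H4ℕ l m n (+ (2 ℕ.* k)) ⟩
  H4ℕ l m n (+ (2 ℕ.* k)) ∎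
  where open ≡-Reasoning

f-odd-via-deletion : ∀ l m n k → f (Σgraph l m n) (suc (2 ℕ.* k))
  ≡ f (Σgraph l m n) (2 ℕ.* k) ℕ.+ l ℕ.* f (Σgraph (pred l) m n) (2 ℕ.* k)
    ℕ.+ m ℕ.* f (Σgraph l (pred m) n) (2 ℕ.* k) ℕ.+ n ℕ.* f (Σgraph l m (pred n)) (2 ℕ.* k)
f-odd-via-deletion l m n k = begin
  f (Σgraph l m n) (suc (2 ℕ.* k))
    ≡⟨ f≡extensions l m n (suc (2 ℕ.* k)) ⟩
  extensions (Cλ (suc (2 ℕ.* k))) (parts l m n) none
    ≡⟨ extensions-colours (Cλ (suc (2 ℕ.* k))) (+ 0 ∷ C₀) (sumOver-C-odd k) (parts l m n) none ⟩
  extensions (+ 0 ∷ C₀) (parts l m n) none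
    ≡⟨ extensions-with-zero C₀ (C-even-nonzero k) (parts l m n) none (zeroFree-none C₀ (C-even-nonzero k)) ⟩
  E l m n ℕ.+ withZero C₀ (C-even-nonzero k) (parts l m n) none
    ≡⟨ cong (E l m n ℕ.+_) (withZero-parts C₀ (C-even-nonzero k) l m n none) ⟩
  E l m n ℕ.+ (l ℕ.* E (pred l) m n ℕ.+ m ℕ.* E l (pred m) n ℕ.+ n ℕ.* E l m (pred n))
    ≡⟨ regroup (E l m n) _ _ _ ⟩
  E l m n ℕ.+ l ℕ.* E (pred l) m n ℕ.+ m ℕ.* E l (pred m) n ℕ.+ n ℕ.* E l m (pred n)
    ≡⟨ cong₂ ℕ._+_ (cong₂ ℕ._+_ (cong₂ (λ u v → u ℕ.+ l ℕ.* v) (E≡f l m n) (E≡f (pred l) m n))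
                                (cong (m ℕ.*_) (E≡f l (pred m) n)))
                   (cong (n ℕ.*_) (E≡f l m (pred n))) ⟩
  f₂ₖ l m n ℕ.+ l ℕ.* f₂ₖ (pred l) m n ℕ.+ m ℕ.* f₂ₖ l (pred m) n ℕ.+ n ℕ.* f₂ₖ l m (pred n) ∎
  where
  open ≡-Reasoning
  C₀ = Cλ (2 ℕ.* k)
  f₂ₖ E : ℕ → ℕ → ℕ → ℕ
  f₂ₖ a b c = f (Σgraph a b c) (2 ℕ.* k)
  E a b c = extensions C₀ (parts a b c) none
  E≡f : ∀ a b c → E a b c ≡ f₂ₖ a b c
  E≡f a b c = sym (f≡extensions a b c (2 ℕ.* k))
  regroup : ∀ a b c d → a ℕ.+ (b ℕ.+ c ℕ.+ d) ≡ a ℕ.+ b ℕ.+ c ℕ.+ d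
  regroup = ℕSolver.solve-∀

+[1+a]-1 : ∀ a → + suc a - + 1 ≡ + a
+[1+a]-1 a = cancel (+ a)
  where
  cancel : ∀ x → + 1 + x - + 1 ≡ x
  cancel = solve-∀

f-even-at-odd : ∀ l m n k → + f (Σgraph l m n) (2 ℕ.* k) ≡ H4 (+ l) (+ m) (+ n) (+ suc (2 ℕ.* k) - + 1)
f-even-at-odd l m n k = trans (f-even l m n k) (cong (H4ℕ l m n) (sym (+[1+a]-1 (2 ℕ.* k))))

scaled-by-size : ∀ a (g : ℕ → ℕ) (G : ℤ → ℤ) → (∀ a′ → + g a′ ≡ G (+ a′)) →
  + (a ℕ.* g (pred a)) ≡ + a * G (+ a - + 1)
scaled-by-size zero    g G _   = refl
scaled-by-size (suc a) g G g≡G =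
  trans (ℤP.pos-* (suc a) (g a)) (cong (+ suc a *_) (trans (g≡G a) (cong G (sym (+[1+a]-1 a)))))

pos-+₄ : ∀ a b c d → + (a ℕ.+ b ℕ.+ c ℕ.+ d) ≡ + a + + b + + c + + d
pos-+₄ a b c d =
  trans (ℤP.pos-+ _ d) (cong (_+ + d) (trans (ℤP.pos-+ _ c) (cong (_+ + c) (ℤP.pos-+ a b))))

f-odd : ∀ l m n k → + f (Σgraph l m n) (suc (2 ℕ.* k))
  ≡ + f (Σgraph l m n) (2 ℕ.* k)
    + + l * H4 (+ l - + 1) (+ m) (+ n) (+ suc (2 ℕ.* k) - + 1)
    + + m * H4 (+ l) (+ m - + 1) (+ n) (+ suc (2 ℕ.* k) - + 1)
    + + n * H4 (+ l) (+ m) (+ n - + 1) (+ suc (2 ℕ.* k) - + 1)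
f-odd l m n k = begin
  + f (Σgraph l m n) (suc (2 ℕ.* k))
    ≡⟨ cong +_ (f-odd-via-deletion l m n k) ⟩
  + (f₂ₖ l m n ℕ.+ l ℕ.* f₂ₖ (pred l) m n ℕ.+ m ℕ.* f₂ₖ l (pred m) n ℕ.+ n ℕ.* f₂ₖ l m (pred n))
    ≡⟨ pos-+₄ (f₂ₖ l m n) _ _ _ ⟩
  + f₂ₖ l m n + + (l ℕ.* f₂ₖ (pred l) m n) + + (m ℕ.* f₂ₖ l (pred m) n) + + (n ℕ.* f₂ₖ l m (pred n))
    ≡⟨ cong₂ _+_ (cong₂ _+_ (cong (_+_ (+ f₂ₖ l m n)) A-term) B-term) N-term ⟩
  + f₂ₖ l m n + + l * H4 (+ l - + 1) (+ m) (+ n) x + + m * H4 (+ l) (+ m - + 1) (+ n) x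
    + + n * H4 (+ l) (+ m) (+ n - + 1) x ∎
  where
  open ≡-Reasoning
  x = + suc (2 ℕ.* k) - + 1
  f₂ₖ : ℕ → ℕ → ℕ → ℕ
  f₂ₖ a b c = f (Σgraph a b c) (2 ℕ.* k)
  A-term : + (l ℕ.* f₂ₖ (pred l) m n) ≡ + l * H4 (+ l - + 1) (+ m) (+ n) x
  A-term = scaled-by-size l (λ a → f₂ₖ a m n) (λ z → H4 z (+ m) (+ n) x) (λ a → f-even-at-odd a m n k)
  B-term : + (m ℕ.* f₂ₖ l (pred m) n) ≡ + m * H4 (+ l) (+ m - + 1) (+ n) x
  B-term = scaled-by-size m (λ b → f₂ₖ l b n) (λ z → H4 (+ l) z (+ n) x) (λ b → f-even-at-odd l b n k)
  N-term : + (n ℕ.* f₂ₖ l m (pred n)) ≡ + n * H4 (+ l) (+ m) (+ n - + 1) x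
  N-term = scaled-by-size n (λ c → f₂ₖ l m c) (λ z → H4 (+ l) (+ m) z x) (λ c → f-even-at-odd l m c k)

proposition3p6 : (l m n : ℕ) →
    ((k : ℕ) → + f (Σgraph l m n) (2 ℕ.* k) ≡ H4 (+ l) (+ m) (+ n) (+ (2 ℕ.* k)))
    × ((k : ℕ) → + f (Σgraph l m n) (suc (2 ℕ.* k))
        ≡ + f (Σgraph l m n) (2 ℕ.* k)
          + + l * H4 (+ l - + 1) (+ m) (+ n) (+ suc (2 ℕ.* k) - + 1)
          + + m * H4 (+ l) (+ m - + 1) (+ n) (+ suc (2 ℕ.* k) - + 1)
          + + n * H4 (+ l) (+ m) (+ n - + 1) (+ suc (2 ℕ.* k) - + 1))
proposition3p6 l m n = f-even l m n , f-odd l m n
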